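{- Let $k,\ell$ be positive integers. For $n\ge1$ let $f_1(n)$ be the number of lattice paths from $(0,0)$ to $(\ell n-1,kn)$ with steps $N=(0,1)$, $E=(1,0)$ that never go above the path $(N^kE^{\ell})^{n-1}N^kE^{\ell-1}$, and set $f_1(0)=1$. Then $$F_1(x)=\sum_{n\geq 0}f_1(n)x^n=\exp \left(\sum_{n\geq 1}\binom{kn+\ell n-1}{\ell n-1}\frac{x^n}{n}\right).$$
   Context: A path given as a word in $N,E$ starts at $(0,0)$; "never goes above" means weakly below it at every point. -}

module Defs where

open import Data.Bool using (Bool; true; false; _∧_; if_then_else_)
open import Data.Nat using (ℕ; zero; suc; _+_; _*_; _∸_; _≡ᵇ_; _≤ᵇ_; NonZero)
open import Data.Nat.Combinatorics using (_C_)
open import Data.Nat.Properties using (_!≢0)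
open import Data.Nat.Base using (_!)
open import Data.Product using (_×_; _,_)
open import Data.List using (List; []; _∷_; _++_; replicate; concat; concatMap; filter; length; upTo; map; foldr)
open import Data.Bool.ListAction using (all; any)
open import Data.Integer using (+_)
import Data.Rational as ℚ
open ℚ using (ℚ)

data Step : Set where
  N E : Step

pointsFrom : ℕ × ℕ → List Step → List (ℕ × ℕ)
pointsFrom p [] = p ∷ []
pointsFrom (x , y) (N ∷ w) = (x , y) ∷ pointsFrom (x , suc y) w
pointsFrom (x , y) (E ∷ w) = (x , y) ∷ pointsFrom (suc x , y) w

points : List Step → List (ℕ × ℕ)
points = pointsFrom (0 , 0)

-- "w never goes above b": every point (x , y) of w is weakly below b,
-- i.e. b passes through some point (x , y') with y ≤ y'.
weaklyBelow : List Step → List Step → Bool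
weaklyBelow w b =
  all (λ { (x , y) → any (λ { (x' , y') → (x ≡ᵇ x') ∧ (y ≤ᵇ y') }) (points b) })
      (points w)

isN isE : Step → Bool
isN N = true
isN E = false
isE N = false
isE E = true

countN countE : List Step → ℕ
countN w = length (filter (λ s → Data.Bool.T? (isN s)) w)
  where import Data.Bool
countE w = length (filter (λ s → Data.Bool.T? (isE s)) w)
  where import Data.Bool

words : ℕ → List (List Step)
words zero = [] ∷ []
words (suc L) = concatMap (λ w → (N ∷ w) ∷ (E ∷ w) ∷ []) (words L)

pathsTo : ℕ → ℕ → List (List Step)
pathsTo a b = filter (λ w → Data.Bool.T? ((countE w ≡ᵇ a) ∧ (countN w ≡ᵇ b))) (words (a + b))
  where import Data.Bool

-- the boundary path (N^k E^ℓ)^(n-1) N^k E^(ℓ-1), for n ≥ 1 (written n = suc m)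
boundary : ℕ → ℕ → ℕ → List Step
boundary k ℓ m =
  concat (replicate m (replicate k N ++ replicate ℓ E)) ++ replicate k N ++ replicate (ℓ ∸ 1) E

f₁ : ℕ → ℕ → ℕ → ℕ
f₁ k ℓ zero = 1
f₁ k ℓ (suc m) =
  length (filter (λ w → Data.Bool.T? (weaklyBelow w (boundary k ℓ m)))
                 (pathsTo (ℓ * suc m ∸ 1) (k * suc m)))
  where import Data.Bool

PS : Set
PS = ℕ → ℚ

Σ≤ : ℕ → (ℕ → ℚ) → ℚ
Σ≤ n f = foldr (λ i acc → f i ℚ.+ acc) ℚ.0ℚ (upTo (suc n))

_⊛_ : PS → PS → PS
(f ⊛ g) n = Σ≤ n (λ i → f i ℚ.* g (n ∸ i))

onePS : PS
onePS zero = ℚ.1ℚ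
onePS (suc _) = ℚ.0ℚ

_^PS_ : PS → ℕ → PS
G ^PS zero = onePS
G ^PS suc m = G ⊛ (G ^PS m)

inv! : ℕ → ℚ
inv! m = ((+ 1) ℚ./ (m !)) {{m !≢0}}

-- exp(G) = Σ_{m ≥ 0} G^m / m!, for G with zero constant term; then
-- [x^n] G^m = 0 for m > n, so the coefficient of x^n is a finite sum.
expPS : PS → PS
expPS G n = Σ≤ n (λ m → (G ^PS m) n ℚ.* inv! m)

G₁ : ℕ → ℕ → PS
G₁ k ℓ zero = ℚ.0ℚ
G₁ k ℓ (suc m) =
  ((+ ((k * suc m + ℓ * suc m ∸ 1) C (ℓ * suc m ∸ 1))) ℚ./ suc m)

module Submission where

-- Prefix a path to (ℓn − 1, kn) by an east step and cut it into n blocks, each starting with an east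
-- step and containing ℓ of them.  Scoring a block by k minus its number of north steps turns paths
-- weakly below the boundary into excursions (all partial sums ≥ 0, total 0) and arbitrary paths into
-- bridges (total 0) of a walk with integer steps, so there are b_n = C((k+ℓ)n − 1, ℓn − 1) bridges
-- of length n.  For any such walk, cutting excursions at their last return and bridges at their first
-- and last minimum gives E = 1 + E·P and B = E·M with M + P = 1 + xP′ (P: primitive excursions);
-- eliminating P gives xE′ = (B − 1)·E, i.e. n f₁(n) = Σ_{i=1}^{n} b_i f₁(n − i).  The series exp G
-- satisfies the same recurrence because x(exp G)′ = xG′ · exp G and n G_n = b_n, and both sequences
-- start with 1.

open import Algebra.Core using (Op₂)
open import Algebra.Structures using (IsCommutativeSemiring)
open import Data.Integer using (ℤ)
open import Data.List using (List)
open import Relation.Binary.PropositionalEquality using (_≡_)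

module Series {A : Set} {plus times : Op₂ A} {zero# one# : A}
              (isCS : IsCommutativeSemiring _≡_ plus times zero# one#) where
  open import Level using (0ℓ)
  open import Algebra.Bundles using (CommutativeSemiring)
  open import Data.Bool using (Bool; true; false; T; _∧_)
  open import Data.List using (List; []; _∷_; _++_; map; concatMap; foldr; applyUpTo)
  open import Data.Nat as ℕ using (ℕ; zero; suc; _∸_; _≤_; _<_; z≤n; s≤s)
  import Data.Nat.Properties as ℕP
  open import Data.Nat.Induction using (<-rec)
  open import Function using (_∘_)
  open import Relation.Binary.PropositionalEquality
  open import Relation.Nullary using (¬_; contradiction)

  commutativeSemiring : CommutativeSemiring 0ℓ 0ℓ
  commutativeSemiring = record { isCommutativeSemiring = isCS }

  open CommutativeSemiring commutativeSemiring public
    using (_+_; _*_; 0#; 1#; +-assoc; +-comm; +-identityˡ; +-identityʳ;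
           *-assoc; *-comm; *-identityˡ; *-identityʳ; distribˡ; distribʳ; zeroˡ; zeroʳ)
  open CommutativeSemiring commutativeSemiring using (semiring; +-commutativeMonoid; +-commutativeSemigroup)
  open import Algebra.Properties.Semiring.Mult semiring public using (_×_; ×-homo-+; ×-assoc-*; ×-comm-*)
  open import Algebra.Properties.CommutativeMonoid.Mult +-commutativeMonoid using (×-distrib-+)
  open import Algebra.Properties.CommutativeSemigroup +-commutativeSemigroup using (interchange)
  open ≡-Reasoning

  ⟦_⟧ : Bool → A
  ⟦ true ⟧  = 1#
  ⟦ false ⟧ = 0#

  ⟦⟧-true : ∀ {b} → T b → ⟦ b ⟧ ≡ 1#
  ⟦⟧-true {true} _ = refl

  ⟦⟧-false : ∀ {b} → ¬ T b → ⟦ b ⟧ ≡ 0#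
  ⟦⟧-false {true}  ¬b = contradiction _ ¬b
  ⟦⟧-false {false} _  = refl

  ⟦⟧-∧ : ∀ a b → ⟦ a ∧ b ⟧ ≡ ⟦ a ⟧ * ⟦ b ⟧
  ⟦⟧-∧ true  b = sym (*-identityˡ _)
  ⟦⟧-∧ false b = sym (zeroˡ _)

  ⟦⟧-*-cong : ∀ b {x y} → (T b → x ≡ y) → ⟦ b ⟧ * x ≡ ⟦ b ⟧ * y
  ⟦⟧-*-cong true  h = cong (1# *_) (h _)
  ⟦⟧-*-cong false h = trans (zeroˡ _) (sym (zeroˡ _))

  ⟦⟧-absorb : ∀ a b x → (T b → T a) → ⟦ a ⟧ * (⟦ b ⟧ * x) ≡ ⟦ b ⟧ * x
  ⟦⟧-absorb true  b     x h = *-identityˡ _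
  ⟦⟧-absorb false true  x h = contradiction (h _) (λ ())
  ⟦⟧-absorb false false x h = trans (zeroˡ _) (sym (zeroˡ x))

  ×-zeroʳ : ∀ n → n × 0# ≡ 0#
  ×-zeroʳ zero    = refl
  ×-zeroʳ (suc n) = trans (+-identityˡ _) (×-zeroʳ n)

  Σ< : ℕ → (ℕ → A) → A
  Σ< zero    f = 0#
  Σ< (suc n) f = f 0 + Σ< n (f ∘ suc)

  Σ<-cong : ∀ n {f g : ℕ → A} → (∀ i → i < n → f i ≡ g i) → Σ< n f ≡ Σ< n g
  Σ<-cong zero    h = refl
  Σ<-cong (suc n) h = cong₂ _+_ (h 0 (s≤s z≤n)) (Σ<-cong n (λ i p → h (suc i) (s≤s p)))

  Σ<-ext : ∀ n {f g : ℕ → A} → (∀ i → f i ≡ g i) → Σ< n f ≡ Σ< n g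
  Σ<-ext n h = Σ<-cong n (λ i _ → h i)

  Σ<-zero : ∀ n → Σ< n (λ _ → 0#) ≡ 0#
  Σ<-zero zero    = refl
  Σ<-zero (suc n) = trans (+-identityˡ _) (Σ<-zero n)

  Σ<-≡0 : ∀ n {f : ℕ → A} → (∀ i → i < n → f i ≡ 0#) → Σ< n f ≡ 0#
  Σ<-≡0 n h = trans (Σ<-cong n h) (Σ<-zero n)

  Σ<-distrib-+ : ∀ n (f g : ℕ → A) → Σ< n (λ i → f i + g i) ≡ Σ< n f + Σ< n g
  Σ<-distrib-+ zero    f g = sym (+-identityˡ 0#)
  Σ<-distrib-+ (suc n) f g =
    trans (cong ((f 0 + g 0) +_) (Σ<-distrib-+ n (f ∘ suc) (g ∘ suc))) (interchange _ _ _ _)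

  Σ<-*ˡ : ∀ n c (f : ℕ → A) → Σ< n (λ i → c * f i) ≡ c * Σ< n f
  Σ<-*ˡ zero    c f = sym (zeroʳ c)
  Σ<-*ˡ (suc n) c f = trans (cong (c * f 0 +_) (Σ<-*ˡ n c (f ∘ suc))) (sym (distribˡ c _ _))

  Σ<-*ʳ : ∀ n c (f : ℕ → A) → Σ< n (λ i → f i * c) ≡ Σ< n f * c
  Σ<-*ʳ n c f = trans (Σ<-ext n (λ i → *-comm (f i) c)) (trans (Σ<-*ˡ n c f) (*-comm c _))

  ×-Σ< : ∀ c n (f : ℕ → A) → c × Σ< n f ≡ Σ< n (λ i → c × f i)
  ×-Σ< c zero    f = ×-zeroʳ c
  ×-Σ< c (suc n) f = trans (×-distrib-+ (f 0) _ c) (cong (c × f 0 +_) (×-Σ< c n (f ∘ suc)))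

  Σ<-const : ∀ n c → Σ< n (λ _ → c) ≡ n × c
  Σ<-const zero    c = refl
  Σ<-const (suc n) c = cong (c +_) (Σ<-const n c)

  Σ<-last : ∀ n (f : ℕ → A) → Σ< (suc n) f ≡ Σ< n f + f n
  Σ<-last zero    f = trans (+-identityʳ (f 0)) (sym (+-identityˡ (f 0)))
  Σ<-last (suc n) f = trans (cong (f 0 +_) (Σ<-last n (f ∘ suc))) (sym (+-assoc _ _ _))

  Σ<-split : ∀ m n (f : ℕ → A) → Σ< (m ℕ.+ n) f ≡ Σ< m f + Σ< n (λ i → f (m ℕ.+ i))
  Σ<-split zero    n f = sym (+-identityˡ _)
  Σ<-split (suc m) n f = trans (cong (f 0 +_) (Σ<-split m n (f ∘ suc))) (sym (+-assoc _ _ _))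

  Σ<-extend : ∀ {m n} (f : ℕ → A) → m ≤ n → (∀ i → m ≤ i → i < n → f i ≡ 0#) → Σ< m f ≡ Σ< n f
  Σ<-extend {m} {n} f m≤n h = begin
    Σ< m f                                   ≡⟨ sym (+-identityʳ _) ⟩
    Σ< m f + 0#                              ≡⟨ cong (Σ< m f +_) (sym (Σ<-≡0 (n ∸ m) tail≡0)) ⟩
    Σ< m f + Σ< (n ∸ m) (λ i → f (m ℕ.+ i))  ≡⟨ sym (Σ<-split m (n ∸ m) f) ⟩
    Σ< (m ℕ.+ (n ∸ m)) f                     ≡⟨ cong (λ z → Σ< z f) (ℕP.m+[n∸m]≡n m≤n) ⟩
    Σ< n f                                   ∎
    where
    tail≡0 : ∀ i → i < n ∸ m → f (m ℕ.+ i) ≡ 0#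
    tail≡0 i p = h (m ℕ.+ i) (ℕP.m≤m+n m i)
                   (subst (m ℕ.+ i <_) (ℕP.m+[n∸m]≡n m≤n) (ℕP.+-monoʳ-< m p))

  Σ<-single : ∀ n (f : ℕ → A) i₀ → i₀ < n → (∀ i → i < n → i ≢ i₀ → f i ≡ 0#) → Σ< n f ≡ f i₀
  Σ<-single (suc n) f zero _ h =
    trans (cong (f 0 +_) (Σ<-≡0 n (λ i p → h (suc i) (s≤s p) (λ ())))) (+-identityʳ _)
  Σ<-single (suc n) f (suc i₀) (s≤s p) h =
    trans (cong₂ _+_ (h 0 (s≤s z≤n) (λ ()))
                     (Σ<-single n (f ∘ suc) i₀ p (λ i q i≢i₀ → h (suc i) (s≤s q) (i≢i₀ ∘ ℕP.suc-injective))))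
          (+-identityˡ _)

  Σ<-reverse : ∀ n (f : ℕ → A) → Σ< n f ≡ Σ< n (λ i → f (n ∸ suc i))
  Σ<-reverse zero    f = refl
  Σ<-reverse (suc n) f = begin
    f 0 + Σ< n (f ∘ suc)                       ≡⟨ +-comm _ _ ⟩
    Σ< n (f ∘ suc) + f 0                       ≡⟨ cong₂ _+_ (Σ<-reverse n (f ∘ suc)) (cong f (sym (ℕP.n∸n≡0 n))) ⟩
    Σ< n (λ i → f (suc (n ∸ suc i))) + f (n ∸ n) ≡⟨ cong (_+ f (n ∸ n)) (Σ<-cong n (λ i p → cong f (sym (ℕP.+-∸-assoc 1 p)))) ⟩
    Σ< n (λ i → f (n ∸ i)) + f (n ∸ n)         ≡⟨ sym (Σ<-last n (λ i → f (n ∸ i))) ⟩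
    Σ< (suc n) (λ i → f (n ∸ i))               ∎

  Σ<-triangle : ∀ n (F : ℕ → ℕ → A) →
                Σ< (suc n) (λ i → Σ< (suc (n ∸ i)) (F i)) ≡ Σ< (suc n) (λ s → Σ< (suc s) (λ i → F i (s ∸ i)))
  Σ<-triangle zero    F = refl
  Σ<-triangle (suc n) F = begin
    (F 0 0 + row₀) + Σ< (suc n) (λ i → Σ< (suc (n ∸ i)) (F (suc i)))
      ≡⟨ cong ((F 0 0 + row₀) +_) (Σ<-triangle n (F ∘ suc)) ⟩
    (F 0 0 + row₀) + rest
      ≡⟨ +-assoc _ _ _ ⟩
    F 0 0 + (row₀ + rest)
      ≡⟨ cong₂ _+_ (sym (+-identityʳ _)) (sym (Σ<-distrib-+ (suc n) (λ s → F 0 (suc s)) (λ s → Σ< (suc s) (λ i → F (suc i) (s ∸ i))))) ⟩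
    (F 0 0 + 0#) + Σ< (suc n) (λ s → F 0 (suc s) + Σ< (suc s) (λ i → F (suc i) (s ∸ i))) ∎
    where
    row₀ rest : A
    row₀ = Σ< (suc n) (λ s → F 0 (suc s))
    rest = Σ< (suc n) (λ s → Σ< (suc s) (λ i → F (suc i) (s ∸ i)))

  Σ<-triangle-swap : ∀ n (F : ℕ → ℕ → A) →
                     Σ< (suc n) (λ i → Σ< (suc (n ∸ i)) (F i)) ≡ Σ< (suc n) (λ j → Σ< (suc (n ∸ j)) (λ i → F i j))
  Σ<-triangle-swap n F = begin
    Σ< (suc n) (λ i → Σ< (suc (n ∸ i)) (F i))                   ≡⟨ Σ<-triangle n F ⟩
    Σ< (suc n) (λ s → Σ< (suc s) (λ i → F i (s ∸ i)))           ≡⟨ Σ<-ext (suc n) (λ s → Σ<-reverse (suc s) (λ i → F i (s ∸ i))) ⟩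
    Σ< (suc n) (λ s → Σ< (suc s) (λ i → F (s ∸ i) (s ∸ (s ∸ i)))) ≡⟨ Σ<-ext (suc n) (λ s → Σ<-cong (suc s) (λ i p → cong (F (s ∸ i)) (ℕP.m∸[m∸n]≡n (ℕP.≤-pred p)))) ⟩
    Σ< (suc n) (λ s → Σ< (suc s) (λ j → F (s ∸ j) j))           ≡⟨ sym (Σ<-triangle n (λ j i → F i j)) ⟩
    Σ< (suc n) (λ j → Σ< (suc (n ∸ j)) (λ i → F i j))           ∎

  module _ {X : Set} where

    Σ∈ : List X → (X → A) → A
    Σ∈ xs f = foldr (λ x acc → f x + acc) 0# xs

    Σ∈-ext : ∀ (xs : List X) {f g : X → A} → (∀ x → f x ≡ g x) → Σ∈ xs f ≡ Σ∈ xs g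
    Σ∈-ext []       h = refl
    Σ∈-ext (x ∷ xs) h = cong₂ _+_ (h x) (Σ∈-ext xs h)

    Σ∈-zero : ∀ (xs : List X) {f : X → A} → (∀ x → f x ≡ 0#) → Σ∈ xs f ≡ 0#
    Σ∈-zero []       h = refl
    Σ∈-zero (x ∷ xs) h = trans (cong₂ _+_ (h x) (Σ∈-zero xs h)) (+-identityˡ 0#)

    Σ∈-++ : ∀ (xs ys : List X) f → Σ∈ (xs ++ ys) f ≡ Σ∈ xs f + Σ∈ ys f
    Σ∈-++ []       ys f = sym (+-identityˡ _)
    Σ∈-++ (x ∷ xs) ys f = trans (cong (f x +_) (Σ∈-++ xs ys f)) (sym (+-assoc (f x) _ _))

    Σ∈-distrib-+ : ∀ (xs : List X) f g → Σ∈ xs (λ x → f x + g x) ≡ Σ∈ xs f + Σ∈ xs g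
    Σ∈-distrib-+ []       f g = sym (+-identityˡ 0#)
    Σ∈-distrib-+ (x ∷ xs) f g = trans (cong (f x + g x +_) (Σ∈-distrib-+ xs f g)) (interchange _ _ _ _)

    Σ∈-*ˡ : ∀ (xs : List X) c f → Σ∈ xs (λ x → c * f x) ≡ c * Σ∈ xs f
    Σ∈-*ˡ []       c f = sym (zeroʳ c)
    Σ∈-*ˡ (x ∷ xs) c f = trans (cong (c * f x +_) (Σ∈-*ˡ xs c f)) (sym (distribˡ c (f x) _))

    Σ∈-*ʳ : ∀ (xs : List X) c f → Σ∈ xs (λ x → f x * c) ≡ Σ∈ xs f * c
    Σ∈-*ʳ xs c f = trans (Σ∈-ext xs (λ x → *-comm (f x) c)) (trans (Σ∈-*ˡ xs c f) (*-comm c _))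

    Σ∈-Σ< : ∀ (xs : List X) n (F : X → ℕ → A) → Σ∈ xs (λ x → Σ< n (F x)) ≡ Σ< n (λ i → Σ∈ xs (λ x → F x i))
    Σ∈-Σ< []       n F = sym (Σ<-zero n)
    Σ∈-Σ< (x ∷ xs) n F = trans (cong (Σ< n (F x) +_) (Σ∈-Σ< xs n F)) (sym (Σ<-distrib-+ n (F x) _))

  Σ∈-applyUpTo : ∀ (g : ℕ → ℕ) n f → Σ∈ (applyUpTo g n) f ≡ Σ< n (f ∘ g)
  Σ∈-applyUpTo g zero    f = refl
  Σ∈-applyUpTo g (suc n) f = cong (f (g 0) +_) (Σ∈-applyUpTo (g ∘ suc) n f)

  module _ {X Y : Set} where

    Σ∈-map : ∀ (g : X → Y) (xs : List X) f → Σ∈ (map g xs) f ≡ Σ∈ xs (f ∘ g)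
    Σ∈-map g []       f = refl
    Σ∈-map g (x ∷ xs) f = cong (f (g x) +_) (Σ∈-map g xs f)

    Σ∈-concatMap : ∀ (h : X → List Y) (xs : List X) f → Σ∈ (concatMap h xs) f ≡ Σ∈ xs (λ x → Σ∈ (h x) f)
    Σ∈-concatMap h []       f = refl
    Σ∈-concatMap h (x ∷ xs) f = trans (Σ∈-++ (h x) (concatMap h xs) f) (cong (Σ∈ (h x) f +_) (Σ∈-concatMap h xs f))

    Σ∈-swap : ∀ (xs : List X) (ys : List Y) (F : X → Y → A) →
              Σ∈ xs (λ x → Σ∈ ys (F x)) ≡ Σ∈ ys (λ y → Σ∈ xs (λ x → F x y))
    Σ∈-swap []       ys F = sym (Σ∈-zero ys (λ _ → refl))
    Σ∈-swap (x ∷ xs) ys F = trans (cong (Σ∈ ys (F x) +_) (Σ∈-swap xs ys F)) (sym (Σ∈-distrib-+ ys (F x) _))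

  infixl 7 _∗_

  _∗_ : (ℕ → A) → (ℕ → A) → ℕ → A
  (f ∗ g) n = Σ< (suc n) (λ i → f i * g (n ∸ i))

  𝟙 : ℕ → A
  𝟙 zero    = 1#
  𝟙 (suc _) = 0#

  -- The Euler operator x d/dx on coefficient sequences.
  θ : (ℕ → A) → ℕ → A
  θ f n = n × f n

  ∗-congˡ : ∀ {f f′} g n → (∀ i → f i ≡ f′ i) → (f ∗ g) n ≡ (f′ ∗ g) n
  ∗-congˡ g n e = Σ<-ext (suc n) (λ i → cong (_* g (n ∸ i)) (e i))

  ∗-congʳ : ∀ f {g g′} n → (∀ i → g i ≡ g′ i) → (f ∗ g) n ≡ (f ∗ g′) n
  ∗-congʳ f n e = Σ<-ext (suc n) (λ i → cong (f i *_) (e (n ∸ i)))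

  ∗-comm : ∀ f g n → (f ∗ g) n ≡ (g ∗ f) n
  ∗-comm f g n = begin
    Σ< (suc n) (λ i → f i * g (n ∸ i))             ≡⟨ Σ<-reverse (suc n) (λ i → f i * g (n ∸ i)) ⟩
    Σ< (suc n) (λ i → f (n ∸ i) * g (n ∸ (n ∸ i))) ≡⟨ Σ<-cong (suc n) (λ i p → trans (*-comm _ _) (cong (λ j → g j * f (n ∸ i)) (ℕP.m∸[m∸n]≡n (ℕP.≤-pred p)))) ⟩
    Σ< (suc n) (λ i → g i * f (n ∸ i))             ∎

  ∗-assoc : ∀ f g h n → ((f ∗ g) ∗ h) n ≡ (f ∗ (g ∗ h)) n
  ∗-assoc f g h n = sym (begin
    Σ< (suc n) (λ i → f i * Σ< (suc (n ∸ i)) (λ j → g j * h (n ∸ i ∸ j)))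
      ≡⟨ Σ<-ext (suc n) (λ i → sym (Σ<-*ˡ (suc (n ∸ i)) (f i) (λ j → g j * h (n ∸ i ∸ j)))) ⟩
    Σ< (suc n) (λ i → Σ< (suc (n ∸ i)) (λ j → f i * (g j * h (n ∸ i ∸ j))))
      ≡⟨ Σ<-triangle n (λ i j → f i * (g j * h (n ∸ i ∸ j))) ⟩
    Σ< (suc n) (λ s → Σ< (suc s) (λ i → f i * (g (s ∸ i) * h (n ∸ i ∸ (s ∸ i)))))
      ≡⟨ Σ<-cong (suc n) (λ s _ → Σ<-cong (suc s) (λ i i≤s →
           trans (sym (*-assoc _ _ _)) (cong (λ j → f i * g (s ∸ i) * h j) (∸-∸-cancel n (ℕP.≤-pred i≤s))))) ⟩
    Σ< (suc n) (λ s → Σ< (suc s) (λ i → f i * g (s ∸ i) * h (n ∸ s)))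
      ≡⟨ Σ<-ext (suc n) (λ s → Σ<-*ʳ (suc s) (h (n ∸ s)) (λ i → f i * g (s ∸ i))) ⟩
    Σ< (suc n) (λ s → (f ∗ g) s * h (n ∸ s)) ∎)
    where
    ∸-∸-cancel : ∀ n {i s} → i ≤ s → n ∸ i ∸ (s ∸ i) ≡ n ∸ s
    ∸-∸-cancel n {i} {s} i≤s = trans (ℕP.∸-+-assoc n i (s ∸ i)) (cong (n ∸_) (ℕP.m+[n∸m]≡n i≤s))

  ∗-distribʳ-+ : ∀ f g h n → ((λ i → f i + g i) ∗ h) n ≡ (f ∗ h) n + (g ∗ h) n
  ∗-distribʳ-+ f g h n = trans (Σ<-ext (suc n) (λ i → distribʳ (h (n ∸ i)) (f i) (g i)))
                                 (Σ<-distrib-+ (suc n) (λ i → f i * h (n ∸ i)) (λ i → g i * h (n ∸ i)))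

  ∗-distribˡ-+ : ∀ f g h n → (f ∗ (λ i → g i + h i)) n ≡ (f ∗ g) n + (f ∗ h) n
  ∗-distribˡ-+ f g h n = trans (Σ<-ext (suc n) (λ i → distribˡ (f i) (g (n ∸ i)) (h (n ∸ i))))
                                 (Σ<-distrib-+ (suc n) (λ i → f i * g (n ∸ i)) (λ i → f i * h (n ∸ i)))

  ∗-identityˡ : ∀ f n → (𝟙 ∗ f) n ≡ f n
  ∗-identityˡ f n = begin
    1# * f (n ∸ 0) + Σ< n (λ i → 0# * f (n ∸ suc i)) ≡⟨ cong₂ _+_ (*-identityˡ _) (Σ<-≡0 n (λ i _ → zeroˡ _)) ⟩
    f n + 0#                                         ≡⟨ +-identityʳ _ ⟩
    f n                                              ∎

  ∗-identityʳ : ∀ f n → (f ∗ 𝟙) n ≡ f n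
  ∗-identityʳ f n = trans (∗-comm f 𝟙 n) (∗-identityˡ f n)

  ∗-×ʳ : ∀ f g c n → (f ∗ (λ j → c × g j)) n ≡ c × (f ∗ g) n
  ∗-×ʳ f g c n = trans (Σ<-ext (suc n) (λ i → ×-comm-* c (f i) (g (n ∸ i)))) (sym (×-Σ< c (suc n) (λ i → f i * g (n ∸ i))))

  θ-+ : ∀ f g n → θ (λ i → f i + g i) n ≡ θ f n + θ g n
  θ-+ f g n = ×-distrib-+ (f n) (g n) n

  θ-𝟙 : ∀ n → θ 𝟙 n ≡ 0#
  θ-𝟙 zero    = refl
  θ-𝟙 (suc n) = ×-zeroʳ (suc n)

  θ-∗ : ∀ f g n → θ (f ∗ g) n ≡ (θ f ∗ g) n + (f ∗ θ g) n
  θ-∗ f g n = begin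
    n × Σ< (suc n) (λ i → f i * g (n ∸ i))                    ≡⟨ ×-Σ< n (suc n) (λ i → f i * g (n ∸ i)) ⟩
    Σ< (suc n) (λ i → n × (f i * g (n ∸ i)))                  ≡⟨ Σ<-cong (suc n) (λ i i≤n → leibniz i (ℕP.≤-pred i≤n)) ⟩
    Σ< (suc n) (λ i → θ f i * g (n ∸ i) + f i * θ g (n ∸ i))  ≡⟨ Σ<-distrib-+ (suc n) (λ i → θ f i * g (n ∸ i)) (λ i → f i * θ g (n ∸ i)) ⟩
    (θ f ∗ g) n + (f ∗ θ g) n                                 ∎
    where
    leibniz : ∀ i → i ≤ n → n × (f i * g (n ∸ i)) ≡ θ f i * g (n ∸ i) + f i * θ g (n ∸ i)
    leibniz i i≤n = begin
      n × (f i * g (n ∸ i))                                       ≡⟨ cong (_× (f i * g (n ∸ i))) (sym (ℕP.m+[n∸m]≡n i≤n)) ⟩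
      (i ℕ.+ (n ∸ i)) × (f i * g (n ∸ i))                         ≡⟨ ×-homo-+ _ i (n ∸ i) ⟩
      i × (f i * g (n ∸ i)) + (n ∸ i) × (f i * g (n ∸ i))         ≡⟨ cong₂ _+_ (sym (×-assoc-* i _ _)) (sym (×-comm-* (n ∸ i) _ _)) ⟩
      θ f i * g (n ∸ i) + f i * θ g (n ∸ i)                       ∎

  ∗-vanishing-head : ∀ f p n → p 0 ≡ 0# → (f ∗ p) n ≡ Σ< n (λ i → f i * p (n ∸ i))
  ∗-vanishing-head f p n p₀ = begin
    (f ∗ p) n                                  ≡⟨ Σ<-last n _ ⟩
    Σ< n (λ i → f i * p (n ∸ i)) + f n * p (n ∸ n) ≡⟨ cong (λ j → Σ< n (λ i → f i * p (n ∸ i)) + f n * p j) (ℕP.n∸n≡0 n) ⟩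
    Σ< n (λ i → f i * p (n ∸ i)) + f n * p 0   ≡⟨ cong (λ z → Σ< n (λ i → f i * p (n ∸ i)) + f n * z) p₀ ⟩
    Σ< n (λ i → f i * p (n ∸ i)) + f n * 0#    ≡⟨ cong (Σ< n (λ i → f i * p (n ∸ i)) +_) (zeroʳ _) ⟩
    Σ< n (λ i → f i * p (n ∸ i)) + 0#          ≡⟨ +-identityʳ _ ⟩
    Σ< n (λ i → f i * p (n ∸ i))               ∎

  -- The n-th coefficient of x ∗ p only involves earlier coefficients of x when p 0 = 0.
  ∗-fixpoint-unique : ∀ (x y p r : ℕ → A) → p 0 ≡ 0# →
                      (∀ n → x n ≡ (x ∗ p) n + r n) → (∀ n → y n ≡ (y ∗ p) n + r n) → ∀ n → x n ≡ y n
  ∗-fixpoint-unique x y p r p₀ hx hy = <-rec (λ i → x i ≡ y i) step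
    where
    step : ∀ i → (∀ {j} → j < i → x j ≡ y j) → x i ≡ y i
    step i earlier = begin
      x i                                    ≡⟨ hx i ⟩
      (x ∗ p) i + r i                        ≡⟨ cong (_+ r i) (∗-vanishing-head x p i p₀) ⟩
      Σ< i (λ j → x j * p (i ∸ j)) + r i     ≡⟨ cong (_+ r i) (Σ<-cong i (λ j j<i → cong (_* p (i ∸ j)) (earlier j<i))) ⟩
      Σ< i (λ j → y j * p (i ∸ j)) + r i     ≡⟨ cong (_+ r i) (sym (∗-vanishing-head y p i p₀)) ⟩
      (y ∗ p) i + r i                        ≡⟨ sym (hy i) ⟩
      y i                                    ∎

module ℕSeries where
  open import Data.Nat as ℕ using (ℕ; zero; suc)
  import Data.Nat.Properties as ℕP
  open import Relation.Binary.PropositionalEquality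

  open Series ℕP.+-*-isCommutativeSemiring public
    using (⟦_⟧; ⟦⟧-true; ⟦⟧-false; ⟦⟧-∧; ⟦⟧-*-cong; ⟦⟧-absorb;
           _∗_; 𝟙; θ; ∗-congˡ; ∗-congʳ; ∗-assoc; ∗-distribˡ-+; ∗-distribʳ-+; ∗-identityˡ; ∗-identityʳ;
           θ-+; θ-𝟙; θ-∗; ∗-fixpoint-unique;
           Σ<; Σ<-cong; Σ<-ext; Σ<-≡0; Σ<-single; Σ<-last; Σ<-const; Σ<-*ˡ; Σ<-*ʳ;
           Σ<-reverse; Σ<-triangle-swap;
           Σ∈; Σ∈-ext; Σ∈-zero; Σ∈-distrib-+; Σ∈-*ˡ; Σ∈-*ʳ; Σ∈-Σ<; Σ∈-map; Σ∈-concatMap; Σ∈-swap; Σ∈-applyUpTo)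
    renaming (_×_ to _×′_)

  ×≡* : ∀ n x → n ×′ x ≡ n ℕ.* x
  ×≡* zero    x = refl
  ×≡* (suc n) x = cong (x ℕ.+_) (×≡* n x)

module HeightProfiles where
  open import Data.Bool using (Bool; true; false; _∧_; T; T?)
  open import Data.Empty using (⊥; ⊥-elim)
  open import Algebra.Bundles using (AbelianGroup)
  open import Data.Integer as ℤ using (ℤ)
  import Data.Integer.Properties as ℤP
  open import Data.Nat as ℕ using (ℕ; zero; suc; _∸_; z≤n; s≤s; _≤ᵇ_; _≡ᵇ_)
  import Data.Nat.Properties as ℕP
  open import Data.Product using (_×_; _,_; proj₁; proj₂; ∃)
  open import Data.Sum using (inj₁; inj₂)
  open import Data.Unit using (tt)
  open import Function using (_∘_)
  open import Relation.Binary.Definitions using (tri<; tri≈; tri>)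
  open import Relation.Binary.PropositionalEquality
  open import Relation.Nullary using (yes; no; contradiction)
  open import Relation.Nullary.Decidable using (⌊_⌋; toWitness; fromWitness)

  open ℕSeries
  open import Algebra.Properties.Group (AbelianGroup.group ℤP.+-0-abelianGroup) using (\\-leftDividesʳ)

  ∧-intro : ∀ {a b} → T a → T b → T (a ∧ b)
  ∧-intro {true} {true} _ _ = tt

  ∧-elimˡ : ∀ {a b} → T (a ∧ b) → T a
  ∧-elimˡ {true} _ = tt

  ∧-elimʳ : ∀ {a b} → T (a ∧ b) → T b
  ∧-elimʳ {true} {true} _ = tt

  T-ext : ∀ {a b} → (T a → T b) → (T b → T a) → a ≡ b
  T-ext {true}  {true}  _ _ = refl
  T-ext {true}  {false} f _ = ⊥-elim (f tt)
  T-ext {false} {true}  _ g = ⊥-elim (g tt)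
  T-ext {false} {false} _ _ = refl

  ⟦⟧²-≡0 : ∀ a b → (T a → T b → ⊥) → ⟦ a ⟧ ℕ.* ⟦ b ⟧ ≡ 0
  ⟦⟧²-≡0 true  true  h = ⊥-elim (h tt tt)
  ⟦⟧²-≡0 true  false h = refl
  ⟦⟧²-≡0 false b     h = refl

  ⟦⟧²-≡1 : ∀ {a b} → T a → T b → ⟦ a ⟧ ℕ.* ⟦ b ⟧ ≡ 1
  ⟦⟧²-≡1 {true} {true} _ _ = refl

  ⟦⟧³-≡0 : ∀ a b c → (T a → T b → T c → ⊥) → ⟦ a ⟧ ℕ.* ⟦ b ⟧ ℕ.* ⟦ c ⟧ ≡ 0
  ⟦⟧³-≡0 true  true  true  h = ⊥-elim (h tt tt tt)
  ⟦⟧³-≡0 true  true  false h = refl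
  ⟦⟧³-≡0 true  false c     h = refl
  ⟦⟧³-≡0 false b     c     h = refl

  ⟦⟧³-≡1 : ∀ {a b c} → T a → T b → T c → ⟦ a ⟧ ℕ.* ⟦ b ⟧ ℕ.* ⟦ c ⟧ ≡ 1
  ⟦⟧³-≡1 {true} {true} {true} _ _ _ = refl

  all<ᵇ : ℕ → (ℕ → Bool) → Bool
  all<ᵇ zero    q = true
  all<ᵇ (suc n) q = q 0 ∧ all<ᵇ n (q ∘ suc)

  all<ᵇ-elim : ∀ n q → T (all<ᵇ n q) → ∀ t → t ℕ.< n → T (q t)
  all<ᵇ-elim (suc n) q h zero    _       = ∧-elimˡ h
  all<ᵇ-elim (suc n) q h (suc t) (s≤s p) = all<ᵇ-elim n (q ∘ suc) (∧-elimʳ {q 0} h) t p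

  all<ᵇ-intro : ∀ n q → (∀ t → t ℕ.< n → T (q t)) → T (all<ᵇ n q)
  all<ᵇ-intro zero    q h = tt
  all<ᵇ-intro (suc n) q h = ∧-intro (h 0 (s≤s z≤n)) (all<ᵇ-intro n (q ∘ suc) (λ t p → h (suc t) (s≤s p)))

  all<ᵇ-cong : ∀ n {q q′} → (∀ t → t ℕ.< n → q t ≡ q′ t) → all<ᵇ n q ≡ all<ᵇ n q′
  all<ᵇ-cong zero    h = refl
  all<ᵇ-cong (suc n) h = cong₂ _∧_ (h 0 (s≤s z≤n)) (all<ᵇ-cong n (λ t p → h (suc t) (s≤s p)))

  ltb leb eqb : ℤ → ℤ → Bool
  ltb x y = ⌊ x ℤP.<? y ⌋
  leb x y = ⌊ x ℤP.≤? y ⌋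
  eqb x y = ⌊ x ℤP.≟ y ⌋

  ltb⇒< : ∀ {x y} → T (ltb x y) → x ℤ.< y
  ltb⇒< = toWitness

  <⇒ltb : ∀ {x y} → x ℤ.< y → T (ltb x y)
  <⇒ltb = fromWitness

  leb⇒≤ : ∀ {x y} → T (leb x y) → x ℤ.≤ y
  leb⇒≤ = toWitness

  ≤⇒leb : ∀ {x y} → x ℤ.≤ y → T (leb x y)
  ≤⇒leb = fromWitness

  eqb⇒≡ : ∀ {x y} → T (eqb x y) → x ≡ y
  eqb⇒≡ = toWitness

  ≡⇒eqb : ∀ {x y} → x ≡ y → T (eqb x y)
  ≡⇒eqb = fromWitness

  -- A height profile g is read on the window [0, n]; all four predicates are relative to g 0 or g n,
  -- so they only depend on g up to an additive constant.
  excursionᵇ : (ℕ → ℤ) → ℕ → Bool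
  excursionᵇ g n = all<ᵇ (suc n) (λ t → leb (g 0) (g t)) ∧ eqb (g n) (g 0)

  aboveStartᵇ : (ℕ → ℤ) → ℕ → Bool
  aboveStartᵇ g n = all<ᵇ n (λ t → ltb (g 0) (g (suc t)))

  primitiveᵇ : (ℕ → ℤ) → ℕ → Bool
  primitiveᵇ g n = (1 ≤ᵇ n) ∧ (eqb (g n) (g 0) ∧ aboveStartᵇ g (n ∸ 1))

  aboveEndᵇ : (ℕ → ℤ) → ℕ → Bool
  aboveEndᵇ g n = all<ᵇ n (λ t → ltb (g n) (g t))

  record FirstMinimum (g : ℕ → ℤ) (n : ℕ) : Set where
    field
      pos      : ℕ
      pos≤n    : pos ℕ.≤ n
      minimal  : ∀ t → t ℕ.≤ n → g pos ℤ.≤ g t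
      first    : ∀ t → t ℕ.< pos → g pos ℤ.< g t

  record LastMinimum (g : ℕ → ℤ) (n : ℕ) : Set where
    field
      pos      : ℕ
      pos≤n    : pos ℕ.≤ n
      minimal  : ∀ t → t ℕ.≤ n → g pos ℤ.≤ g t
      last     : ∀ t → pos ℕ.< t → t ℕ.≤ n → g pos ℤ.< g t

  record LastReturn (g : ℕ → ℤ) (n : ℕ) : Set where
    field
      pos      : ℕ
      pos≤n    : pos ℕ.≤ n
      returns  : g pos ≡ g 0
      last     : ∀ t → pos ℕ.< t → t ℕ.≤ n → g t ≢ g 0

  firstMinimum : ∀ g n → FirstMinimum g n
  firstMinimum g zero    = record { pos = 0 ; pos≤n = z≤n ; minimal = λ { .0 z≤n → ℤP.≤-refl } ; first = λ t () }
  firstMinimum g (suc m) with firstMinimum g m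
  ... | record { pos = i ; pos≤n = i≤m ; minimal = min ; first = fst } with g (suc m) ℤP.<? g i
  ...   | yes new = record { pos = suc m ; pos≤n = ℕP.≤-refl ; minimal = min′ ; first = λ { t (s≤s t≤m) → ℤP.<-≤-trans new (min t t≤m) } }
    where
    min′ : ∀ t → t ℕ.≤ suc m → g (suc m) ℤ.≤ g t
    min′ t t≤ with ℕP.m≤n⇒m<n∨m≡n t≤
    ... | inj₁ (s≤s t≤m) = ℤP.<⇒≤ (ℤP.<-≤-trans new (min t t≤m))
    ... | inj₂ refl      = ℤP.≤-refl
  ...   | no old = record { pos = i ; pos≤n = ℕP.m≤n⇒m≤1+n i≤m ; minimal = min′ ; first = fst }
    where
    min′ : ∀ t → t ℕ.≤ suc m → g i ℤ.≤ g t
    min′ t t≤ with ℕP.m≤n⇒m<n∨m≡n t≤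
    ... | inj₁ (s≤s t≤m) = min t t≤m
    ... | inj₂ refl      = ℤP.≮⇒≥ old

  lastMinimum : ∀ g n → LastMinimum g n
  lastMinimum g zero    = record { pos = 0 ; pos≤n = z≤n ; minimal = λ { .0 z≤n → ℤP.≤-refl } ; last = λ { t () z≤n } }
  lastMinimum g (suc m) with lastMinimum g m
  ... | record { pos = k ; pos≤n = k≤m ; minimal = min ; last = lst } with g (suc m) ℤP.≤? g k
  ...   | yes new = record { pos = suc m ; pos≤n = ℕP.≤-refl ; minimal = min′ ; last = λ t p q → contradiction (ℕP.<-≤-trans p q) (ℕP.<-irrefl refl) }
    where
    min′ : ∀ t → t ℕ.≤ suc m → g (suc m) ℤ.≤ g t
    min′ t t≤ with ℕP.m≤n⇒m<n∨m≡n t≤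
    ... | inj₁ (s≤s t≤m) = ℤP.≤-trans new (min t t≤m)
    ... | inj₂ refl      = ℤP.≤-refl
  ...   | no old = record { pos = k ; pos≤n = ℕP.m≤n⇒m≤1+n k≤m ; minimal = min′ ; last = lst′ }
    where
    min′ : ∀ t → t ℕ.≤ suc m → g k ℤ.≤ g t
    min′ t t≤ with ℕP.m≤n⇒m<n∨m≡n t≤
    ... | inj₁ (s≤s t≤m) = min t t≤m
    ... | inj₂ refl      = ℤP.<⇒≤ (ℤP.≰⇒> old)
    lst′ : ∀ t → k ℕ.< t → t ℕ.≤ suc m → g k ℤ.< g t
    lst′ t p t≤ with ℕP.m≤n⇒m<n∨m≡n t≤
    ... | inj₁ (s≤s t≤m) = lst t p t≤m
    ... | inj₂ refl      = ℤP.≰⇒> old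

  lastReturn : ∀ g n → LastReturn g n
  lastReturn g zero = record { pos = 0 ; pos≤n = z≤n ; returns = refl ; last = λ { t () z≤n } }
  lastReturn g (suc m) with g (suc m) ℤP.≟ g 0
  ... | yes back = record { pos = suc m ; pos≤n = ℕP.≤-refl ; returns = back ; last = λ t p q → contradiction (ℕP.<-≤-trans p q) (ℕP.<-irrefl refl) }
  ... | no away with lastReturn g m
  ...   | record { pos = j ; pos≤n = j≤m ; returns = ret ; last = lst } =
    record { pos = j ; pos≤n = ℕP.m≤n⇒m≤1+n j≤m ; returns = ret ; last = lst′ }
    where
    lst′ : ∀ t → j ℕ.< t → t ℕ.≤ suc m → g t ≢ g 0
    lst′ t p t≤ with ℕP.m≤n⇒m<n∨m≡n t≤
    ... | inj₁ (s≤s t≤m) = lst t p t≤m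
    ... | inj₂ refl      = away

  excursion-min : ∀ g n → T (excursionᵇ g n) → ∀ t → t ℕ.≤ n → g 0 ℤ.≤ g t
  excursion-min g n h t p = leb⇒≤ (all<ᵇ-elim (suc n) (λ t → leb (g 0) (g t)) (∧-elimˡ h) t (s≤s p))

  excursion-returns : ∀ g n → T (excursionᵇ g n) → g n ≡ g 0
  excursion-returns g n h = eqb⇒≡ (∧-elimʳ {all<ᵇ (suc n) (λ t → leb (g 0) (g t))} h)

  excursion-intro : ∀ g n → (∀ t → t ℕ.≤ n → g 0 ℤ.≤ g t) → g n ≡ g 0 → T (excursionᵇ g n)
  excursion-intro g n h e = ∧-intro (all<ᵇ-intro (suc n) _ (λ t p → ≤⇒leb (h t (ℕP.≤-pred p)))) (≡⇒eqb e)

  aboveStart-elim : ∀ g n → T (aboveStartᵇ g n) → ∀ t → t ℕ.< n → g 0 ℤ.< g (suc t)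
  aboveStart-elim g n h t p = ltb⇒< (all<ᵇ-elim n (λ t → ltb (g 0) (g (suc t))) h t p)

  aboveStart-intro : ∀ g n → (∀ t → t ℕ.< n → g 0 ℤ.< g (suc t)) → T (aboveStartᵇ g n)
  aboveStart-intro g n h = all<ᵇ-intro n _ (λ t p → <⇒ltb (h t p))

  aboveEnd-elim : ∀ g n → T (aboveEndᵇ g n) → ∀ t → t ℕ.< n → g n ℤ.< g t
  aboveEnd-elim g n h t p = ltb⇒< (all<ᵇ-elim n (λ t → ltb (g n) (g t)) h t p)

  aboveEnd-intro : ∀ g n → (∀ t → t ℕ.< n → g n ℤ.< g t) → T (aboveEndᵇ g n)
  aboveEnd-intro g n h = all<ᵇ-intro n _ (λ t p → <⇒ltb (h t p))

  primitive-nonempty : ∀ g n → T (primitiveᵇ g n) → 1 ℕ.≤ n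
  primitive-nonempty g (suc n) _ = s≤s z≤n

  primitive-returns : ∀ g n → T (primitiveᵇ g n) → g n ≡ g 0
  primitive-returns g (suc n) h = eqb⇒≡ (∧-elimˡ h)

  primitive-above : ∀ g n → T (primitiveᵇ g n) → ∀ t → t ℕ.< n ∸ 1 → g 0 ℤ.< g (suc t)
  primitive-above g (suc n) h = aboveStart-elim g n (∧-elimʳ {eqb (g (suc n)) (g 0)} h)

  primitive-intro : ∀ g n → 1 ℕ.≤ n → g n ≡ g 0 → (∀ t → t ℕ.< n ∸ 1 → g 0 ℤ.< g (suc t)) → T (primitiveᵇ g n)
  primitive-intro g (suc n) _ e h = ∧-intro (≡⇒eqb e) (aboveStart-intro g n h)

  at-+0 : ∀ (g : ℕ → ℤ) i → g (i ℕ.+ 0) ≡ g i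
  at-+0 g i = cong g (ℕP.+-identityʳ i)

  +-suc-∸ : ∀ e t → e ℕ.< t → e ℕ.+ suc (t ∸ suc e) ≡ t
  +-suc-∸ e t e<t = trans (ℕP.+-suc e (t ∸ suc e)) (ℕP.m+[n∸m]≡n e<t)

  ∸-suc-<-∸ : ∀ e t n → e ℕ.< t → t ℕ.≤ n → t ∸ suc e ℕ.< n ∸ e
  ∸-suc-<-∸ e t n e<t t≤n = begin-strict
    t ∸ suc e        <⟨ ℕP.n<1+n _ ⟩
    suc (t ∸ suc e)  ≡⟨ sym (ℕP.+-∸-assoc 1 e<t) ⟩
    t ∸ e            ≤⟨ ℕP.∸-monoˡ-≤ e t≤n ⟩
    n ∸ e            ∎
    where open ℕP.≤-Reasoning

  +-suc-≤ : ∀ {j m t} → j ℕ.≤ m → t ℕ.< suc m ∸ j ∸ 1 → j ℕ.+ suc t ℕ.≤ m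
  +-suc-≤ {j} {m} {t} j≤m p = begin
    j ℕ.+ suc t    ≤⟨ ℕP.+-monoʳ-≤ j (subst (suc t ℕ.≤_) (trans (ℕP.∸-+-assoc (suc m) j 1) (cong (suc m ∸_) (ℕP.+-comm j 1))) p) ⟩
    j ℕ.+ (m ∸ j)  ≡⟨ ℕP.m+[n∸m]≡n j≤m ⟩
    m              ∎
    where open ℕP.≤-Reasoning

  -- Cutting a walk on [0, n] at its first minimum i₀ and its last minimum k₀ = i₀ + j₀ is the only way
  -- to write it as (stays strictly above its end) · (excursion) · (stays strictly above its start).
  module MinimumSplit (g : ℕ → ℤ) (n : ℕ) where
    open FirstMinimum (firstMinimum g n) renaming (pos to i₀; pos≤n to i₀≤n; minimal to i₀-min; first to i₀-first)
    open LastMinimum (lastMinimum g n) renaming (pos to k₀; pos≤n to k₀≤n; minimal to k₀-min; last to k₀-last)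

    split : ℕ → ℕ → ℕ
    split i j = ⟦ aboveEndᵇ g i ⟧ ℕ.* ⟦ excursionᵇ (λ t → g (i ℕ.+ t)) j ⟧ ℕ.* ⟦ aboveStartᵇ (λ t → g (i ℕ.+ j ℕ.+ t)) (n ∸ i ∸ j) ⟧

    j₀ : ℕ
    j₀ = k₀ ∸ i₀

    i₀≤k₀ : i₀ ℕ.≤ k₀
    i₀≤k₀ = ℕP.≮⇒≥ (λ k₀<i₀ → ℤP.<⇒≱ (i₀-first k₀ k₀<i₀) (k₀-min i₀ i₀≤n))

    i₀+j₀≡k₀ : i₀ ℕ.+ j₀ ≡ k₀
    i₀+j₀≡k₀ = ℕP.m+[n∸m]≡n i₀≤k₀

    split-unique : ∀ i j → i ℕ.≤ n → j ℕ.≤ n ∸ i → T (aboveEndᵇ g i) → T (excursionᵇ (λ t → g (i ℕ.+ t)) j) →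
                   T (aboveStartᵇ (λ t → g (i ℕ.+ j ℕ.+ t)) (n ∸ i ∸ j)) → i ≡ i₀ × j ≡ j₀
    split-unique i j i≤n j≤n∸i before middle after = i≡i₀ , j≡j₀
      where
      returns : g (i ℕ.+ j) ≡ g i
      returns = trans (excursion-returns (λ t → g (i ℕ.+ t)) j middle) (at-+0 g i)
      i+j≤n : i ℕ.+ j ℕ.≤ n
      i+j≤n = subst (i ℕ.+ j ℕ.≤_) (ℕP.m+[n∸m]≡n i≤n) (ℕP.+-monoʳ-≤ i j≤n∸i)
      above-after : ∀ t → i ℕ.+ j ℕ.< t → t ℕ.≤ n → g i ℤ.< g t
      above-after t p q = subst₂ ℤ._<_ (trans (at-+0 g (i ℕ.+ j)) returns) (cong g (+-suc-∸ (i ℕ.+ j) t p))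
        (aboveStart-elim (λ t → g (i ℕ.+ j ℕ.+ t)) (n ∸ i ∸ j) after (t ∸ suc (i ℕ.+ j))
          (subst (t ∸ suc (i ℕ.+ j) ℕ.<_) (sym (ℕP.∸-+-assoc n i j)) (∸-suc-<-∸ (i ℕ.+ j) t n p q)))
      minimal : ∀ t → t ℕ.≤ n → g i ℤ.≤ g t
      minimal t t≤n with t ℕ.<? i | t ℕ.≤? i ℕ.+ j
      ... | yes t<i | _       = ℤP.<⇒≤ (aboveEnd-elim g i before t t<i)
      ... | no t≮i  | yes t≤  = subst₂ ℤ._≤_ (at-+0 g i) (cong g (ℕP.m+[n∸m]≡n (ℕP.≮⇒≥ t≮i)))
                                  (excursion-min (λ t → g (i ℕ.+ t)) j middle (t ∸ i)
                                    (subst (t ∸ i ℕ.≤_) (ℕP.m+n∸m≡n i j) (ℕP.∸-monoˡ-≤ i t≤)))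
      ... | no _    | no t≰   = ℤP.<⇒≤ (above-after t (ℕP.≰⇒> t≰) t≤n)
      i≡i₀ : i ≡ i₀
      i≡i₀ with ℕP.<-cmp i i₀
      ... | tri< i<i₀ _ _ = contradiction (minimal i₀ i₀≤n) (ℤP.<⇒≱ (i₀-first i i<i₀))
      ... | tri≈ _ eq _   = eq
      ... | tri> _ _ i₀<i = contradiction (i₀-min i i≤n) (ℤP.<⇒≱ (aboveEnd-elim g i before i₀ i₀<i))
      i+j≡k₀ : i ℕ.+ j ≡ k₀
      i+j≡k₀ with ℕP.<-cmp (i ℕ.+ j) k₀
      ... | tri< p _ _ = contradiction (k₀-min i (ℕP.≤-trans (ℕP.m≤m+n i j) i+j≤n)) (ℤP.<⇒≱ (above-after k₀ p k₀≤n))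
      ... | tri≈ _ eq _ = eq
      ... | tri> _ _ p = contradiction (subst (ℤ._≤ g k₀) (sym returns) (minimal k₀ k₀≤n)) (ℤP.<⇒≱ (k₀-last (i ℕ.+ j) p i+j≤n))
      j≡j₀ : j ≡ j₀
      j≡j₀ = trans (sym (ℕP.m+n∸m≡n i j)) (cong₂ _∸_ i+j≡k₀ i≡i₀)

    before₀ : T (aboveEndᵇ g i₀)
    before₀ = aboveEnd-intro g i₀ i₀-first

    middle₀ : T (excursionᵇ (λ t → g (i₀ ℕ.+ t)) j₀)
    middle₀ = excursion-intro (λ t → g (i₀ ℕ.+ t)) j₀
      (λ t t≤j₀ → subst (ℤ._≤ g (i₀ ℕ.+ t)) (sym (at-+0 g i₀))
         (i₀-min (i₀ ℕ.+ t) (ℕP.≤-trans (subst (i₀ ℕ.+ t ℕ.≤_) i₀+j₀≡k₀ (ℕP.+-monoʳ-≤ i₀ t≤j₀)) k₀≤n)))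
      (trans (cong g i₀+j₀≡k₀) (trans (ℤP.≤-antisym (k₀-min i₀ i₀≤n) (i₀-min k₀ k₀≤n)) (sym (at-+0 g i₀))))

    after₀ : T (aboveStartᵇ (λ t → g (i₀ ℕ.+ j₀ ℕ.+ t)) (n ∸ i₀ ∸ j₀))
    after₀ = aboveStart-intro (λ t → g (i₀ ℕ.+ j₀ ℕ.+ t)) (n ∸ i₀ ∸ j₀)
      (λ t p → subst₂ ℤ._<_ (sym (trans (at-+0 g (i₀ ℕ.+ j₀)) (cong g i₀+j₀≡k₀))) (cong (λ s → g (s ℕ.+ suc t)) (sym i₀+j₀≡k₀))
                 (k₀-last (k₀ ℕ.+ suc t) (ℕP.m<m+n k₀ (s≤s z≤n)) (in-window t p)))
      where
      in-window : ∀ t → t ℕ.< n ∸ i₀ ∸ j₀ → k₀ ℕ.+ suc t ℕ.≤ n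
      in-window t p = begin
        k₀ ℕ.+ suc t    ≤⟨ ℕP.+-monoʳ-≤ k₀ (subst (suc t ℕ.≤_) (trans (ℕP.∸-+-assoc n i₀ j₀) (cong (n ∸_) i₀+j₀≡k₀)) p) ⟩
        k₀ ℕ.+ (n ∸ k₀) ≡⟨ ℕP.m+[n∸m]≡n k₀≤n ⟩
        n               ∎
        where open ℕP.≤-Reasoning

    Σsplit≡1 : Σ< (suc n) (λ i → Σ< (suc (n ∸ i)) (split i)) ≡ 1
    Σsplit≡1 = begin
      Σ< (suc n) (λ i → Σ< (suc (n ∸ i)) (split i))
        ≡⟨ Σ<-single (suc n) _ i₀ (s≤s i₀≤n) (λ i p i≢i₀ → Σ<-≡0 (suc (n ∸ i)) (λ j q →
             ⟦⟧³-≡0 _ _ _ (λ a b c → i≢i₀ (proj₁ (split-unique i j (ℕP.≤-pred p) (ℕP.≤-pred q) a b c))))) ⟩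
      Σ< (suc (n ∸ i₀)) (split i₀)
        ≡⟨ Σ<-single (suc (n ∸ i₀)) _ j₀ (s≤s (ℕP.∸-monoˡ-≤ i₀ k₀≤n)) (λ j q j≢j₀ →
             ⟦⟧³-≡0 _ _ _ (λ a b c → j≢j₀ (proj₂ (split-unique i₀ j i₀≤n (ℕP.≤-pred q) a b c)))) ⟩
      split i₀ j₀
        ≡⟨ ⟦⟧³-≡1 before₀ middle₀ after₀ ⟩
      1 ∎
      where open ≡-Reasoning

  module LastReturnSplit (g : ℕ → ℤ) where
    split : ℕ → ℕ → ℕ
    split n j = ⟦ excursionᵇ g j ⟧ ℕ.* ⟦ primitiveᵇ (λ t → g (j ℕ.+ t)) (n ∸ j) ⟧

    split-excursion : ∀ n j → j ℕ.≤ n → T (excursionᵇ g j) → T (primitiveᵇ (λ t → g (j ℕ.+ t)) (n ∸ j)) → T (excursionᵇ g n)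
    split-excursion n j j≤n init last = excursion-intro g n nonneg returns
      where
      back-at-j : g (j ℕ.+ 0) ≡ g 0
      back-at-j = trans (at-+0 g j) (excursion-returns g j init)
      returns : g n ≡ g 0
      returns = trans (cong g (sym (ℕP.m+[n∸m]≡n j≤n))) (trans (primitive-returns (λ t → g (j ℕ.+ t)) (n ∸ j) last) back-at-j)
      nonneg : ∀ t → t ℕ.≤ n → g 0 ℤ.≤ g t
      nonneg t t≤n with t ℕ.≤? j | ℕP.m≤n⇒m<n∨m≡n t≤n
      ... | yes t≤j | _         = excursion-min g j init t t≤j
      ... | no _    | inj₂ refl = ℤP.≤-reflexive (sym returns)
      ... | no t≰j  | inj₁ t<n  = ℤP.<⇒≤ (subst₂ ℤ._<_ back-at-j (cong g (+-suc-∸ j t (ℕP.≰⇒> t≰j)))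
          (primitive-above (λ t → g (j ℕ.+ t)) (n ∸ j) last (t ∸ suc j)
            (subst (t ∸ suc j ℕ.<_) (trans (cong (n ∸_) (ℕP.+-comm 1 j)) (sym (ℕP.∸-+-assoc n j 1)))
              (ℕP.∸-monoˡ-< t<n (ℕP.≰⇒> t≰j)))))

    excursion-split : ∀ n → ⟦ excursionᵇ g n ⟧ ≡ ⟦ n ≡ᵇ 0 ⟧ ℕ.+ Σ< (suc n) (split n)
    excursion-split zero = trans (⟦⟧-true (excursion-intro g 0 (λ { .0 z≤n → ℤP.≤-refl }) refl))
                                 (cong suc (sym (trans (ℕP.+-identityʳ _) (ℕP.*-zeroʳ ⟦ excursionᵇ g 0 ⟧))))
    excursion-split (suc m) with T? (excursionᵇ g (suc m))
    ... | no ¬exc = begin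
      ⟦ excursionᵇ g (suc m) ⟧ ≡⟨ ⟦⟧-false ¬exc ⟩
      0                        ≡⟨ sym (Σ<-≡0 (suc (suc m)) (λ j p → ⟦⟧²-≡0 _ _ (λ a b → ¬exc (split-excursion (suc m) j (ℕP.≤-pred p) a b)))) ⟩
      Σ< (suc (suc m)) (split (suc m)) ∎
      where open ≡-Reasoning
    ... | yes exc = begin
      ⟦ excursionᵇ g (suc m) ⟧ ≡⟨ ⟦⟧-true exc ⟩
      1                        ≡⟨ sym (⟦⟧²-≡1 init₀ last₀) ⟩
      split (suc m) j₀         ≡⟨ sym (Σ<-single (suc (suc m)) (split (suc m)) j₀ (s≤s (ℕP.m≤n⇒m≤1+n j₀≤m)) others) ⟩
      Σ< (suc (suc m)) (split (suc m)) ∎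
      where
      open ≡-Reasoning
      open LastReturn (lastReturn g m) renaming (pos to j₀; pos≤n to j₀≤m; returns to j₀-returns; last to j₀-last)
      n : ℕ
      n = suc m
      back-at-j₀ : g (j₀ ℕ.+ 0) ≡ g 0
      back-at-j₀ = trans (at-+0 g j₀) j₀-returns
      in-window : ∀ t → t ℕ.< n ∸ j₀ ∸ 1 → j₀ ℕ.+ suc t ℕ.≤ m
      in-window t p = +-suc-≤ j₀≤m p
      init₀ : T (excursionᵇ g j₀)
      init₀ = excursion-intro g j₀ (λ t p → excursion-min g n exc t (ℕP.≤-trans p (ℕP.m≤n⇒m≤1+n j₀≤m))) j₀-returns
      last₀ : T (primitiveᵇ (λ t → g (j₀ ℕ.+ t)) (n ∸ j₀))
      last₀ = primitive-intro (λ t → g (j₀ ℕ.+ t)) (n ∸ j₀) (ℕP.m<n⇒0<n∸m (s≤s j₀≤m))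
        (trans (cong g (ℕP.m+[n∸m]≡n (ℕP.m≤n⇒m≤1+n j₀≤m))) (trans (excursion-returns g n exc) (sym back-at-j₀)))
        (λ t p → subst (ℤ._< g (j₀ ℕ.+ suc t)) (sym back-at-j₀)
           (ℤP.≤∧≢⇒< (excursion-min g n exc (j₀ ℕ.+ suc t) (ℕP.m≤n⇒m≤1+n (in-window t p)))
                     (λ eq → j₀-last (j₀ ℕ.+ suc t) (ℕP.m<m+n j₀ (s≤s z≤n)) (in-window t p) (sym eq))))
      others : ∀ j → j ℕ.< suc n → j ≢ j₀ → split n j ≡ 0
      others j _ j≢j₀ = ⟦⟧²-≡0 _ _ impossible
        where
        impossible : T (excursionᵇ g j) → T (primitiveᵇ (λ t → g (j ℕ.+ t)) (n ∸ j)) → ⊥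
        impossible init last with ℕP.<-cmp j j₀
        ... | tri≈ _ eq _ = j≢j₀ eq
        ... | tri> _ _ j₀<j = j₀-last j j₀<j
                (ℕP.≤-pred (ℕP.m∸n≢0⇒n<m (λ z → ℕP.<⇒≢ (primitive-nonempty (λ t → g (j ℕ.+ t)) (n ∸ j) last) (sym z))))
                (excursion-returns g j init)
        ... | tri< j<j₀ _ _ = ℤP.<⇒≱
                (primitive-above (λ t → g (j ℕ.+ t)) (n ∸ j) last (j₀ ∸ suc j)
                  (subst (j₀ ∸ suc j ℕ.<_) (trans (cong (n ∸_) (ℕP.+-comm 1 j)) (sym (ℕP.∸-+-assoc n j 1))) (ℕP.∸-monoˡ-< (s≤s j₀≤m) j<j₀)))
                (ℤP.≤-reflexive (trans (cong g (+-suc-∸ j j₀ j<j₀)) (trans j₀-returns (sym (trans (at-+0 g j) (excursion-returns g j init))))))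

  module PrimitiveCuts (g : ℕ → ℤ) where
    cut : ℕ → ℕ → ℕ
    cut n c = ⟦ aboveStartᵇ g c ⟧ ℕ.* ⟦ aboveEndᵇ (λ t → g (c ℕ.+ t)) (n ∸ c) ⟧

    interior-cut : ∀ m c → c ℕ.< m → g (suc m) ≡ g 0 →
                   (aboveStartᵇ g (suc c) ∧ aboveEndᵇ (λ t → g (suc c ℕ.+ t)) (m ∸ c)) ≡ aboveStartᵇ g m
    interior-cut m c c<m back = T-ext to from
      where
      top : g (suc c ℕ.+ (m ∸ c)) ≡ g 0
      top = trans (cong (λ x → g (suc x)) (ℕP.m+[n∸m]≡n (ℕP.<⇒≤ c<m))) back
      to : T (aboveStartᵇ g (suc c) ∧ aboveEndᵇ (λ t → g (suc c ℕ.+ t)) (m ∸ c)) → T (aboveStartᵇ g m)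
      to h = aboveStart-intro g m above
        where
        above : ∀ t → t ℕ.< m → g 0 ℤ.< g (suc t)
        above t t<m with t ℕ.≤? c
        ... | yes t≤c = aboveStart-elim g (suc c) (∧-elimˡ h) t (s≤s t≤c)
        ... | no t≰c  = subst₂ ℤ._<_ top (cong (λ x → g (suc x)) (ℕP.m+[n∸m]≡n (ℕP.<⇒≤ (ℕP.≰⇒> t≰c))))
                          (aboveEnd-elim (λ t → g (suc c ℕ.+ t)) (m ∸ c) (∧-elimʳ {aboveStartᵇ g (suc c)} h) (t ∸ c)
                            (ℕP.∸-monoˡ-< t<m (ℕP.<⇒≤ (ℕP.≰⇒> t≰c))))
      from : T (aboveStartᵇ g m) → T (aboveStartᵇ g (suc c) ∧ aboveEndᵇ (λ t → g (suc c ℕ.+ t)) (m ∸ c))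
      from h = ∧-intro (aboveStart-intro g (suc c) (λ t p → aboveStart-elim g m h t (ℕP.<-≤-trans p c<m)))
        (aboveEnd-intro (λ t → g (suc c ℕ.+ t)) (m ∸ c) (λ t p → subst (ℤ._< g (suc c ℕ.+ t)) (sym top)
          (aboveStart-elim g m h (c ℕ.+ t) (subst (c ℕ.+ t ℕ.<_) (ℕP.m+[n∸m]≡n (ℕP.<⇒≤ c<m)) (ℕP.+-monoʳ-< c p)))))

    Σcut : ∀ n → g n ≡ g 0 → Σ< (suc n) (cut n) ≡ ⟦ n ≡ᵇ 0 ⟧ ℕ.+ ⟦ primitiveᵇ g n ⟧ ℕ.* (n ∸ 1)
    Σcut zero    back = refl
    Σcut (suc m) back = begin
      cut (suc m) 0 ℕ.+ Σ< (suc m) (λ c → cut (suc m) (suc c))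
        ≡⟨ cong₂ ℕ._+_ first-cut (Σ<-last m (λ c → cut (suc m) (suc c))) ⟩
      Σ< m (λ c → cut (suc m) (suc c)) ℕ.+ cut (suc m) (suc m)
        ≡⟨ trans (cong (Σ< m (λ c → cut (suc m) (suc c)) ℕ.+_) last-cut) (ℕP.+-identityʳ _) ⟩
      Σ< m (λ c → cut (suc m) (suc c))
        ≡⟨ Σ<-cong m (λ c p → trans (sym (⟦⟧-∧ (aboveStartᵇ g (suc c)) _)) (cong ⟦_⟧ (interior-cut m c p back))) ⟩
      Σ< m (λ _ → ⟦ aboveStartᵇ g m ⟧)
        ≡⟨ trans (Σ<-const m _) (trans (×≡* m _) (ℕP.*-comm m _)) ⟩
      ⟦ aboveStartᵇ g m ⟧ ℕ.* m
        ≡⟨ cong (λ b → ⟦ b ∧ aboveStartᵇ g m ⟧ ℕ.* m) (sym (⟦⟧-true-≡ (≡⇒eqb back))) ⟩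
      ⟦ primitiveᵇ g (suc m) ⟧ ℕ.* m ∎
      where
      open ≡-Reasoning
      ⟦⟧-true-≡ : ∀ {b} → T b → b ≡ true
      ⟦⟧-true-≡ {true} _ = refl
      first-cut : cut (suc m) 0 ≡ 0
      first-cut = trans (ℕP.*-identityˡ _)
        (⟦⟧-false (λ h → ℤP.<⇒≱ (aboveEnd-elim g (suc m) h 0 (s≤s z≤n)) (ℤP.≤-reflexive (sym back))))
      last-cut : cut (suc m) (suc m) ≡ 0
      last-cut = ⟦⟧²-≡0 (aboveStartᵇ g (suc m)) _ (λ h _ → ℤP.<⇒≱ (aboveStart-elim g (suc m) h m ℕP.≤-refl) (ℤP.≤-reflexive back))

  private
    cancel-shift : ∀ c x → ℤ.- c ℤ.+ (c ℤ.+ x) ≡ x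
    cancel-shift = \\-leftDividesʳ

  leb-shift : ∀ c x y → leb (c ℤ.+ x) (c ℤ.+ y) ≡ leb x y
  leb-shift c x y = T-ext
    (λ h → ≤⇒leb (subst₂ ℤ._≤_ (cancel-shift c x) (cancel-shift c y) (ℤP.+-monoʳ-≤ (ℤ.- c) (leb⇒≤ h))))
    (λ h → ≤⇒leb (ℤP.+-monoʳ-≤ c (leb⇒≤ h)))

  ltb-shift : ∀ c x y → ltb (c ℤ.+ x) (c ℤ.+ y) ≡ ltb x y
  ltb-shift c x y = T-ext
    (λ h → <⇒ltb (subst₂ ℤ._<_ (cancel-shift c x) (cancel-shift c y) (ℤP.+-monoʳ-< (ℤ.- c) (ltb⇒< h))))
    (λ h → <⇒ltb (ℤP.+-monoʳ-< c (ltb⇒< h)))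

  eqb-shift : ∀ c x y → eqb (c ℤ.+ x) (c ℤ.+ y) ≡ eqb x y
  eqb-shift c x y = T-ext
    (λ h → ≡⇒eqb (trans (sym (cancel-shift c x)) (trans (cong (λ z → ℤ.- c ℤ.+ z) (eqb⇒≡ h)) (cancel-shift c y))))
    (λ h → ≡⇒eqb (cong (λ z → c ℤ.+ z) (eqb⇒≡ h)))

  infix 4 _≈[_]_

  _≈[_]_ : (ℕ → ℤ) → ℕ → (ℕ → ℤ) → Set
  g ≈[ n ] g′ = ∃ λ c → ∀ t → t ℕ.≤ n → g t ≡ c ℤ.+ g′ t

  ≈-trans : ∀ {g g′ g″ n} → g ≈[ n ] g′ → g′ ≈[ n ] g″ → g ≈[ n ] g″
  ≈-trans (c , h) (c′ , h′) = c ℤ.+ c′ , λ t p → trans (h t p) (trans (cong (λ z → c ℤ.+ z) (h′ t p)) (sym (ℤP.+-assoc c c′ _)))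

  module _ {g g′ : ℕ → ℤ} {n : ℕ} (g≈g′ : g ≈[ n ] g′) where
    private
      compare : (op : ℤ → ℤ → Bool) → (∀ c x y → op (c ℤ.+ x) (c ℤ.+ y) ≡ op x y) →
                ∀ {a b} → a ℕ.≤ n → b ℕ.≤ n → op (g a) (g b) ≡ op (g′ a) (g′ b)
      compare op shift {a} {b} a≤n b≤n =
        trans (cong₂ op (proj₂ g≈g′ a a≤n) (proj₂ g≈g′ b b≤n)) (shift (proj₁ g≈g′) (g′ a) (g′ b))

    excursion-≈ : excursionᵇ g n ≡ excursionᵇ g′ n
    excursion-≈ = cong₂ _∧_ (all<ᵇ-cong (suc n) (λ t p → compare leb leb-shift z≤n (ℕP.≤-pred p)))
                            (compare eqb eqb-shift ℕP.≤-refl z≤n)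

    aboveStart-≈ : aboveStartᵇ g n ≡ aboveStartᵇ g′ n
    aboveStart-≈ = all<ᵇ-cong n (λ t p → compare ltb ltb-shift z≤n p)

    aboveEnd-≈ : aboveEndᵇ g n ≡ aboveEndᵇ g′ n
    aboveEnd-≈ = all<ᵇ-cong n (λ t p → compare ltb ltb-shift ℕP.≤-refl (ℕP.<⇒≤ p))

    primitive-≈ : primitiveᵇ g n ≡ primitiveᵇ g′ n
    primitive-≈ = cong ((1 ≤ᵇ n) ∧_) (cong₂ _∧_ (compare eqb eqb-shift ℕP.≤-refl z≤n)
                    (all<ᵇ-cong (n ∸ 1) (λ t p → compare ltb ltb-shift z≤n (ℕP.≤-trans p (ℕP.m∸n≤m n 1)))))

module Walks {S : Set} (letters : List S) (step : S → ℤ) where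
  open import Data.Bool using (Bool; T)
  open import Data.Integer as ℤ using (ℤ)
  import Data.Integer.Properties as ℤP
  open import Data.List using (List; []; _∷_; _++_; length; map; concatMap)
  open import Data.Nat as ℕ using (ℕ; zero; suc; _∸_; s≤s; _≡ᵇ_)
  import Data.Nat.Properties as ℕP
  open import Data.Nat.Tactic.RingSolver using (solve-∀)
  open import Data.Product using (_,_)
  open import Relation.Binary.PropositionalEquality

  open ℕSeries
  open HeightProfiles
  open ≡-Reasoning

  height : List S → ℕ → ℤ
  height σ       zero    = ℤ.0ℤ
  height []      (suc t) = ℤ.0ℤ
  height (a ∷ σ) (suc t) = step a ℤ.+ height σ t

  height-++ˡ : ∀ α β t → t ℕ.≤ length α → height (α ++ β) t ≡ height α t
  height-++ˡ α       β zero    _       = refl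
  height-++ˡ (a ∷ α) β (suc t) (s≤s p) = cong (λ z → step a ℤ.+ z) (height-++ˡ α β t p)

  height-++ʳ : ∀ α β t → height (α ++ β) (length α ℕ.+ t) ≡ height α (length α) ℤ.+ height β t
  height-++ʳ []      β t = sym (ℤP.+-identityˡ _)
  height-++ʳ (a ∷ α) β t = trans (cong (λ z → step a ℤ.+ z) (height-++ʳ α β t)) (sym (ℤP.+-assoc (step a) _ _))

  height-prefix : ∀ α β {i} → length α ≡ i → height (α ++ β) ≈[ i ] height α
  height-prefix α β refl = ℤ.0ℤ , λ t p → trans (height-++ˡ α β t p) (sym (ℤP.+-identityˡ _))

  height-suffix : ∀ α β {i} n → length α ≡ i → (λ t → height (α ++ β) (i ℕ.+ t)) ≈[ n ] height β
  height-suffix α β n refl = height α (length α) , λ t _ → height-++ʳ α β t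

  walks : ℕ → List (List S)
  walks zero    = [] ∷ []
  walks (suc n) = concatMap (λ a → map (a ∷_) (walks n)) letters

  Σwalks-suc : ∀ n f → Σ∈ (walks (suc n)) f ≡ Σ∈ letters (λ a → Σ∈ (walks n) (λ σ → f (a ∷ σ)))
  Σwalks-suc n f = trans (Σ∈-concatMap (λ a → map (a ∷_) (walks n)) letters f)
                         (Σ∈-ext letters (λ a → Σ∈-map (a ∷_) (walks n) f))

  Σwalks-cong : ∀ n {f g} → (∀ σ → length σ ≡ n → f σ ≡ g σ) → Σ∈ (walks n) f ≡ Σ∈ (walks n) g
  Σwalks-cong zero    h = cong (ℕ._+ 0) (h [] refl)
  Σwalks-cong (suc n) {f} {g} h = begin
    Σ∈ (walks (suc n)) f                          ≡⟨ Σwalks-suc n f ⟩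
    Σ∈ letters (λ a → Σ∈ (walks n) (λ σ → f (a ∷ σ))) ≡⟨ Σ∈-ext letters (λ a → Σwalks-cong n (λ σ e → h (a ∷ σ) (cong suc e))) ⟩
    Σ∈ letters (λ a → Σ∈ (walks n) (λ σ → g (a ∷ σ))) ≡⟨ sym (Σwalks-suc n g) ⟩
    Σ∈ (walks (suc n)) g                          ∎

  Σwalks-++ : ∀ i j f → Σ∈ (walks (i ℕ.+ j)) f ≡ Σ∈ (walks i) (λ α → Σ∈ (walks j) (λ β → f (α ++ β)))
  Σwalks-++ zero    j f = sym (ℕP.+-identityʳ _)
  Σwalks-++ (suc i) j f = begin
    Σ∈ (walks (suc (i ℕ.+ j))) f                                              ≡⟨ Σwalks-suc (i ℕ.+ j) f ⟩
    Σ∈ letters (λ a → Σ∈ (walks (i ℕ.+ j)) (λ σ → f (a ∷ σ)))                 ≡⟨ Σ∈-ext letters (λ a → Σwalks-++ i j (λ σ → f (a ∷ σ))) ⟩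
    Σ∈ letters (λ a → Σ∈ (walks i) (λ α → Σ∈ (walks j) (λ β → f (a ∷ α ++ β)))) ≡⟨ sym (Σwalks-suc i (λ α → Σ∈ (walks j) (λ β → f (α ++ β)))) ⟩
    Σ∈ (walks (suc i)) (λ α → Σ∈ (walks j) (λ β → f (α ++ β)))                ∎

  Σwalks-split : ∀ n j f → j ℕ.≤ n → Σ∈ (walks n) f ≡ Σ∈ (walks j) (λ α → Σ∈ (walks (n ∸ j)) (λ β → f (α ++ β)))
  Σwalks-split n j f j≤n = trans (cong (λ m → Σ∈ (walks m) f) (sym (ℕP.m+[n∸m]≡n j≤n))) (Σwalks-++ j (n ∸ j) f)

  returnsᵇ : List S → ℕ → Bool
  returnsᵇ σ n = eqb (height σ n) ℤ.0ℤ

  excursions primitives bridges : ℕ → ℕ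
  excursions n = Σ∈ (walks n) (λ σ → ⟦ excursionᵇ (height σ) n ⟧)
  primitives n = Σ∈ (walks n) (λ σ → ⟦ primitiveᵇ (height σ) n ⟧)
  bridges    n = Σ∈ (walks n) (λ σ → ⟦ returnsᵇ σ n ⟧)

  Σwalks-lastReturnSplit : ∀ n j → j ℕ.≤ n →
    Σ∈ (walks n) (λ σ → LastReturnSplit.split (height σ) n j) ≡ excursions j ℕ.* primitives (n ∸ j)
  Σwalks-lastReturnSplit n j j≤n = begin
    Σ∈ (walks n) (λ σ → LastReturnSplit.split (height σ) n j)
      ≡⟨ Σwalks-split n j _ j≤n ⟩
    Σ∈ (walks j) (λ α → Σ∈ (walks (n ∸ j)) (λ β → LastReturnSplit.split (height (α ++ β)) n j))
      ≡⟨ Σwalks-cong j (λ α ∣α∣ → Σwalks-cong (n ∸ j) (λ β _ →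
           cong₂ (λ x y → ⟦ x ⟧ ℕ.* ⟦ y ⟧) (excursion-≈ (height-prefix α β ∣α∣)) (primitive-≈ (height-suffix α β (n ∸ j) ∣α∣)))) ⟩
    Σ∈ (walks j) (λ α → Σ∈ (walks (n ∸ j)) (λ β → ⟦ excursionᵇ (height α) j ⟧ ℕ.* ⟦ primitiveᵇ (height β) (n ∸ j) ⟧))
      ≡⟨ Σ∈-ext (walks j) (λ α → Σ∈-*ˡ (walks (n ∸ j)) ⟦ excursionᵇ (height α) j ⟧ (λ β → ⟦ primitiveᵇ (height β) (n ∸ j) ⟧)) ⟩
    Σ∈ (walks j) (λ α → ⟦ excursionᵇ (height α) j ⟧ ℕ.* primitives (n ∸ j))
      ≡⟨ Σ∈-*ʳ (walks j) (primitives (n ∸ j)) (λ α → ⟦ excursionᵇ (height α) j ⟧) ⟩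
    excursions j ℕ.* primitives (n ∸ j) ∎

  excursions-lastReturn : ∀ n → excursions n ≡ 𝟙 n ℕ.+ (excursions ∗ primitives) n
  excursions-lastReturn n = begin
    Σ∈ (walks n) (λ σ → ⟦ excursionᵇ (height σ) n ⟧)
      ≡⟨ Σ∈-ext (walks n) (λ σ → LastReturnSplit.excursion-split (height σ) n) ⟩
    Σ∈ (walks n) (λ σ → ⟦ n ≡ᵇ 0 ⟧ ℕ.+ Σ< (suc n) (LastReturnSplit.split (height σ) n))
      ≡⟨ Σ∈-distrib-+ (walks n) (λ _ → ⟦ n ≡ᵇ 0 ⟧) (λ σ → Σ< (suc n) (LastReturnSplit.split (height σ) n)) ⟩
    Σ∈ (walks n) (λ _ → ⟦ n ≡ᵇ 0 ⟧) ℕ.+ Σ∈ (walks n) (λ σ → Σ< (suc n) (LastReturnSplit.split (height σ) n))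
      ≡⟨ cong₂ ℕ._+_ (empty-walk n) (Σ∈-Σ< (walks n) (suc n) (λ σ → LastReturnSplit.split (height σ) n)) ⟩
    𝟙 n ℕ.+ Σ< (suc n) (λ j → Σ∈ (walks n) (λ σ → LastReturnSplit.split (height σ) n j))
      ≡⟨ cong (𝟙 n ℕ.+_) (Σ<-cong (suc n) (λ j j≤n → Σwalks-lastReturnSplit n j (ℕP.≤-pred j≤n))) ⟩
    𝟙 n ℕ.+ (excursions ∗ primitives) n ∎
    where
    empty-walk : ∀ n → Σ∈ (walks n) (λ _ → ⟦ n ≡ᵇ 0 ⟧) ≡ 𝟙 n
    empty-walk zero    = refl
    empty-walk (suc n) = Σ∈-zero (walks (suc n)) (λ _ → refl)

  markedPrimitives : ℕ → ℕ
  markedPrimitives b = ⟦ b ≡ᵇ 0 ⟧ ℕ.+ primitives b ℕ.* (b ∸ 1)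

  -- The two outer pieces of a bridge cut at its first and last minimum: α ends strictly below its
  -- earlier heights, γ stays strictly above its start, and together they climb back to 0.
  outer : List S → List S → ℕ → ℕ → ℕ
  outer α γ i c = ⟦ aboveEndᵇ (height α) i ⟧ ℕ.* ⟦ aboveStartᵇ (height γ) c ⟧ ℕ.* ⟦ eqb (height α i ℤ.+ height γ c) ℤ.0ℤ ⟧

  outers : ℕ → ℕ → ℕ
  outers i c = Σ∈ (walks i) (λ α → Σ∈ (walks c) (λ γ → outer α γ i c))

  height-++-++ : ∀ α ε γ t → height (α ++ (ε ++ γ)) (length α ℕ.+ length ε ℕ.+ t)
                             ≡ (height α (length α) ℤ.+ height ε (length ε)) ℤ.+ height γ t
  height-++-++ α ε γ t = begin
    height (α ++ (ε ++ γ)) (length α ℕ.+ length ε ℕ.+ t)            ≡⟨ cong (height (α ++ (ε ++ γ))) (ℕP.+-assoc (length α) (length ε) t) ⟩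
    height (α ++ (ε ++ γ)) (length α ℕ.+ (length ε ℕ.+ t))          ≡⟨ height-++ʳ α (ε ++ γ) (length ε ℕ.+ t) ⟩
    height α (length α) ℤ.+ height (ε ++ γ) (length ε ℕ.+ t)        ≡⟨ cong (λ z → height α (length α) ℤ.+ z) (height-++ʳ ε γ t) ⟩
    height α (length α) ℤ.+ (height ε (length ε) ℤ.+ height γ t)    ≡⟨ sym (ℤP.+-assoc (height α (length α)) _ _) ⟩
    (height α (length α) ℤ.+ height ε (length ε)) ℤ.+ height γ t    ∎

  minimumSplit-factorises : ∀ α ε γ {i j c n} → length α ≡ i → length ε ≡ j → length γ ≡ c → n ≡ i ℕ.+ (j ℕ.+ c) →
    ⟦ returnsᵇ (α ++ (ε ++ γ)) n ⟧ ℕ.* MinimumSplit.split (height (α ++ (ε ++ γ))) n i j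
      ≡ ⟦ excursionᵇ (height ε) j ⟧ ℕ.* outer α γ i c
  minimumSplit-factorises α ε γ refl refl refl refl = begin
    ⟦ returnsᵇ σ n ⟧ ℕ.* (⟦ aboveEndᵇ (height σ) i ⟧ ℕ.* ⟦ excursionᵇ (λ t → height σ (i ℕ.+ t)) j ⟧ ℕ.* ⟦ after ⟧)
      ≡⟨ cong₂ (λ x y → ⟦ returnsᵇ σ n ⟧ ℕ.* (⟦ x ⟧ ℕ.* ⟦ y ⟧ ℕ.* ⟦ after ⟧))
           (aboveEnd-≈ (height-prefix α (ε ++ γ) refl))
           (excursion-≈ (≈-trans (height-suffix α (ε ++ γ) j refl) (height-prefix ε γ refl))) ⟩
    ⟦ returnsᵇ σ n ⟧ ℕ.* (⟦ aboveEndᵇ (height α) i ⟧ ℕ.* ⟦ excursionᵇ (height ε) j ⟧ ℕ.* ⟦ after ⟧)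
      ≡⟨ cong (λ x → ⟦ returnsᵇ σ n ⟧ ℕ.* (⟦ aboveEndᵇ (height α) i ⟧ ℕ.* ⟦ excursionᵇ (height ε) j ⟧ ℕ.* ⟦ x ⟧)) after≡ ⟩
    ⟦ returnsᵇ σ n ⟧ ℕ.* (⟦ aboveEndᵇ (height α) i ⟧ ℕ.* ⟦ excursionᵇ (height ε) j ⟧ ℕ.* ⟦ aboveStartᵇ (height γ) c ⟧)
      ≡⟨ rearrange ⟦ returnsᵇ σ n ⟧ ⟦ aboveEndᵇ (height α) i ⟧ ⟦ excursionᵇ (height ε) j ⟧ ⟦ aboveStartᵇ (height γ) c ⟧ ⟩
    ⟦ excursionᵇ (height ε) j ⟧ ℕ.* (⟦ aboveEndᵇ (height α) i ⟧ ℕ.* ⟦ aboveStartᵇ (height γ) c ⟧ ℕ.* ⟦ returnsᵇ σ n ⟧)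
      ≡⟨ ⟦⟧-*-cong (excursionᵇ (height ε) j)
           (λ exc → cong (λ x → ⟦ aboveEndᵇ (height α) i ⟧ ℕ.* ⟦ aboveStartᵇ (height γ) c ⟧ ℕ.* ⟦ eqb x ℤ.0ℤ ⟧) (total exc)) ⟩
    ⟦ excursionᵇ (height ε) j ⟧ ℕ.* outer α γ i c ∎
    where
    σ : List S
    σ = α ++ (ε ++ γ)
    i j c n : ℕ
    i = length α
    j = length ε
    c = length γ
    n = i ℕ.+ (j ℕ.+ c)
    after : Bool
    after = aboveStartᵇ (λ t → height σ (i ℕ.+ j ℕ.+ t)) (n ∸ i ∸ j)
    rearrange : ∀ e a b c → e ℕ.* (a ℕ.* b ℕ.* c) ≡ b ℕ.* (a ℕ.* c ℕ.* e)
    rearrange = solve-∀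
    after≡ : after ≡ aboveStartᵇ (height γ) c
    after≡ = trans (cong (aboveStartᵇ (λ t → height σ (i ℕ.+ j ℕ.+ t))) (trans (cong (_∸ j) (ℕP.m+n∸m≡n i (j ℕ.+ c))) (ℕP.m+n∸m≡n j c)))
                   (aboveStart-≈ {n = c} ((height α i ℤ.+ height ε j) , λ t _ → height-++-++ α ε γ t))
    total : T (excursionᵇ (height ε) j) → height σ n ≡ height α i ℤ.+ height γ c
    total exc = begin
      height σ n                                   ≡⟨ cong (height σ) (sym (ℕP.+-assoc i j c)) ⟩
      height σ (i ℕ.+ j ℕ.+ c)                     ≡⟨ height-++-++ α ε γ c ⟩
      (height α i ℤ.+ height ε j) ℤ.+ height γ c   ≡⟨ cong (λ z → (height α i ℤ.+ z) ℤ.+ height γ c) (excursion-returns (height ε) j exc) ⟩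
      (height α i ℤ.+ ℤ.0ℤ) ℤ.+ height γ c         ≡⟨ cong (ℤ._+ height γ c) (ℤP.+-identityʳ (height α i)) ⟩
      height α i ℤ.+ height γ c                    ∎

  Σwalks-minimumSplit : ∀ n i j → i ℕ.≤ n → j ℕ.≤ n ∸ i →
    Σ∈ (walks n) (λ σ → ⟦ returnsᵇ σ n ⟧ ℕ.* MinimumSplit.split (height σ) n i j) ≡ excursions j ℕ.* outers i (n ∸ i ∸ j)
  Σwalks-minimumSplit n i j i≤n j≤n∸i = begin
    Σ∈ (walks n) F
      ≡⟨ Σwalks-split n i F i≤n ⟩
    Σ∈ (walks i) (λ α → Σ∈ (walks (n ∸ i)) (λ τ → F (α ++ τ)))
      ≡⟨ Σ∈-ext (walks i) (λ α → Σwalks-split (n ∸ i) j (λ τ → F (α ++ τ)) j≤n∸i) ⟩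
    Σ∈ (walks i) (λ α → Σ∈ (walks j) (λ ε → Σ∈ (walks c) (λ γ → F (α ++ (ε ++ γ)))))
      ≡⟨ Σwalks-cong i (λ α ∣α∣ → Σwalks-cong j (λ ε ∣ε∣ → Σwalks-cong c (λ γ ∣γ∣ → minimumSplit-factorises α ε γ ∣α∣ ∣ε∣ ∣γ∣ n≡))) ⟩
    Σ∈ (walks i) (λ α → Σ∈ (walks j) (λ ε → Σ∈ (walks c) (λ γ → ⟦ excursionᵇ (height ε) j ⟧ ℕ.* outer α γ i c)))
      ≡⟨ Σ∈-ext (walks i) (λ α → Σ∈-ext (walks j) (λ ε → Σ∈-*ˡ (walks c) ⟦ excursionᵇ (height ε) j ⟧ (λ γ → outer α γ i c))) ⟩
    Σ∈ (walks i) (λ α → Σ∈ (walks j) (λ ε → ⟦ excursionᵇ (height ε) j ⟧ ℕ.* Σ∈ (walks c) (λ γ → outer α γ i c)))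
      ≡⟨ Σ∈-ext (walks i) (λ α → Σ∈-*ʳ (walks j) (Σ∈ (walks c) (λ γ → outer α γ i c)) (λ ε → ⟦ excursionᵇ (height ε) j ⟧)) ⟩
    Σ∈ (walks i) (λ α → excursions j ℕ.* Σ∈ (walks c) (λ γ → outer α γ i c))
      ≡⟨ Σ∈-*ˡ (walks i) (excursions j) (λ α → Σ∈ (walks c) (λ γ → outer α γ i c)) ⟩
    excursions j ℕ.* outers i c ∎
    where
    c : ℕ
    c = n ∸ i ∸ j
    F : List S → ℕ
    F σ = ⟦ returnsᵇ σ n ⟧ ℕ.* MinimumSplit.split (height σ) n i j
    n≡ : n ≡ i ℕ.+ (j ℕ.+ c)
    n≡ = sym (trans (cong (i ℕ.+_) (ℕP.m+[n∸m]≡n j≤n∸i)) (ℕP.m+[n∸m]≡n i≤n))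

  cutBridge : ℕ → List S → ℕ → ℕ
  cutBridge b π c = ⟦ returnsᵇ π b ⟧ ℕ.* PrimitiveCuts.cut (height π) b c

  outer-rotate : ∀ γ α {c i b} → length γ ≡ c → length α ≡ i → b ≡ c ℕ.+ i → outer α γ i c ≡ cutBridge b (γ ++ α) c
  outer-rotate γ α refl refl refl = begin
    ⟦ aboveEndᵇ (height α) i ⟧ ℕ.* ⟦ aboveStartᵇ (height γ) c ⟧ ℕ.* ⟦ eqb (height α i ℤ.+ height γ c) ℤ.0ℤ ⟧
      ≡⟨ rearrange ⟦ aboveEndᵇ (height α) i ⟧ ⟦ aboveStartᵇ (height γ) c ⟧ _ ⟩
    ⟦ eqb (height α i ℤ.+ height γ c) ℤ.0ℤ ⟧ ℕ.* (⟦ aboveStartᵇ (height γ) c ⟧ ℕ.* ⟦ aboveEndᵇ (height α) i ⟧)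
      ≡⟨ cong₂ (λ x y → ⟦ x ⟧ ℕ.* (⟦ y ⟧ ℕ.* ⟦ aboveEndᵇ (height α) i ⟧))
           (cong (λ z → eqb z ℤ.0ℤ) (trans (ℤP.+-comm (height α i) (height γ c)) (sym (height-++ʳ γ α i))))
           (sym (aboveStart-≈ (height-prefix γ α refl))) ⟩
    ⟦ returnsᵇ π (c ℕ.+ i) ⟧ ℕ.* (⟦ aboveStartᵇ (height π) c ⟧ ℕ.* ⟦ aboveEndᵇ (height α) i ⟧)
      ≡⟨ cong (λ x → ⟦ returnsᵇ π (c ℕ.+ i) ⟧ ℕ.* (⟦ aboveStartᵇ (height π) c ⟧ ℕ.* ⟦ x ⟧))
           (trans (sym (aboveEnd-≈ (height-suffix γ α i refl))) (cong (aboveEndᵇ (λ t → height π (c ℕ.+ t))) (sym (ℕP.m+n∸m≡n c i)))) ⟩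
    cutBridge (c ℕ.+ i) π c ∎
    where
    π : List S
    π = γ ++ α
    c i : ℕ
    c = length γ
    i = length α
    rearrange : ∀ a c e → a ℕ.* c ℕ.* e ≡ e ℕ.* (c ℕ.* a)
    rearrange = solve-∀

  outers-as-cuts : ∀ b c → c ℕ.≤ b → outers (b ∸ c) c ≡ Σ∈ (walks b) (λ π → cutBridge b π c)
  outers-as-cuts b c c≤b = begin
    Σ∈ (walks (b ∸ c)) (λ α → Σ∈ (walks c) (λ γ → outer α γ (b ∸ c) c))
      ≡⟨ Σ∈-swap (walks (b ∸ c)) (walks c) (λ α γ → outer α γ (b ∸ c) c) ⟩
    Σ∈ (walks c) (λ γ → Σ∈ (walks (b ∸ c)) (λ α → outer α γ (b ∸ c) c))
      ≡⟨ Σwalks-cong c (λ γ ∣γ∣ → Σwalks-cong (b ∸ c) (λ α ∣α∣ → outer-rotate γ α ∣γ∣ ∣α∣ (sym (ℕP.m+[n∸m]≡n c≤b)))) ⟩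
    Σ∈ (walks c) (λ γ → Σ∈ (walks (b ∸ c)) (λ α → cutBridge b (γ ++ α) c))
      ≡⟨ sym (Σwalks-split b c (λ π → cutBridge b π c) c≤b) ⟩
    Σ∈ (walks b) (λ π → cutBridge b π c) ∎

  Σouters : ∀ b → Σ< (suc b) (λ i → outers i (b ∸ i)) ≡ markedPrimitives b
  Σouters b = begin
    Σ< (suc b) (λ i → outers i (b ∸ i))
      ≡⟨ Σ<-reverse (suc b) (λ i → outers i (b ∸ i)) ⟩
    Σ< (suc b) (λ c → outers (b ∸ c) (b ∸ (b ∸ c)))
      ≡⟨ Σ<-cong (suc b) (λ c c≤b → trans (cong (outers (b ∸ c)) (ℕP.m∸[m∸n]≡n (ℕP.≤-pred c≤b))) (outers-as-cuts b c (ℕP.≤-pred c≤b))) ⟩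
    Σ< (suc b) (λ c → Σ∈ (walks b) (λ π → cutBridge b π c))
      ≡⟨ sym (Σ∈-Σ< (walks b) (suc b) (cutBridge b)) ⟩
    Σ∈ (walks b) (λ π → Σ< (suc b) (cutBridge b π))
      ≡⟨ Σ∈-ext (walks b) (λ π → Σ<-*ˡ (suc b) ⟦ returnsᵇ π b ⟧ (PrimitiveCuts.cut (height π) b)) ⟩
    Σ∈ (walks b) (λ π → ⟦ returnsᵇ π b ⟧ ℕ.* Σ< (suc b) (PrimitiveCuts.cut (height π) b))
      ≡⟨ Σ∈-ext (walks b) (λ π → ⟦⟧-*-cong (returnsᵇ π b) (λ h → PrimitiveCuts.Σcut (height π) b (eqb⇒≡ h))) ⟩
    Σ∈ (walks b) (λ π → ⟦ returnsᵇ π b ⟧ ℕ.* (⟦ b ≡ᵇ 0 ⟧ ℕ.+ ⟦ primitiveᵇ (height π) b ⟧ ℕ.* (b ∸ 1)))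
      ≡⟨ Σ∈-ext (walks b) (λ π → trans (ℕP.*-distribˡ-+ ⟦ returnsᵇ π b ⟧ _ _)
           (cong (⟦ returnsᵇ π b ⟧ ℕ.* ⟦ b ≡ᵇ 0 ⟧ ℕ.+_)
             (⟦⟧-absorb (returnsᵇ π b) (primitiveᵇ (height π) b) (b ∸ 1) (λ h → ≡⇒eqb (primitive-returns (height π) b h))))) ⟩
    Σ∈ (walks b) (λ π → ⟦ returnsᵇ π b ⟧ ℕ.* ⟦ b ≡ᵇ 0 ⟧ ℕ.+ ⟦ primitiveᵇ (height π) b ⟧ ℕ.* (b ∸ 1))
      ≡⟨ Σ∈-distrib-+ (walks b) _ _ ⟩
    Σ∈ (walks b) (λ π → ⟦ returnsᵇ π b ⟧ ℕ.* ⟦ b ≡ᵇ 0 ⟧) ℕ.+ Σ∈ (walks b) (λ π → ⟦ primitiveᵇ (height π) b ⟧ ℕ.* (b ∸ 1))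
      ≡⟨ cong₂ ℕ._+_ (empty-bridge b) (Σ∈-*ʳ (walks b) (b ∸ 1) (λ π → ⟦ primitiveᵇ (height π) b ⟧)) ⟩
    markedPrimitives b ∎
    where
    empty-bridge : ∀ b → Σ∈ (walks b) (λ π → ⟦ returnsᵇ π b ⟧ ℕ.* ⟦ b ≡ᵇ 0 ⟧) ≡ ⟦ b ≡ᵇ 0 ⟧
    empty-bridge zero    = refl
    empty-bridge (suc b) = Σ∈-zero (walks (suc b)) (λ π → ℕP.*-zeroʳ ⟦ returnsᵇ π (suc b) ⟧)

  bridges-minimumSplit : ∀ n → bridges n ≡ (excursions ∗ markedPrimitives) n
  bridges-minimumSplit n = begin
    Σ∈ (walks n) (λ σ → ⟦ returnsᵇ σ n ⟧)
      ≡⟨ Σ∈-ext (walks n) (λ σ → trans (sym (ℕP.*-identityʳ _)) (cong (⟦ returnsᵇ σ n ⟧ ℕ.*_) (sym (MinimumSplit.Σsplit≡1 (height σ) n)))) ⟩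
    Σ∈ (walks n) (λ σ → ⟦ returnsᵇ σ n ⟧ ℕ.* Σ< (suc n) (λ i → Σ< (suc (n ∸ i)) (split σ i)))
      ≡⟨ Σ∈-ext (walks n) (λ σ → trans (sym (Σ<-*ˡ (suc n) ⟦ returnsᵇ σ n ⟧ (λ i → Σ< (suc (n ∸ i)) (split σ i))))
                                       (Σ<-ext (suc n) (λ i → sym (Σ<-*ˡ (suc (n ∸ i)) ⟦ returnsᵇ σ n ⟧ (split σ i))))) ⟩
    Σ∈ (walks n) (λ σ → Σ< (suc n) (λ i → Σ< (suc (n ∸ i)) (λ j → ⟦ returnsᵇ σ n ⟧ ℕ.* split σ i j)))
      ≡⟨ Σ∈-Σ< (walks n) (suc n) (λ σ i → Σ< (suc (n ∸ i)) (λ j → ⟦ returnsᵇ σ n ⟧ ℕ.* split σ i j)) ⟩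
    Σ< (suc n) (λ i → Σ∈ (walks n) (λ σ → Σ< (suc (n ∸ i)) (λ j → ⟦ returnsᵇ σ n ⟧ ℕ.* split σ i j)))
      ≡⟨ Σ<-ext (suc n) (λ i → Σ∈-Σ< (walks n) (suc (n ∸ i)) (λ σ j → ⟦ returnsᵇ σ n ⟧ ℕ.* split σ i j)) ⟩
    Σ< (suc n) (λ i → Σ< (suc (n ∸ i)) (λ j → Σ∈ (walks n) (λ σ → ⟦ returnsᵇ σ n ⟧ ℕ.* split σ i j)))
      ≡⟨ Σ<-cong (suc n) (λ i i≤n → Σ<-cong (suc (n ∸ i)) (λ j j≤ → Σwalks-minimumSplit n i j (ℕP.≤-pred i≤n) (ℕP.≤-pred j≤))) ⟩
    Σ< (suc n) (λ i → Σ< (suc (n ∸ i)) (λ j → excursions j ℕ.* outers i (n ∸ i ∸ j)))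
      ≡⟨ Σ<-triangle-swap n (λ i j → excursions j ℕ.* outers i (n ∸ i ∸ j)) ⟩
    Σ< (suc n) (λ j → Σ< (suc (n ∸ j)) (λ i → excursions j ℕ.* outers i (n ∸ i ∸ j)))
      ≡⟨ Σ<-ext (suc n) (λ j → trans (Σ<-ext (suc (n ∸ j)) (λ i → cong (λ z → excursions j ℕ.* outers i z) (∸-comm i j)))
                                      (Σ<-*ˡ (suc (n ∸ j)) (excursions j) (λ i → outers i (n ∸ j ∸ i)))) ⟩
    Σ< (suc n) (λ j → excursions j ℕ.* Σ< (suc (n ∸ j)) (λ i → outers i (n ∸ j ∸ i)))
      ≡⟨ Σ<-ext (suc n) (λ j → cong (excursions j ℕ.*_) (Σouters (n ∸ j))) ⟩
    (excursions ∗ markedPrimitives) n ∎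
    where
    split : List S → ℕ → ℕ → ℕ
    split σ = MinimumSplit.split (height σ) n
    ∸-comm : ∀ i j → n ∸ i ∸ j ≡ n ∸ j ∸ i
    ∸-comm i j = trans (ℕP.∸-+-assoc n i j) (trans (cong (n ∸_) (ℕP.+-comm i j)) (sym (ℕP.∸-+-assoc n j i)))

  markedPrimitives+primitives : ∀ b → markedPrimitives b ℕ.+ primitives b ≡ 𝟙 b ℕ.+ θ primitives b
  markedPrimitives+primitives zero    = refl
  markedPrimitives+primitives (suc b) = begin
    primitives (suc b) ℕ.* b ℕ.+ primitives (suc b)  ≡⟨ ℕP.+-comm (primitives (suc b) ℕ.* b) _ ⟩
    primitives (suc b) ℕ.+ primitives (suc b) ℕ.* b  ≡⟨ cong (primitives (suc b) ℕ.+_) (trans (ℕP.*-comm _ b) (sym (×≡* b _))) ⟩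
    θ primitives (suc b)                             ∎

  θ-excursions : ∀ n → θ excursions n ≡ ((excursions ∗ θ primitives) ∗ excursions) n
  θ-excursions = ∗-fixpoint-unique (θ excursions) ((excursions ∗ θ primitives) ∗ excursions) primitives
                                   (excursions ∗ θ primitives) refl θE-equation Y-equation
    where
    θE-equation : ∀ n → θ excursions n ≡ (θ excursions ∗ primitives) n ℕ.+ (excursions ∗ θ primitives) n
    θE-equation n = begin
      n ×′ excursions n                                   ≡⟨ cong (n ×′_) (excursions-lastReturn n) ⟩
      θ (λ i → 𝟙 i ℕ.+ (excursions ∗ primitives) i) n     ≡⟨ θ-+ 𝟙 (excursions ∗ primitives) n ⟩
      θ 𝟙 n ℕ.+ θ (excursions ∗ primitives) n              ≡⟨ cong₂ ℕ._+_ (θ-𝟙 n) (θ-∗ excursions primitives n) ⟩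
      (θ excursions ∗ primitives) n ℕ.+ (excursions ∗ θ primitives) n ∎
    Y-equation : ∀ n → ((excursions ∗ θ primitives) ∗ excursions) n
                       ≡ (((excursions ∗ θ primitives) ∗ excursions) ∗ primitives) n ℕ.+ (excursions ∗ θ primitives) n
    Y-equation n = sym (begin
      (((E∂P) ∗ excursions) ∗ primitives) n ℕ.+ (E∂P) n
        ≡⟨ cong₂ ℕ._+_ (∗-assoc E∂P excursions primitives n) (sym (∗-identityʳ E∂P n)) ⟩
      (E∂P ∗ (excursions ∗ primitives)) n ℕ.+ (E∂P ∗ 𝟙) n
        ≡⟨ sym (∗-distribˡ-+ E∂P (excursions ∗ primitives) 𝟙 n) ⟩
      (E∂P ∗ (λ i → (excursions ∗ primitives) i ℕ.+ 𝟙 i)) n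
        ≡⟨ ∗-congʳ E∂P n (λ i → trans (ℕP.+-comm _ (𝟙 i)) (sym (excursions-lastReturn i))) ⟩
      (E∂P ∗ excursions) n ∎)
      where
      E∂P : ℕ → ℕ
      E∂P = excursions ∗ θ primitives

  bridges∗excursions : ∀ n → (bridges ∗ excursions) n ≡ excursions n ℕ.+ θ excursions n
  bridges∗excursions n = ℕP.+-cancelˡ-≡ ((EP ∗ excursions) n) _ _ (begin
    (EP ∗ excursions) n ℕ.+ (bridges ∗ excursions) n
      ≡⟨ trans (ℕP.+-comm ((EP ∗ excursions) n) ((bridges ∗ excursions) n)) (cong (ℕ._+ (EP ∗ excursions) n) (∗-congˡ excursions n bridges-minimumSplit)) ⟩
    ((excursions ∗ markedPrimitives) ∗ excursions) n ℕ.+ (EP ∗ excursions) n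
      ≡⟨ sym (∗-distribʳ-+ (excursions ∗ markedPrimitives) EP excursions n) ⟩
    ((λ i → (excursions ∗ markedPrimitives) i ℕ.+ EP i) ∗ excursions) n
      ≡⟨ ∗-congˡ excursions n (λ i → trans (sym (∗-distribˡ-+ excursions markedPrimitives primitives i))
                                           (∗-congʳ excursions i markedPrimitives+primitives)) ⟩
    ((excursions ∗ (λ b → 𝟙 b ℕ.+ θ primitives b)) ∗ excursions) n
      ≡⟨ ∗-congˡ excursions n (λ i → trans (∗-distribˡ-+ excursions 𝟙 (θ primitives) i)
                                           (cong (ℕ._+ (excursions ∗ θ primitives) i) (∗-identityʳ excursions i))) ⟩
    ((λ i → excursions i ℕ.+ (excursions ∗ θ primitives) i) ∗ excursions) n
      ≡⟨ ∗-distribʳ-+ excursions (excursions ∗ θ primitives) excursions n ⟩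
    (excursions ∗ excursions) n ℕ.+ ((excursions ∗ θ primitives) ∗ excursions) n
      ≡⟨ cong₂ ℕ._+_ (∗-congˡ excursions n excursions-lastReturn) (sym (θ-excursions n)) ⟩
    ((λ i → 𝟙 i ℕ.+ EP i) ∗ excursions) n ℕ.+ θ excursions n
      ≡⟨ cong (ℕ._+ θ excursions n) (trans (∗-distribʳ-+ 𝟙 EP excursions n) (cong (ℕ._+ (EP ∗ excursions) n) (∗-identityˡ excursions n))) ⟩
    excursions n ℕ.+ (EP ∗ excursions) n ℕ.+ θ excursions n
      ≡⟨ solve-∀′ (excursions n) ((EP ∗ excursions) n) (θ excursions n) ⟩
    (EP ∗ excursions) n ℕ.+ (excursions n ℕ.+ θ excursions n) ∎)
    where
    EP : ℕ → ℕ
    EP = excursions ∗ primitives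
    solve-∀′ : ∀ a b c → a ℕ.+ b ℕ.+ c ≡ b ℕ.+ (a ℕ.+ c)
    solve-∀′ = solve-∀

  excursions-recurrence : ∀ n → n ℕ.* excursions n ≡ Σ< n (λ i → bridges (suc i) ℕ.* excursions (n ∸ suc i))
  excursions-recurrence n = ℕP.+-cancelˡ-≡ (excursions n) _ _ (begin
    excursions n ℕ.+ n ℕ.* excursions n     ≡⟨ cong (excursions n ℕ.+_) (sym (×≡* n (excursions n))) ⟩
    excursions n ℕ.+ θ excursions n         ≡⟨ sym (bridges∗excursions n) ⟩
    (bridges ∗ excursions) n                ≡⟨ cong (ℕ._+ Σ< n (λ i → bridges (suc i) ℕ.* excursions (n ∸ suc i))) (ℕP.+-identityʳ (excursions n)) ⟩
    excursions n ℕ.+ Σ< n (λ i → bridges (suc i) ℕ.* excursions (n ∸ suc i)) ∎)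

module LatticePaths where
  open import Data.Bool using (Bool; true; false; _∧_; _∨_; T; T?)
  open import Data.Bool.ListAction using (all; any)
  open import Data.Bool.Properties using (∧-assoc; ∧-identityʳ; ∧-zeroʳ; ∨-identityʳ)
  open import Data.Empty using (⊥-elim)
  open import Data.Integer as ℤ using (ℤ; +_)
  import Data.Integer.Properties as ℤP
  open import Data.List using (List; []; _∷_; _++_; length; concat; concatMap; filter; replicate; upTo)
  open import Data.List.Properties using (++-identityʳ; ++-assoc)
  open import Data.List.Relation.Unary.All as All using (All; []; _∷_)
  open import Data.Nat as ℕ using (ℕ; zero; suc; _∸_; z≤n; s≤s; _≤ᵇ_; _≡ᵇ_)
  open import Data.Nat.Combinatorics using (_C_; nCn≡1; nCk+nC[k+1]≡[n+1]C[k+1])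
  import Data.Nat.Properties as ℕP
  open import Data.Product using (Σ; _×_; _,_; proj₁; proj₂; ∃)
  open import Data.Sum using (_⊎_; inj₁; inj₂)
  open import Data.Unit using (tt)
  open import Function using (id)
  open import Relation.Binary.PropositionalEquality
  open import Defs

  open ℕSeries
  open HeightProfiles

  length-filter : ∀ {X : Set} (p : X → Bool) xs → length (filter (λ x → T? (p x)) xs) ≡ Σ∈ xs (λ x → ⟦ p x ⟧)
  length-filter p [] = refl
  length-filter p (x ∷ xs) with p x
  ... | true = cong suc (length-filter p xs)
  ... | false = length-filter p xs

  Σ∈-filter : ∀ {X : Set} (p : X → Bool) xs f → Σ∈ (filter (λ x → T? (p x)) xs) f ≡ Σ∈ xs (λ x → ⟦ p x ⟧ ℕ.* f x)
  Σ∈-filter p [] f = refl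
  Σ∈-filter p (x ∷ xs) f with p x
  ... | true = cong₂ ℕ._+_ (sym (ℕP.+-identityʳ (f x))) (Σ∈-filter p xs f)
  ... | false = Σ∈-filter p xs f

  Σwords-suc : ∀ L f → Σ∈ (words (suc L)) f ≡ Σ∈ (words L) (λ w → f (N ∷ w) ℕ.+ f (E ∷ w))
  Σwords-suc L f = trans (Σ∈-concatMap (λ w → (N ∷ w) ∷ (E ∷ w) ∷ []) (words L) f)
                     (Σ∈-ext (words L) (λ w → cong (f (N ∷ w) ℕ.+_) (ℕP.+-identityʳ (f (E ∷ w)))))

  countE-++ : ∀ u v → countE (u ++ v) ≡ countE u ℕ.+ countE v
  countE-++ [] v = refl
  countE-++ (N ∷ u) v = countE-++ u v
  countE-++ (E ∷ u) v = cong suc (countE-++ u v)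

  countN-++ : ∀ u v → countN (u ++ v) ≡ countN u ℕ.+ countN v
  countN-++ [] v = refl
  countN-++ (N ∷ u) v = cong suc (countN-++ u v)
  countN-++ (E ∷ u) v = countN-++ u v

  length≡countE+countN : ∀ w → length w ≡ countE w ℕ.+ countN w
  length≡countE+countN [] = refl
  length≡countE+countN (N ∷ w) = trans (cong suc (length≡countE+countN w)) (sym (ℕP.+-suc (countE w) (countN w)))
  length≡countE+countN (E ∷ w) = cong suc (length≡countE+countN w)

  countWords : ℕ → ℕ → ℕ → ℕ
  countWords L a b = Σ∈ (words L) (λ w → ⟦ (countE w ≡ᵇ a) ∧ (countN w ≡ᵇ b) ⟧)

  countWords≡C : ∀ L a b → a ℕ.+ b ≡ L → countWords L a b ≡ L C a
  countWords≡C zero zero zero e = refl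
  countWords≡C zero (suc a) b ()
  countWords≡C zero zero (suc b) ()
  countWords≡C (suc L) a b e = trans (Σwords-suc L (λ w → ⟦ (countE w ≡ᵇ a) ∧ (countN w ≡ᵇ b) ⟧)) (go a b e)
    where
    go : ∀ a b → a ℕ.+ b ≡ suc L →
         Σ∈ (words L) (λ w → ⟦ (countE w ≡ᵇ a) ∧ (suc (countN w) ≡ᵇ b) ⟧ ℕ.+ ⟦ (suc (countE w) ≡ᵇ a) ∧ (countN w ≡ᵇ b) ⟧) ≡ suc L C a
    go zero zero ()
    go zero (suc b) e = trans (Σ∈-ext (words L) (λ w → ℕP.+-identityʳ _)) (countWords≡C L zero b (ℕP.suc-injective e))
    go (suc a) zero e = trans (Σ∈-ext (words L) (λ w → cong (λ z → ⟦ z ⟧ ℕ.+ ⟦ (countE w ≡ᵇ a) ∧ (countN w ≡ᵇ 0) ⟧) (∧-zeroʳ (countE w ≡ᵇ suc a))))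
                          (trans (countWords≡C L a zero (ℕP.suc-injective e))
                            (trans (cong (L C_) a≡L) (trans (nCn≡1 L) (trans (sym (nCn≡1 (suc L))) (cong (suc L C_) (cong suc (sym a≡L)))))))
      where
      a≡L : a ≡ L
      a≡L = ℕP.suc-injective (trans (sym (ℕP.+-identityʳ (suc a))) e)
    go (suc a) (suc b) e = trans (Σ∈-distrib-+ (words L) (λ w → ⟦ (countE w ≡ᵇ suc a) ∧ (countN w ≡ᵇ b) ⟧) (λ w → ⟦ (countE w ≡ᵇ a) ∧ (countN w ≡ᵇ suc b) ⟧))
      (trans (cong₂ ℕ._+_ (countWords≡C L (suc a) b (trans (sym (ℕP.+-suc a b)) (ℕP.suc-injective e))) (countWords≡C L a (suc b) (ℕP.suc-injective e)))
        (trans (ℕP.+-comm (L C suc a) (L C a)) (nCk+nC[k+1]≡[n+1]C[k+1] L a)))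

  sameStepᵇ : Step → Step → Bool
  sameStepᵇ N N = true
  sameStepᵇ E E = true
  sameStepᵇ N E = false
  sameStepᵇ E N = false

  sameWordᵇ : List Step → List Step → Bool
  sameWordᵇ [] [] = true
  sameWordᵇ [] (_ ∷ _) = false
  sameWordᵇ (_ ∷ _) [] = false
  sameWordᵇ (s ∷ x) (t ∷ y) = sameStepᵇ s t ∧ sameWordᵇ x y

  sameWord⇒≡ : ∀ x y → T (sameWordᵇ x y) → x ≡ y
  sameWord⇒≡ [] [] h = refl
  sameWord⇒≡ (N ∷ x) (N ∷ y) h = cong (N ∷_) (sameWord⇒≡ x y h)
  sameWord⇒≡ (E ∷ x) (E ∷ y) h = cong (E ∷_) (sameWord⇒≡ x y h)

  sameWord-comm : ∀ x y → sameWordᵇ x y ≡ sameWordᵇ y x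
  sameWord-comm [] [] = refl
  sameWord-comm [] (_ ∷ _) = refl
  sameWord-comm (_ ∷ _) [] = refl
  sameWord-comm (N ∷ x) (N ∷ y) = sameWord-comm x y
  sameWord-comm (N ∷ x) (E ∷ y) = refl
  sameWord-comm (E ∷ x) (N ∷ y) = refl
  sameWord-comm (E ∷ x) (E ∷ y) = sameWord-comm x y

  Σwords-sameWord : ∀ L v → Σ∈ (words L) (λ w → ⟦ sameWordᵇ v w ⟧) ≡ ⟦ length v ≡ᵇ L ⟧
  Σwords-sameWord zero [] = refl
  Σwords-sameWord zero (_ ∷ _) = refl
  Σwords-sameWord (suc L) v = trans (Σwords-suc L (λ w → ⟦ sameWordᵇ v w ⟧)) (go v)
    where
    go : ∀ v → Σ∈ (words L) (λ w → ⟦ sameWordᵇ v (N ∷ w) ⟧ ℕ.+ ⟦ sameWordᵇ v (E ∷ w) ⟧) ≡ ⟦ length v ≡ᵇ suc L ⟧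
    go [] = Σ∈-zero (words L) (λ _ → refl)
    go (N ∷ v) = trans (Σ∈-ext (words L) (λ w → ℕP.+-identityʳ _)) (Σwords-sameWord L v)
    go (E ∷ v) = Σwords-sameWord L v

  ⟦⟧-sameWord-transfer : ∀ (R : List Step → Bool) x v → ⟦ R v ⟧ ℕ.* ⟦ sameWordᵇ x v ⟧ ≡ ⟦ R x ⟧ ℕ.* ⟦ sameWordᵇ x v ⟧
  ⟦⟧-sameWord-transfer R x v with sameWordᵇ x v in e
  ... | false = trans (ℕP.*-zeroʳ ⟦ R v ⟧) (sym (ℕP.*-zeroʳ ⟦ R x ⟧))
  ... | true = cong (λ z → ⟦ R z ⟧ ℕ.* 1) (sym (sameWord⇒≡ x v (subst T (sym e) tt)))

  whenᵇ : ∀ {X : Set} (b : Bool) → (T b → X) → List X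
  whenᵇ true f = f tt ∷ []
  whenᵇ false f = []

  Σ∈-whenᵇ : ∀ {X : Set} b (f : T b → X) g G → (∀ h → g (f h) ≡ G) → Σ∈ (whenᵇ b f) g ≡ ⟦ b ⟧ ℕ.* G
  Σ∈-whenᵇ true f g G e = trans (ℕP.+-identityʳ _) (trans (e tt) (sym (ℕP.+-identityʳ G)))
  Σ∈-whenᵇ false f g G e = refl

  startsWithEᵇ : List Step → Bool
  startsWithEᵇ [] = true
  startsWithEᵇ (N ∷ _) = false
  startsWithEᵇ (E ∷ _) = true

  sameWord-++ : ∀ u u' x y → countE u ≡ countE u' → T (startsWithEᵇ x) → T (startsWithEᵇ y) → sameWordᵇ (u ++ x) (u' ++ y) ≡ sameWordᵇ u u' ∧ sameWordᵇ x y
  sameWord-++ [] [] x y e hx hy = refl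
  sameWord-++ [] (N ∷ u') [] y e hx hy = refl
  sameWord-++ [] (N ∷ u') (E ∷ x) y e hx hy = refl
  sameWord-++ [] (E ∷ u') x y () hx hy
  sameWord-++ (N ∷ u) [] x [] e hx hy = refl
  sameWord-++ (N ∷ u) [] x (E ∷ y) e hx hy = refl
  sameWord-++ (E ∷ u) [] x y () hx hy
  sameWord-++ (N ∷ u) (N ∷ u') x y e hx hy = sameWord-++ u u' x y e hx hy
  sameWord-++ (N ∷ u) (E ∷ u') x y e hx hy = refl
  sameWord-++ (E ∷ u) (N ∷ u') x y e hx hy = refl
  sameWord-++ (E ∷ u) (E ∷ u') x y e hx hy = sameWord-++ u u' x y (ℕP.suc-injective e) hx hy

  reachesᵇ : ℕ → ℕ → ℕ × ℕ → List Step → Bool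
  reachesᵇ X Y q w = any (λ p → (X ≡ᵇ proj₁ p) ∧ (Y ≤ᵇ proj₂ p)) (pointsFrom q w)

  ∨-absorb : ∀ a b → (T a → T b) → (a ∨ b) ≡ b
  ∨-absorb true true h = refl
  ∨-absorb true false h = ⊥-elim (h tt)
  ∨-absorb false b h = refl

  ∧-absorb : ∀ a b → (T b → T a) → (a ∧ b) ≡ b
  ∧-absorb true b h = refl
  ∧-absorb false true h = ⊥-elim (h tt)
  ∧-absorb false false h = refl

  reaches-here : ∀ X Y x y w → T ((X ≡ᵇ x) ∧ (Y ≤ᵇ y)) → T (reachesᵇ X Y (x , y) w)
  reaches-here X Y x y [] h with (X ≡ᵇ x) ∧ (Y ≤ᵇ y)
  ... | true = tt
  reaches-here X Y x y (N ∷ w) h with (X ≡ᵇ x) ∧ (Y ≤ᵇ y)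
  ... | true = tt
  reaches-here X Y x y (E ∷ w) h with (X ≡ᵇ x) ∧ (Y ≤ᵇ y)
  ... | true = tt

  ≤ᵇ-suc : ∀ Y y → T (Y ≤ᵇ y) → T (Y ≤ᵇ suc y)
  ≤ᵇ-suc Y y h = ℕP.≤⇒≤ᵇ (ℕP.m≤n⇒m≤1+n (ℕP.≤ᵇ⇒≤ Y y h))

  reaches-N : ∀ X Y x y c v → reachesᵇ X Y (x , y) (replicate c N ++ v) ≡ reachesᵇ X Y (x , y ℕ.+ c) v
  reaches-N X Y x y zero v = cong (λ z → reachesᵇ X Y (x , z) v) (sym (ℕP.+-identityʳ y))
  reaches-N X Y x y (suc c) v = trans (∨-absorb _ _ (λ h → reaches-here X Y x (suc y) (replicate c N ++ v)
                                    (∧-intro (∧-elimˡ {X ≡ᵇ x} h) (≤ᵇ-suc Y y (∧-elimʳ {X ≡ᵇ x} h)))))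
                          (trans (reaches-N X Y x (suc y) c v) (cong (λ z → reachesᵇ X Y (x , z) v) (sym (ℕP.+-suc y c))))

  ≡ᵇ-lt : ∀ X x → X ℕ.< x → (X ≡ᵇ x) ≡ false
  ≡ᵇ-lt X x p with X ≡ᵇ x in e
  ... | true = ⊥-elim (ℕP.<-irrefl (ℕP.≡ᵇ⇒≡ X x (subst T (sym e) tt)) p)
  ... | false = refl

  ≡ᵇ-gt : ∀ X x → x ℕ.< X → (X ≡ᵇ x) ≡ false
  ≡ᵇ-gt X x p with X ≡ᵇ x in e
  ... | true = ⊥-elim (ℕP.<-irrefl (sym (ℕP.≡ᵇ⇒≡ X x (subst T (sym e) tt))) p)
  ... | false = refl

  ≡ᵇ-refl : ∀ n → (n ≡ᵇ n) ≡ true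
  ≡ᵇ-refl zero = refl
  ≡ᵇ-refl (suc n) = ≡ᵇ-refl n

  reaches-behind : ∀ X Y x y w → X ℕ.< x → reachesᵇ X Y (x , y) w ≡ false
  reaches-behind X Y x y [] p rewrite ≡ᵇ-lt X x p = refl
  reaches-behind X Y x y (N ∷ w) p rewrite ≡ᵇ-lt X x p = reaches-behind X Y x (suc y) w p
  reaches-behind X Y x y (E ∷ w) p rewrite ≡ᵇ-lt X x p = reaches-behind X Y (suc x) y w (ℕP.m≤n⇒m≤1+n p)

  reaches-E-past : ∀ X Y x y s v → x ℕ.+ s ℕ.≤ X → reachesᵇ X Y (x , y) (replicate s E ++ v) ≡ reachesᵇ X Y (x ℕ.+ s , y) v
  reaches-E-past X Y x y zero v p = cong (λ z → reachesᵇ X Y (z , y) v) (sym (ℕP.+-identityʳ x))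
  reaches-E-past X Y x y (suc s) v p rewrite ≡ᵇ-gt X x (ℕP.<-≤-trans (s≤s (ℕP.m≤m+n x s)) (subst (ℕ._≤ X) (ℕP.+-suc x s) p)) =
    trans (reaches-E-past X Y (suc x) y s v (subst (ℕ._≤ X) (ℕP.+-suc x s) p)) (cong (λ z → reachesᵇ X Y (z , y) v) (sym (ℕP.+-suc x s)))

  reaches-E-within : ∀ X Y x y s v → x ℕ.≤ X → X ℕ.< x ℕ.+ s → reachesᵇ X Y (x , y) (replicate s E ++ v) ≡ (Y ≤ᵇ y)
  reaches-E-within X Y x y zero v p q = ⊥-elim (ℕP.<-irrefl refl (ℕP.<-≤-trans q (subst (ℕ._≤ X) (sym (ℕP.+-identityʳ x)) p)))
  reaches-E-within X Y x y (suc s) v p q with ℕP.m≤n⇒m<n∨m≡n p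
  ... | inj₂ refl rewrite ≡ᵇ-refl x = trans (cong (λ z → (Y ≤ᵇ y) ∨ z) (reaches-behind x Y (suc x) y (replicate s E ++ v) ℕP.≤-refl)) (∨-identityʳ (Y ≤ᵇ y))
  ... | inj₁ x<X rewrite ≡ᵇ-gt X x x<X = reaches-E-within X Y (suc x) y s v x<X (subst (X ℕ.<_) (ℕP.+-suc x s) q)

  endpoint : ℕ × ℕ → List Step → ℕ × ℕ
  endpoint q [] = q
  endpoint (x , y) (N ∷ w) = endpoint (x , suc y) w
  endpoint (x , y) (E ∷ w) = endpoint (suc x , y) w

  endpoint≡ : ∀ x y w → endpoint (x , y) w ≡ (x ℕ.+ countE w , y ℕ.+ countN w)
  endpoint≡ x y [] = cong₂ _,_ (sym (ℕP.+-identityʳ x)) (sym (ℕP.+-identityʳ y))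
  endpoint≡ x y (N ∷ w) = trans (endpoint≡ x (suc y) w) (cong (x ℕ.+ countE w ,_) (sym (ℕP.+-suc y (countN w))))
  endpoint≡ x y (E ∷ w) = trans (endpoint≡ (suc x) y w) (cong (_, y ℕ.+ countN w) (sym (ℕP.+-suc x (countE w))))

  all-points-++E : ∀ (p : ℕ × ℕ → Bool) q u rest →
    all p (pointsFrom q (u ++ E ∷ rest)) ≡ (all p (pointsFrom q u) ∧ all p (pointsFrom (suc (proj₁ (endpoint q u)) , proj₂ (endpoint q u)) rest))
  all-points-++E p (x , y) [] rest with p (x , y)
  ... | true = refl
  ... | false = refl
  all-points-++E p (x , y) (N ∷ u) rest = trans (cong (p (x , y) ∧_) (all-points-++E p (x , suc y) u rest)) (sym (∧-assoc (p (x , y)) _ _))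
  all-points-++E p (x , y) (E ∷ u) rest = trans (cong (p (x , y) ∧_) (all-points-++E p (suc x , y) u rest)) (sym (∧-assoc (p (x , y)) _ _))

  -- A segment is a word with ℓ − 1 east steps; behind an east step it is one block of a path, and the
  -- path is weakly below the boundary iff its first i blocks contain at most i·k north steps.
  module Segments (k ℓ′ : ℕ) where
    ℓ : ℕ
    ℓ = suc ℓ′

    segmentᵇ : List Step → Bool
    segmentᵇ u = countE u ≡ᵇ ℓ′

    Segment : Set
    Segment = Σ (List Step) (λ u → T (segmentᵇ u))

    rise : Segment → ℕ
    rise a = countN (proj₁ a)

    glue : List Segment → List Step
    glue [] = []
    glue (a ∷ σ) = E ∷ proj₁ a ++ glue σ

    segmentStep : Segment → ℤ
    segmentStep a = + k ℤ.- + rise a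

    glue-startsWithE : ∀ σ → T (startsWithEᵇ (glue σ))
    glue-startsWithE [] = tt
    glue-startsWithE (a ∷ σ) = tt

    segment-countE : ∀ u → T (segmentᵇ u) → countE u ≡ ℓ′
    segment-countE u h = ℕP.≡ᵇ⇒≡ (countE u) ℓ′ h

    segmentOfRiseᵇ : ℕ → List Step → Bool
    segmentOfRiseᵇ d u = segmentᵇ u ∧ (countN u ≡ᵇ d)

    segmentIfRise : ℕ → List Step → List Segment
    segmentIfRise d u = whenᵇ (segmentOfRiseᵇ d u) (λ h → u , ∧-elimˡ {segmentᵇ u} h)

    segmentsOfRise : ℕ → List Segment
    segmentsOfRise d = concatMap (segmentIfRise d) (words (ℓ′ ℕ.+ d))

    segments : ℕ → List Segment
    segments M = concatMap segmentsOfRise (upTo (suc M))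

    Σsegments : ∀ M (g : Segment → ℕ) (G : List Step → ℕ) → (∀ a → g a ≡ G (proj₁ a)) →
            Σ∈ (segments M) g ≡ Σ< (suc M) (λ d → Σ∈ (words (ℓ′ ℕ.+ d)) (λ u → ⟦ segmentOfRiseᵇ d u ⟧ ℕ.* G u))
    Σsegments M g G e = begin
      Σ∈ (segments M) g
        ≡⟨ Σ∈-concatMap segmentsOfRise (upTo (suc M)) g ⟩
      Σ∈ (upTo (suc M)) (λ d → Σ∈ (segmentsOfRise d) g)
        ≡⟨ Σ∈-ext (upTo (suc M)) (λ d → trans (Σ∈-concatMap (segmentIfRise d) (words (ℓ′ ℕ.+ d)) g)
             (Σ∈-ext (words (ℓ′ ℕ.+ d)) (λ u → Σ∈-whenᵇ (segmentOfRiseᵇ d u) (λ h → u , ∧-elimˡ {segmentᵇ u} h) g (G u) (λ h → e (u , ∧-elimˡ {segmentᵇ u} h))))) ⟩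
      Σ∈ (upTo (suc M)) (λ d → Σ∈ (words (ℓ′ ℕ.+ d)) (λ u → ⟦ segmentOfRiseᵇ d u ⟧ ℕ.* G u))
        ≡⟨ Σ∈-applyUpTo id (suc M) (λ d → Σ∈ (words (ℓ′ ℕ.+ d)) (λ u → ⟦ segmentOfRiseᵇ d u ⟧ ℕ.* G u)) ⟩
      Σ< (suc M) (λ d → Σ∈ (words (ℓ′ ℕ.+ d)) (λ u → ⟦ segmentOfRiseᵇ d u ⟧ ℕ.* G u)) ∎
      where open ≡-Reasoning

    Σsegments-sameWord : ∀ M (b : Segment) → rise b ℕ.≤ M → Σ∈ (segments M) (λ a → ⟦ sameWordᵇ (proj₁ a) (proj₁ b) ⟧) ≡ 1
    Σsegments-sameWord M (v , hv) rise≤M = begin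
      Σ∈ (segments M) (λ a → ⟦ sameWordᵇ (proj₁ a) v ⟧)
        ≡⟨ Σsegments M (λ a → ⟦ sameWordᵇ (proj₁ a) v ⟧) (λ u → ⟦ sameWordᵇ u v ⟧) (λ a → refl) ⟩
      Σ< (suc M) (λ d → Σ∈ (words (ℓ′ ℕ.+ d)) (λ u → ⟦ segmentOfRiseᵇ d u ⟧ ℕ.* ⟦ sameWordᵇ u v ⟧))
        ≡⟨ Σ<-ext (suc M) (λ d → trans (Σ∈-ext (words (ℓ′ ℕ.+ d)) (λ u → trans (cong (λ z → ⟦ segmentOfRiseᵇ d u ⟧ ℕ.* ⟦ z ⟧) (sameWord-comm u v)) (⟦⟧-sameWord-transfer (segmentOfRiseᵇ d) v u)))
                                      (trans (Σ∈-*ˡ (words (ℓ′ ℕ.+ d)) ⟦ segmentOfRiseᵇ d v ⟧ (λ u → ⟦ sameWordᵇ v u ⟧))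
                                        (cong (⟦ segmentOfRiseᵇ d v ⟧ ℕ.*_) (Σwords-sameWord (ℓ′ ℕ.+ d) v)))) ⟩
      Σ< (suc M) (λ d → ⟦ segmentOfRiseᵇ d v ⟧ ℕ.* ⟦ length v ≡ᵇ ℓ′ ℕ.+ d ⟧)
        ≡⟨ Σ<-single (suc M) (λ d → ⟦ segmentOfRiseᵇ d v ⟧ ℕ.* ⟦ length v ≡ᵇ ℓ′ ℕ.+ d ⟧) (countN v) (s≤s rise≤M) (λ d _ ne → other-rise d ne) ⟩
      ⟦ segmentOfRiseᵇ (countN v) v ⟧ ℕ.* ⟦ length v ≡ᵇ ℓ′ ℕ.+ countN v ⟧
        ≡⟨ cong₂ (λ x y → ⟦ x ⟧ ℕ.* ⟦ y ⟧) (cong (_∧ (countN v ≡ᵇ countN v)) (T-ext {segmentᵇ v} (λ _ → tt) (λ _ → hv)))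
             (cong (_≡ᵇ ℓ′ ℕ.+ countN v) length-v) ⟩
      ⟦ true ∧ (countN v ≡ᵇ countN v) ⟧ ℕ.* ⟦ ℓ′ ℕ.+ countN v ≡ᵇ ℓ′ ℕ.+ countN v ⟧
        ≡⟨ cong₂ (λ x y → ⟦ x ⟧ ℕ.* ⟦ y ⟧) (≡ᵇ-refl (countN v)) (≡ᵇ-refl (ℓ′ ℕ.+ countN v)) ⟩
      1 ∎
      where
      open ≡-Reasoning
      length-v : length v ≡ ℓ′ ℕ.+ countN v
      length-v = trans (length≡countE+countN v) (cong (ℕ._+ countN v) (segment-countE v hv))
      other-rise : ∀ d → d ≢ countN v → ⟦ segmentOfRiseᵇ d v ⟧ ℕ.* ⟦ length v ≡ᵇ ℓ′ ℕ.+ d ⟧ ≡ 0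
      other-rise d ne with countN v ≡ᵇ d in eq
      ... | true = ⊥-elim (ne (sym (ℕP.≡ᵇ⇒≡ (countN v) d (subst T (sym eq) tt))))
      ... | false = cong (λ z → ⟦ z ⟧ ℕ.* ⟦ length v ≡ᵇ ℓ′ ℕ.+ d ⟧) (∧-zeroʳ (segmentᵇ v))

    splitAtE : ℕ → List Step → List Step × List Step
    splitAtE j [] = [] , []
    splitAtE j (N ∷ w) = N ∷ proj₁ (splitAtE j w) , proj₂ (splitAtE j w)
    splitAtE zero (E ∷ w) = [] , E ∷ w
    splitAtE (suc j) (E ∷ w) = E ∷ proj₁ (splitAtE j w) , proj₂ (splitAtE j w)

    splitAtE-++ : ∀ j w → proj₁ (splitAtE j w) ++ proj₂ (splitAtE j w) ≡ w
    splitAtE-++ j [] = refl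
    splitAtE-++ j (N ∷ w) = cong (N ∷_) (splitAtE-++ j w)
    splitAtE-++ zero (E ∷ w) = refl
    splitAtE-++ (suc j) (E ∷ w) = cong (E ∷_) (splitAtE-++ j w)

    splitAtE-startsWithE : ∀ j w → T (startsWithEᵇ (proj₂ (splitAtE j w)))
    splitAtE-startsWithE j [] = tt
    splitAtE-startsWithE j (N ∷ w) = splitAtE-startsWithE j w
    splitAtE-startsWithE zero (E ∷ w) = tt
    splitAtE-startsWithE (suc j) (E ∷ w) = splitAtE-startsWithE j w

    splitAtE-countE : ∀ j w → j ℕ.≤ countE w → countE (proj₁ (splitAtE j w)) ≡ j
    splitAtE-countE zero [] p = refl
    splitAtE-countE j (N ∷ w) p = splitAtE-countE j w p
    splitAtE-countE zero (E ∷ w) p = refl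
    splitAtE-countE (suc j) (E ∷ w) (s≤s p) = cong suc (splitAtE-countE j w p)

    parse : ∀ n v → T (startsWithEᵇ v) → countE v ≡ ℓ ℕ.* n →
            ∃ λ τ → length τ ≡ n × glue τ ≡ v × All (λ a → rise a ℕ.≤ countN v) τ
    parse zero [] startsE e = [] , refl , refl , []
    parse n (N ∷ v) () e
    parse zero (E ∷ v) startsE e with trans e (ℕP.*-zeroʳ ℓ)
    ... | ()
    parse (suc n) [] startsE ()
    parse (suc n) (E ∷ w) _ e =
      (u , ℕP.≡⇒≡ᵇ (countE u) ℓ′ countE-u) ∷ τ , cong suc ∣τ∣ ,
      trans (cong (λ z → E ∷ u ++ z) glue-τ) (cong (E ∷_) (splitAtE-++ ℓ′ w)) ,
      (u≤w ∷ All.map (λ p → ℕP.≤-trans p r≤w) rises)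
      where
      u r : List Step
      u = proj₁ (splitAtE ℓ′ w)
      r = proj₂ (splitAtE ℓ′ w)
      countE-w : countE w ≡ ℓ′ ℕ.+ ℓ ℕ.* n
      countE-w = ℕP.suc-injective (trans e (ℕP.*-suc ℓ n))
      countE-u : countE u ≡ ℓ′
      countE-u = splitAtE-countE ℓ′ w (subst (ℓ′ ℕ.≤_) (sym countE-w) (ℕP.m≤m+n ℓ′ _))
      countE-r : countE r ≡ ℓ ℕ.* n
      countE-r = ℕP.+-cancelˡ-≡ ℓ′ (countE r) (ℓ ℕ.* n)
        (trans (cong (ℕ._+ countE r) (sym countE-u)) (trans (sym (countE-++ u r)) (trans (cong countE (splitAtE-++ ℓ′ w)) countE-w)))
      parsed : ∃ λ τ → length τ ≡ n × glue τ ≡ r × All (λ a → rise a ℕ.≤ countN r) τ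
      parsed = parse n r (splitAtE-startsWithE ℓ′ w) countE-r
      τ : List Segment
      τ = proj₁ parsed
      ∣τ∣ : length τ ≡ n
      ∣τ∣ = proj₁ (proj₂ parsed)
      glue-τ : glue τ ≡ r
      glue-τ = proj₁ (proj₂ (proj₂ parsed))
      rises : All (λ a → rise a ℕ.≤ countN r) τ
      rises = proj₂ (proj₂ (proj₂ parsed))
      countN-w : countN u ℕ.+ countN r ≡ countN w
      countN-w = trans (sym (countN-++ u r)) (cong countN (splitAtE-++ ℓ′ w))
      u≤w : countN u ℕ.≤ countN w
      u≤w = subst (countN u ℕ.≤_) countN-w (ℕP.m≤m+n _ _)
      r≤w : countN r ℕ.≤ countN w
      r≤w = subst (countN r ℕ.≤_) countN-w (ℕP.m≤n+m _ _)

    afterE : (List Step → Bool) → List Step → Bool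
    afterE R [] = false
    afterE R (N ∷ _) = false
    afterE R (E ∷ w) = R w

    risePrefix : List Segment → ℕ → ℕ
    risePrefix σ zero = 0
    risePrefix [] (suc t) = 0
    risePrefix (a ∷ σ) (suc t) = rise a ℕ.+ risePrefix σ t

    countE-glue : ∀ σ → countE (glue σ) ≡ ℓ ℕ.* length σ
    countE-glue [] = sym (ℕP.*-zeroʳ ℓ)
    countE-glue ((u , hu) ∷ σ) = trans (cong suc (trans (countE-++ u (glue σ)) (cong₂ ℕ._+_ (segment-countE u hu) (countE-glue σ)))) (sym (ℕP.*-suc ℓ (length σ)))

    countN-glue : ∀ σ → countN (glue σ) ≡ risePrefix σ (length σ)
    countN-glue [] = refl
    countN-glue ((u , hu) ∷ σ) = trans (countN-++ u (glue σ)) (cong (countN u ℕ.+_) (countN-glue σ))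

    risesOKᵇ : ℕ → ℕ → List Segment → Bool
    risesOKᵇ i y [] = true
    risesOKᵇ i y (a ∷ σ) = (y ℕ.+ rise a ≤ᵇ suc i ℕ.* k) ∧ risesOKᵇ (suc i) (y ℕ.+ rise a) σ

    risesOK-elim : ∀ σ i y → T (risesOKᵇ i y σ) → ∀ t → t ℕ.< length σ → y ℕ.+ risePrefix σ (suc t) ℕ.≤ (i ℕ.+ suc t) ℕ.* k
    risesOK-elim (a ∷ σ) i y h zero p = subst₂ ℕ._≤_ (cong (y ℕ.+_) (sym (ℕP.+-identityʳ (rise a)))) (cong (ℕ._* k) (ℕP.+-comm 1 i)) (ℕP.≤ᵇ⇒≤ (y ℕ.+ rise a) (suc i ℕ.* k) (∧-elimˡ {y ℕ.+ rise a ≤ᵇ suc i ℕ.* k} h))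
    risesOK-elim (a ∷ σ) i y h (suc t) (s≤s p) = subst₂ ℕ._≤_ (ℕP.+-assoc y (rise a) (risePrefix σ (suc t))) (cong (ℕ._* k) (sym (ℕP.+-suc i (suc t))))
       (risesOK-elim σ (suc i) (y ℕ.+ rise a) (∧-elimʳ {y ℕ.+ rise a ≤ᵇ suc i ℕ.* k} h) t p)

    risesOK-intro : ∀ σ i y → (∀ t → t ℕ.< length σ → y ℕ.+ risePrefix σ (suc t) ℕ.≤ (i ℕ.+ suc t) ℕ.* k) → T (risesOKᵇ i y σ)
    risesOK-intro [] i y h = tt
    risesOK-intro (a ∷ σ) i y h = ∧-intro (ℕP.≤⇒≤ᵇ (subst₂ ℕ._≤_ (cong (y ℕ.+_) (ℕP.+-identityʳ (rise a))) (cong (ℕ._* k) (ℕP.+-comm i 1)) (h 0 (s≤s z≤n))))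
       (risesOK-intro σ (suc i) (y ℕ.+ rise a) (λ t p → subst₂ ℕ._≤_ (sym (ℕP.+-assoc y (rise a) (risePrefix σ (suc t)))) (cong (ℕ._* k) (ℕP.+-suc i (suc t))) (h (suc t) (s≤s p))))

    -- The step alphabet of a walk must be a finite list, so only segments with at most M north steps
    -- are letters; M = k n covers every path with n blocks that ends at height k n.
    module Bounded (M : ℕ) where
      open Walks (segments M) segmentStep public

      Σwalks-glue : ∀ (τ : List Segment) → All (λ a → rise a ℕ.≤ M) τ → Σ∈ (walks (length τ)) (λ σ → ⟦ sameWordᵇ (glue σ) (glue τ) ⟧) ≡ 1
      Σwalks-glue [] [] = refl
      Σwalks-glue (b ∷ τ) (rise≤M ∷ sτ) = begin
        Σ∈ (walks (suc (length τ))) (λ σ → ⟦ sameWordᵇ (glue σ) (glue (b ∷ τ)) ⟧)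
          ≡⟨ Σwalks-suc (length τ) (λ σ → ⟦ sameWordᵇ (glue σ) (glue (b ∷ τ)) ⟧) ⟩
        Σ∈ (segments M) (λ a → Σ∈ (walks (length τ)) (λ σ → ⟦ sameWordᵇ (proj₁ a ++ glue σ) (proj₁ b ++ glue τ) ⟧))
          ≡⟨ Σ∈-ext (segments M) (λ a → Σ∈-ext (walks (length τ)) (λ σ →
               trans (cong ⟦_⟧ (sameWord-++ (proj₁ a) (proj₁ b) (glue σ) (glue τ) (trans (segment-countE (proj₁ a) (proj₂ a)) (sym (segment-countE (proj₁ b) (proj₂ b)))) (glue-startsWithE σ) (glue-startsWithE τ)))
                     (⟦⟧-∧ (sameWordᵇ (proj₁ a) (proj₁ b)) (sameWordᵇ (glue σ) (glue τ))))) ⟩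
        Σ∈ (segments M) (λ a → Σ∈ (walks (length τ)) (λ σ → ⟦ sameWordᵇ (proj₁ a) (proj₁ b) ⟧ ℕ.* ⟦ sameWordᵇ (glue σ) (glue τ) ⟧))
          ≡⟨ Σ∈-ext (segments M) (λ a → trans (Σ∈-*ˡ (walks (length τ)) ⟦ sameWordᵇ (proj₁ a) (proj₁ b) ⟧ (λ σ → ⟦ sameWordᵇ (glue σ) (glue τ) ⟧))
                                          (trans (cong (⟦ sameWordᵇ (proj₁ a) (proj₁ b) ⟧ ℕ.*_) (Σwalks-glue τ sτ)) (ℕP.*-identityʳ ⟦ sameWordᵇ (proj₁ a) (proj₁ b) ⟧))) ⟩
        Σ∈ (segments M) (λ a → ⟦ sameWordᵇ (proj₁ a) (proj₁ b) ⟧)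
          ≡⟨ Σsegments-sameWord M b rise≤M ⟩
        1 ∎
        where open ≡-Reasoning

      Σwalks-glue′ : ∀ n v → T (startsWithEᵇ v) → countE v ≡ ℓ ℕ.* n → countN v ℕ.≤ M → Σ∈ (walks n) (λ σ → ⟦ sameWordᵇ (glue σ) v ⟧) ≡ 1
      Σwalks-glue′ n v startsE e countN≤M with parse n v startsE e
      ... | τ , refl , refl , aτ = Σwalks-glue τ (All.map (λ p → ℕP.≤-trans p countN≤M) aτ)

      Σwords-as-walks : ∀ n L (R : List Step → Bool) → (∀ w → T (R w) → countE w ≡ ℓ′ ℕ.+ ℓ ℕ.* (n ∸ 1) × countN w ℕ.≤ M × 1 ℕ.≤ n) →
            Σ∈ (words L) (λ w → ⟦ R w ⟧) ≡ Σ∈ (walks n) (λ σ → ⟦ afterE R (glue σ) ⟧ ℕ.* ⟦ length (glue σ) ≡ᵇ suc L ⟧)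
      Σwords-as-walks n L R hyp = begin
        Σ∈ (words L) (λ w → ⟦ R w ⟧)
          ≡⟨ sym (Σwords-suc L (λ v → ⟦ afterE R v ⟧)) ⟩
        Σ∈ (words (suc L)) (λ v → ⟦ afterE R v ⟧)
          ≡⟨ Σ∈-ext (words (suc L)) (λ v → trans (sym (ℕP.*-identityʳ _)) (⟦⟧-*-cong (afterE R v) (λ h → sym (unique-glue v h)))) ⟩
        Σ∈ (words (suc L)) (λ v → ⟦ afterE R v ⟧ ℕ.* Σ∈ (walks n) (λ σ → ⟦ sameWordᵇ (glue σ) v ⟧))
          ≡⟨ Σ∈-ext (words (suc L)) (λ v → sym (Σ∈-*ˡ (walks n) ⟦ afterE R v ⟧ (λ σ → ⟦ sameWordᵇ (glue σ) v ⟧))) ⟩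
        Σ∈ (words (suc L)) (λ v → Σ∈ (walks n) (λ σ → ⟦ afterE R v ⟧ ℕ.* ⟦ sameWordᵇ (glue σ) v ⟧))
          ≡⟨ Σ∈-swap (words (suc L)) (walks n) (λ v σ → ⟦ afterE R v ⟧ ℕ.* ⟦ sameWordᵇ (glue σ) v ⟧) ⟩
        Σ∈ (walks n) (λ σ → Σ∈ (words (suc L)) (λ v → ⟦ afterE R v ⟧ ℕ.* ⟦ sameWordᵇ (glue σ) v ⟧))
          ≡⟨ Σ∈-ext (walks n) (λ σ → trans (Σ∈-ext (words (suc L)) (λ v → ⟦⟧-sameWord-transfer (afterE R) (glue σ) v))
               (trans (Σ∈-*ˡ (words (suc L)) ⟦ afterE R (glue σ) ⟧ (λ v → ⟦ sameWordᵇ (glue σ) v ⟧))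
                      (cong (⟦ afterE R (glue σ) ⟧ ℕ.*_) (Σwords-sameWord (suc L) (glue σ))))) ⟩
        Σ∈ (walks n) (λ σ → ⟦ afterE R (glue σ) ⟧ ℕ.* ⟦ length (glue σ) ≡ᵇ suc L ⟧) ∎
        where
        open ≡-Reasoning
        unique-glue : ∀ v → T (afterE R v) → Σ∈ (walks n) (λ σ → ⟦ sameWordᵇ (glue σ) v ⟧) ≡ 1
        unique-glue (E ∷ w) h with hyp w h
        ... | ew , nw , p1 = Σwalks-glue′ n (E ∷ w) tt (countE-shape n ew p1) nw
          where
          countE-shape : ∀ n → countE w ≡ ℓ′ ℕ.+ ℓ ℕ.* (n ∸ 1) → 1 ℕ.≤ n → suc (countE w) ≡ ℓ ℕ.* n
          countE-shape (suc n₁) ew _ = trans (cong suc ew) (sym (ℕP.*-suc ℓ n₁))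

      height+risePrefix : ∀ σ t → t ℕ.≤ length σ → height σ t ℤ.+ + risePrefix σ t ≡ + (t ℕ.* k)
      height+risePrefix σ zero p = refl
      height+risePrefix (a ∷ σ) (suc t) (s≤s p) = begin
        (segmentStep a ℤ.+ height σ t) ℤ.+ + (rise a ℕ.+ risePrefix σ t) ≡⟨ cong (λ z → (segmentStep a ℤ.+ height σ t) ℤ.+ z) (ℤP.pos-+ (rise a) (risePrefix σ t)) ⟩
        ((+ k ℤ.- + rise a) ℤ.+ height σ t) ℤ.+ (+ rise a ℤ.+ + risePrefix σ t) ≡⟨ ringL (+ k) (+ rise a) (height σ t) (+ risePrefix σ t) ⟩
        + k ℤ.+ (height σ t ℤ.+ + risePrefix σ t) ≡⟨ cong (λ z → + k ℤ.+ z) (height+risePrefix σ t p) ⟩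
        + k ℤ.+ + (t ℕ.* k) ≡⟨ sym (ℤP.pos-+ k (t ℕ.* k)) ⟩
        + (suc t ℕ.* k) ∎
        where
        open ≡-Reasoning
        open import Data.Integer.Tactic.RingSolver using (solve-∀)
        ringL : ∀ (k s h rises : ℤ) → ((k ℤ.- s) ℤ.+ h) ℤ.+ (s ℤ.+ rises) ≡ k ℤ.+ (h ℤ.+ rises)
        ringL = solve-∀

      nonneg⇒risePrefix≤ : ∀ σ t → t ℕ.≤ length σ → ℤ.0ℤ ℤ.≤ height σ t → risePrefix σ t ℕ.≤ t ℕ.* k
      nonneg⇒risePrefix≤ σ t p h = ℤP.drop‿+≤+ (subst (+ risePrefix σ t ℤ.≤_) (height+risePrefix σ t p) (ℤP.+-monoˡ-≤ (+ risePrefix σ t) h))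

      risePrefix≤⇒nonneg : ∀ σ t → t ℕ.≤ length σ → risePrefix σ t ℕ.≤ t ℕ.* k → ℤ.0ℤ ℤ.≤ height σ t
      risePrefix≤⇒nonneg σ t p h = ℤP.≮⇒≥ (λ lt → ℤP.<⇒≱ (subst (ℤ._< + risePrefix σ t) (height+risePrefix σ t p) (ℤP.+-monoˡ-< (+ risePrefix σ t) lt)) (ℤ.+≤+ h))

      returns⇒risePrefix≡ : ∀ σ t → t ℕ.≤ length σ → height σ t ≡ ℤ.0ℤ → risePrefix σ t ≡ t ℕ.* k
      returns⇒risePrefix≡ σ t p h = ℤP.+-injective (trans (sym (cong (λ z → z ℤ.+ + risePrefix σ t) h)) (height+risePrefix σ t p))

      risePrefix≡⇒returns : ∀ σ t → t ℕ.≤ length σ → risePrefix σ t ≡ t ℕ.* k → height σ t ≡ ℤ.0ℤ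
      risePrefix≡⇒returns σ t p h = trans (sym (ℤP.+-identityʳ (height σ t))) (trans (cong (λ z → height σ t ℤ.+ z) (sym (ℤP.+-inverseʳ (+ risePrefix σ t))))
                        (trans (sym (ℤP.+-assoc (height σ t) _ _)) (trans (cong (λ z → z ℤ.- + risePrefix σ t) (height+risePrefix σ t p))
                          (trans (cong (λ z → + z ℤ.- + risePrefix σ t) (sym h)) (ℤP.+-inverseʳ (+ risePrefix σ t))))))

    module Boundary (m : ℕ) where
      block lastBlock : List Step
      block = replicate k N ++ replicate ℓ E
      lastBlock = replicate k N ++ replicate ℓ′ E

      boundaryPath : List Step
      boundaryPath = boundary k ℓ m

      reaches-boundary : ∀ m' j i r Y → j ℕ.≤ i → i ℕ.≤ j ℕ.+ m' → r ℕ.< ℓ →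
           reachesᵇ (i ℕ.* ℓ ℕ.+ r) Y (j ℕ.* ℓ , j ℕ.* k) (concat (replicate m' block) ++ lastBlock) ≡ (Y ≤ᵇ suc i ℕ.* k)
      reaches-boundary zero j i r Y p q r<ℓ with ℕP.≤-antisym p (subst (i ℕ.≤_) (ℕP.+-identityʳ j) q)
      ... | refl = begin
        reachesᵇ X Y (j ℕ.* ℓ , j ℕ.* k) (replicate k N ++ replicate ℓ′ E)
          ≡⟨ reaches-N X Y (j ℕ.* ℓ) (j ℕ.* k) k (replicate ℓ′ E) ⟩
        reachesᵇ X Y (j ℕ.* ℓ , j ℕ.* k ℕ.+ k) (replicate ℓ′ E)
          ≡⟨ cong (reachesᵇ X Y (j ℕ.* ℓ , j ℕ.* k ℕ.+ k)) (sym (++-identityʳ (replicate ℓ′ E))) ⟩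
        reachesᵇ X Y (j ℕ.* ℓ , j ℕ.* k ℕ.+ k) (replicate ℓ′ E ++ [])
          ≡⟨ last-block (ℕP.m≤n⇒m<n∨m≡n (ℕP.≤-pred r<ℓ)) ⟩
        (Y ≤ᵇ j ℕ.* k ℕ.+ k)
          ≡⟨ cong (Y ≤ᵇ_) (ℕP.+-comm (j ℕ.* k) k) ⟩
        (Y ≤ᵇ suc j ℕ.* k) ∎
        where
        open ≡-Reasoning
        X : ℕ
        X = j ℕ.* ℓ ℕ.+ r
        last-block : r ℕ.< ℓ′ ⊎ r ≡ ℓ′ → reachesᵇ X Y (j ℕ.* ℓ , j ℕ.* k ℕ.+ k) (replicate ℓ′ E ++ []) ≡ (Y ≤ᵇ j ℕ.* k ℕ.+ k)
        last-block (inj₁ r<) = reaches-E-within X Y (j ℕ.* ℓ) _ ℓ′ [] (ℕP.m≤m+n _ r) (ℕP.+-monoʳ-< (j ℕ.* ℓ) r<)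
        last-block (inj₂ refl) = trans (reaches-E-past X Y (j ℕ.* ℓ) _ ℓ′ [] ℕP.≤-refl) (last-point (Y ≤ᵇ j ℕ.* k ℕ.+ k))
          where
          last-point : ∀ b → (((X ≡ᵇ X) ∧ b) ∨ false) ≡ b
          last-point b rewrite ≡ᵇ-refl X with b
          ... | true = refl
          ... | false = refl
      reaches-boundary (suc m') j i r Y p q r<ℓ = begin
        reachesᵇ X Y (j ℕ.* ℓ , j ℕ.* k) ((block ++ concat (replicate m' block)) ++ lastBlock)
          ≡⟨ cong (reachesᵇ X Y (j ℕ.* ℓ , j ℕ.* k)) (trans (++-assoc block _ lastBlock) (++-assoc (replicate k N) (replicate ℓ E) _)) ⟩
        reachesᵇ X Y (j ℕ.* ℓ , j ℕ.* k) (replicate k N ++ (replicate ℓ E ++ rest))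
          ≡⟨ reaches-N X Y (j ℕ.* ℓ) (j ℕ.* k) k _ ⟩
        reachesᵇ X Y (j ℕ.* ℓ , j ℕ.* k ℕ.+ k) (replicate ℓ E ++ rest)
          ≡⟨ step (ℕP.m≤n⇒m<n∨m≡n p) ⟩
        (Y ≤ᵇ suc i ℕ.* k) ∎
        where
        open ≡-Reasoning
        X : ℕ
        X = i ℕ.* ℓ ℕ.+ r
        rest : List Step
        rest = concat (replicate m' block) ++ lastBlock
        step : j ℕ.< i ⊎ j ≡ i → reachesᵇ X Y (j ℕ.* ℓ , j ℕ.* k ℕ.+ k) (replicate ℓ E ++ rest) ≡ (Y ≤ᵇ suc i ℕ.* k)
        step (inj₂ refl) = trans (reaches-E-within X Y (j ℕ.* ℓ) _ ℓ rest (ℕP.m≤m+n _ r) (ℕP.+-monoʳ-< (j ℕ.* ℓ) r<ℓ))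
                                 (cong (Y ≤ᵇ_) (ℕP.+-comm (j ℕ.* k) k))
        step (inj₁ j<i) = begin
          reachesᵇ X Y (j ℕ.* ℓ , j ℕ.* k ℕ.+ k) (replicate ℓ E ++ rest)
            ≡⟨ reaches-E-past X Y (j ℕ.* ℓ) _ ℓ rest le ⟩
          reachesᵇ X Y (j ℕ.* ℓ ℕ.+ ℓ , j ℕ.* k ℕ.+ k) rest
            ≡⟨ cong₂ (λ a b → reachesᵇ X Y (a , b) rest) (ℕP.+-comm (j ℕ.* ℓ) ℓ) (ℕP.+-comm (j ℕ.* k) k) ⟩
          reachesᵇ X Y (suc j ℕ.* ℓ , suc j ℕ.* k) rest
            ≡⟨ reaches-boundary m' (suc j) i r Y j<i (subst (i ℕ.≤_) (ℕP.+-suc j m') q) r<ℓ ⟩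
          (Y ≤ᵇ suc i ℕ.* k) ∎
          where
          le : j ℕ.* ℓ ℕ.+ ℓ ℕ.≤ X
          le = ℕP.≤-trans (ℕP.≤-reflexive (ℕP.+-comm (j ℕ.* ℓ) ℓ)) (ℕP.≤-trans (ℕP.*-monoˡ-≤ ℓ j<i) (ℕP.m≤m+n (i ℕ.* ℓ) r))

      belowBoundaryᵇ : ℕ × ℕ → Bool
      belowBoundaryᵇ p = reachesᵇ (proj₁ p) (proj₂ p) (0 , 0) boundaryPath

      belowBoundary-at : ∀ i r Y → i ℕ.≤ m → r ℕ.< ℓ → belowBoundaryᵇ (i ℕ.* ℓ ℕ.+ r , Y) ≡ (Y ≤ᵇ suc i ℕ.* k)
      belowBoundary-at i r Y p r<ℓ = reaches-boundary m 0 i r Y z≤n p r<ℓ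

      ≤ᵇ-step : ∀ y c K → (y ≤ᵇ K) ∧ (suc y ℕ.+ c ≤ᵇ K) ≡ (y ℕ.+ suc c ≤ᵇ K)
      ≤ᵇ-step y c K = trans (∧-absorb (y ≤ᵇ K) _ (λ h → ℕP.≤⇒≤ᵇ (ℕP.≤-trans (ℕP.m≤m+n y c) (ℕP.<⇒≤ (ℕP.≤ᵇ⇒≤ (suc y ℕ.+ c) K h)))))
                            (cong (_≤ᵇ K) (sym (ℕP.+-suc y c)))

      ≤ᵇ-step0 : ∀ y c K → (y ≤ᵇ K) ∧ (y ℕ.+ c ≤ᵇ K) ≡ (y ℕ.+ c ≤ᵇ K)
      ≤ᵇ-step0 y c K = ∧-absorb (y ≤ᵇ K) _ (λ h → ℕP.≤⇒≤ᵇ (ℕP.≤-trans (ℕP.m≤m+n y c) (ℕP.≤ᵇ⇒≤ (y ℕ.+ c) K h)))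

      belowBoundary-segment : ∀ u r y j₀ i → countE u ≡ j₀ → r ℕ.+ j₀ ≡ ℓ′ → i ℕ.≤ m →
             all belowBoundaryᵇ (pointsFrom (i ℕ.* ℓ ℕ.+ r , y) u) ≡ (y ℕ.+ countN u ≤ᵇ suc i ℕ.* k)
      belowBoundary-segment [] r y j₀ i e1 e2 i≤m = trans (∧-identityʳ _) (trans (belowBoundary-at i r y i≤m (s≤s (subst (r ℕ.≤_) e2 (ℕP.m≤m+n r j₀))))
                                    (cong (_≤ᵇ suc i ℕ.* k) (sym (ℕP.+-identityʳ y))))
      belowBoundary-segment (N ∷ u) r y j₀ i e1 e2 i≤m = trans (cong₂ _∧_ (belowBoundary-at i r y i≤m r<ℓ) (belowBoundary-segment u r (suc y) j₀ i e1 e2 i≤m))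
                                              (≤ᵇ-step y (countN u) (suc i ℕ.* k))
        where
        r<ℓ : r ℕ.< ℓ
        r<ℓ = s≤s (subst (r ℕ.≤_) e2 (ℕP.m≤m+n r j₀))
      belowBoundary-segment (E ∷ u) r y (suc j₁) i e1 e2 i≤m = trans (cong₂ _∧_ (belowBoundary-at i r y i≤m r<ℓ)
                                                  (trans (cong (λ z → all belowBoundaryᵇ (pointsFrom (z , y) u)) (sym (ℕP.+-suc (i ℕ.* ℓ) r)))
                                                    (belowBoundary-segment u (suc r) y j₁ i (ℕP.suc-injective e1) (trans (sym (ℕP.+-suc r j₁)) e2) i≤m)))
                                              (≤ᵇ-step0 y (countN u) (suc i ℕ.* k))
        where
        r<ℓ : r ℕ.< ℓ
        r<ℓ = s≤s (subst (r ℕ.≤_) e2 (ℕP.m≤m+n r (suc j₁)))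

      belowBoundary-glue : ∀ a σ′ i y → i ℕ.+ length σ′ ≡ m →
             all belowBoundaryᵇ (pointsFrom (i ℕ.* ℓ , y) (proj₁ a ++ glue σ′)) ≡ risesOKᵇ i y (a ∷ σ′)
      belowBoundary-glue (u , hu) [] i y e = begin
        all belowBoundaryᵇ (pointsFrom (i ℕ.* ℓ , y) (u ++ []))
          ≡⟨ cong₂ (λ z w → all belowBoundaryᵇ (pointsFrom (z , y) w)) (sym (ℕP.+-identityʳ (i ℕ.* ℓ))) (++-identityʳ u) ⟩
        all belowBoundaryᵇ (pointsFrom (i ℕ.* ℓ ℕ.+ 0 , y) u)
          ≡⟨ belowBoundary-segment u 0 y ℓ′ i (segment-countE u hu) refl (ℕP.≤-reflexive (trans (sym (ℕP.+-identityʳ i)) e)) ⟩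
        (y ℕ.+ countN u ≤ᵇ suc i ℕ.* k)
          ≡⟨ sym (∧-identityʳ _) ⟩
        risesOKᵇ i y ((u , hu) ∷ []) ∎
        where
        open ≡-Reasoning
      belowBoundary-glue (u , hu) (b ∷ σ″) i y e = begin
        all belowBoundaryᵇ (pointsFrom (i ℕ.* ℓ , y) (u ++ E ∷ proj₁ b ++ glue σ″))
          ≡⟨ all-points-++E belowBoundaryᵇ (i ℕ.* ℓ , y) u (proj₁ b ++ glue σ″) ⟩
        all belowBoundaryᵇ (pointsFrom (i ℕ.* ℓ , y) u) ∧ all belowBoundaryᵇ (pointsFrom (suc (proj₁ (endpoint (i ℕ.* ℓ , y) u)) , proj₂ (endpoint (i ℕ.* ℓ , y) u)) (proj₁ b ++ glue σ″))
          ≡⟨ cong₂ _∧_ (trans (cong (λ z → all belowBoundaryᵇ (pointsFrom (z , y) u)) (sym (ℕP.+-identityʳ (i ℕ.* ℓ))))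
                             (belowBoundary-segment u 0 y ℓ′ i (segment-countE u hu) refl i≤m))
                       (cong (λ q → all belowBoundaryᵇ (pointsFrom q (proj₁ b ++ glue σ″))) endpoint-next) ⟩
        (y ℕ.+ countN u ≤ᵇ suc i ℕ.* k) ∧ all belowBoundaryᵇ (pointsFrom (suc i ℕ.* ℓ , y ℕ.+ countN u) (proj₁ b ++ glue σ″))
          ≡⟨ cong ((y ℕ.+ countN u ≤ᵇ suc i ℕ.* k) ∧_) (belowBoundary-glue b σ″ (suc i) (y ℕ.+ countN u) (trans (sym (ℕP.+-suc i (length σ″))) e)) ⟩
        risesOKᵇ i y ((u , hu) ∷ b ∷ σ″) ∎
        where
        open ≡-Reasoning
        i≤m : i ℕ.≤ m
        i≤m = subst (i ℕ.≤_) e (ℕP.m≤m+n i _)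
        endpoint-next : (suc (proj₁ (endpoint (i ℕ.* ℓ , y) u)) , proj₂ (endpoint (i ℕ.* ℓ , y) u)) ≡ (suc i ℕ.* ℓ , y ℕ.+ countN u)
        endpoint-next = trans (cong (λ q → (suc (proj₁ q) , proj₂ q)) (endpoint≡ (i ℕ.* ℓ) y u))
                   (cong (_, y ℕ.+ countN u) (trans (cong (λ z → suc (i ℕ.* ℓ ℕ.+ z)) (segment-countE u hu))
                     (trans (sym (ℕP.+-suc (i ℕ.* ℓ) ℓ′)) (ℕP.+-comm (i ℕ.* ℓ) ℓ))))

    module Count (M m : ℕ) (kM : k ℕ.* suc m ℕ.≤ M) where
      open Bounded M
      open Boundary m

      n : ℕ
      n = suc m

      east north pathLength : ℕ
      east = ℓ ℕ.* n ∸ 1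
      north = k ℕ.* n
      pathLength = east ℕ.+ north

      east≡ : east ≡ ℓ′ ℕ.+ ℓ ℕ.* m
      east≡ = cong (_∸ 1) (ℕP.*-suc ℓ m)

      endsAtᵇ belowᵇ : List Step → Bool
      endsAtᵇ w = (countE w ≡ᵇ east) ∧ (countN w ≡ᵇ north)
      belowᵇ w = endsAtᵇ w ∧ weaklyBelow w (boundary k ℓ m)

      endsAt-shape : ∀ w → T (endsAtᵇ w) → countE w ≡ ℓ′ ℕ.+ ℓ ℕ.* (n ∸ 1) × countN w ℕ.≤ M × 1 ℕ.≤ n
      endsAt-shape w h = trans (ℕP.≡ᵇ⇒≡ _ _ (∧-elimˡ {countE w ≡ᵇ east} h)) east≡ ,
                 ℕP.≤-trans (ℕP.≤-reflexive (ℕP.≡ᵇ⇒≡ _ _ (∧-elimʳ {countE w ≡ᵇ east} h))) kM , s≤s z≤n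

      below-shape : ∀ w → T (belowᵇ w) → countE w ≡ ℓ′ ℕ.+ ℓ ℕ.* (n ∸ 1) × countN w ℕ.≤ M × 1 ℕ.≤ n
      below-shape w h = endsAt-shape w (∧-elimˡ {endsAtᵇ w} h)

      module _ (a : Segment) (σ′ : List Segment) (lσ : length σ′ ≡ m) where
        σ : List Segment
        σ = a ∷ σ′
        w : List Step
        w = proj₁ a ++ glue σ′
        rises : ℕ
        rises = risePrefix σ n

        countE-w : countE w ≡ east
        countE-w = trans (countE-++ (proj₁ a) (glue σ′)) (trans (cong₂ ℕ._+_ (segment-countE (proj₁ a) (proj₂ a)) (trans (countE-glue σ′) (cong (ℓ ℕ.*_) lσ))) (sym east≡))

        countN-w : countN w ≡ rises
        countN-w = trans (countN-glue σ) (cong (λ z → risePrefix σ (suc z)) lσ)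

        length-glue : length (glue σ) ≡ ℓ ℕ.* n ℕ.+ rises
        length-glue = trans (length≡countE+countN (glue σ)) (cong₂ ℕ._+_ (trans (countE-glue σ) (cong (λ z → ℓ ℕ.* suc z) lσ)) countN-w)

        suc-pathLength : suc pathLength ≡ ℓ ℕ.* n ℕ.+ north
        suc-pathLength = cong (ℕ._+ north) (trans (cong suc east≡) (sym (ℕP.*-suc ℓ m)))

        rises≡⇒length : rises ≡ north → T (length (glue σ) ≡ᵇ suc pathLength)
        rises≡⇒length e = ℕP.≡⇒≡ᵇ _ _ (trans length-glue (trans (cong (ℓ ℕ.* n ℕ.+_) e) (sym suc-pathLength)))

        north≡ : north ≡ n ℕ.* k
        north≡ = ℕP.*-comm k n

        n≤length : n ℕ.≤ length σ
        n≤length = ℕP.≤-reflexive (cong suc (sym lσ))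

        returns-iff-endsAt : ⟦ afterE endsAtᵇ (glue σ) ⟧ ℕ.* ⟦ length (glue σ) ≡ᵇ suc pathLength ⟧ ≡ ⟦ eqb (height σ n) ℤ.0ℤ ⟧
        returns-iff-endsAt = trans (sym (⟦⟧-∧ (endsAtᵇ w) _)) (cong ⟦_⟧ (T-ext fwd bwd))
          where
          fwd : T (endsAtᵇ w ∧ (length (glue σ) ≡ᵇ suc pathLength)) → T (eqb (height σ n) ℤ.0ℤ)
          fwd h = ≡⇒eqb (risePrefix≡⇒returns σ n n≤length (trans (sym countN-w) (trans (ℕP.≡ᵇ⇒≡ _ _ (∧-elimʳ {countE w ≡ᵇ east} (∧-elimˡ {endsAtᵇ w} h))) north≡)))
          bwd : T (eqb (height σ n) ℤ.0ℤ) → T (endsAtᵇ w ∧ (length (glue σ) ≡ᵇ suc pathLength))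
          bwd h = ∧-intro (∧-intro (ℕP.≡⇒≡ᵇ _ _ countE-w) (ℕP.≡⇒≡ᵇ _ _ (trans countN-w rises≡north))) (rises≡⇒length rises≡north)
            where
            rises≡north : rises ≡ north
            rises≡north = trans (returns⇒risePrefix≡ σ n n≤length (eqb⇒≡ h)) (sym north≡)

        weaklyBelow≡risesOK : weaklyBelow w (boundary k ℓ m) ≡ risesOKᵇ 0 0 σ
        weaklyBelow≡risesOK = belowBoundary-glue a σ′ 0 0 lσ

        excursion-iff-below : ⟦ afterE belowᵇ (glue σ) ⟧ ℕ.* ⟦ length (glue σ) ≡ᵇ suc pathLength ⟧ ≡ ⟦ excursionᵇ (height σ) n ⟧
        excursion-iff-below = trans (sym (⟦⟧-∧ (belowᵇ w) _)) (cong ⟦_⟧ (T-ext fwd bwd))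
          where
          fwd : T (belowᵇ w ∧ (length (glue σ) ≡ᵇ suc pathLength)) → T (excursionᵇ (height σ) n)
          fwd h = excursion-intro (height σ) n nonneg (risePrefix≡⇒returns σ n n≤length (trans (sym countN-w) (trans (ℕP.≡ᵇ⇒≡ _ _ (∧-elimʳ {countE w ≡ᵇ east} (∧-elimˡ {endsAtᵇ w} (∧-elimˡ {belowᵇ w} h)))) north≡)))
            where
            risesOK : T (risesOKᵇ 0 0 σ)
            risesOK = subst T weaklyBelow≡risesOK (∧-elimʳ {endsAtᵇ w} (∧-elimˡ {belowᵇ w} h))
            nonneg : ∀ t → t ℕ.≤ n → height σ 0 ℤ.≤ height σ t
            nonneg zero _ = ℤP.≤-refl
            nonneg (suc t) p = risePrefix≤⇒nonneg σ (suc t) (ℕP.≤-trans p n≤length) (risesOK-elim σ 0 0 risesOK t (ℕP.<-≤-trans p n≤length))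
          bwd : T (excursionᵇ (height σ) n) → T (belowᵇ w ∧ (length (glue σ) ≡ᵇ suc pathLength))
          bwd h = ∧-intro (∧-intro (∧-intro (ℕP.≡⇒≡ᵇ _ _ countE-w) (ℕP.≡⇒≡ᵇ _ _ (trans countN-w rises≡north))) (subst T (sym weaklyBelow≡risesOK) risesOK)) (rises≡⇒length rises≡north)
            where
            rises≡north : rises ≡ north
            rises≡north = trans (returns⇒risePrefix≡ σ n n≤length (excursion-returns (height σ) n h)) (sym north≡)
            risesOK : T (risesOKᵇ 0 0 σ)
            risesOK = risesOK-intro σ 0 0 (λ t p → nonneg⇒risePrefix≤ σ (suc t) p (excursion-min (height σ) n h (suc t) (ℕP.≤-trans p (ℕP.≤-reflexive (cong suc lσ)))))

      excursion-iff-below′ : ∀ σ → length σ ≡ n → ⟦ afterE belowᵇ (glue σ) ⟧ ℕ.* ⟦ length (glue σ) ≡ᵇ suc pathLength ⟧ ≡ ⟦ excursionᵇ (height σ) n ⟧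
      excursion-iff-below′ (a ∷ σ′) e = excursion-iff-below a σ′ (ℕP.suc-injective e)

      returns-iff-endsAt′ : ∀ σ → length σ ≡ n → ⟦ afterE endsAtᵇ (glue σ) ⟧ ℕ.* ⟦ length (glue σ) ≡ᵇ suc pathLength ⟧ ≡ ⟦ eqb (height σ n) ℤ.0ℤ ⟧
      returns-iff-endsAt′ (a ∷ σ′) e = returns-iff-endsAt a σ′ (ℕP.suc-injective e)

      f₁≡excursions : f₁ k ℓ n ≡ excursions n
      f₁≡excursions = begin
        f₁ k ℓ n
          ≡⟨ length-filter (λ w → weaklyBelow w (boundary k ℓ m)) (pathsTo east north) ⟩
        Σ∈ (pathsTo east north) (λ w → ⟦ weaklyBelow w (boundary k ℓ m) ⟧)
          ≡⟨ Σ∈-filter endsAtᵇ (words (east ℕ.+ north)) (λ w → ⟦ weaklyBelow w (boundary k ℓ m) ⟧) ⟩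
        Σ∈ (words pathLength) (λ w → ⟦ endsAtᵇ w ⟧ ℕ.* ⟦ weaklyBelow w (boundary k ℓ m) ⟧)
          ≡⟨ Σ∈-ext (words pathLength) (λ w → sym (⟦⟧-∧ (endsAtᵇ w) _)) ⟩
        Σ∈ (words pathLength) (λ w → ⟦ belowᵇ w ⟧)
          ≡⟨ Σwords-as-walks n pathLength belowᵇ below-shape ⟩
        Σ∈ (walks n) (λ σ → ⟦ afterE belowᵇ (glue σ) ⟧ ℕ.* ⟦ length (glue σ) ≡ᵇ suc pathLength ⟧)
          ≡⟨ Σwalks-cong n excursion-iff-below′ ⟩
        excursions n ∎
        where open ≡-Reasoning

      bridges≡C : bridges n ≡ (k ℕ.* n ℕ.+ ℓ ℕ.* n ∸ 1) C (ℓ ℕ.* n ∸ 1)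
      bridges≡C = begin
        bridges n
          ≡⟨ sym (Σwalks-cong n returns-iff-endsAt′) ⟩
        Σ∈ (walks n) (λ σ → ⟦ afterE endsAtᵇ (glue σ) ⟧ ℕ.* ⟦ length (glue σ) ≡ᵇ suc pathLength ⟧)
          ≡⟨ sym (Σwords-as-walks n pathLength endsAtᵇ endsAt-shape) ⟩
        countWords pathLength east north
          ≡⟨ countWords≡C pathLength east north refl ⟩
        pathLength C east
          ≡⟨ cong (_C east) (trans (ℕP.+-comm east north) (sym (ℕP.+-∸-assoc (k ℕ.* n) {ℓ ℕ.* n} {1} (ℕP.≤-trans (s≤s z≤n) (ℕP.≤-reflexive (sym (ℕP.*-suc ℓ m))))))) ⟩
        (k ℕ.* n ℕ.+ ℓ ℕ.* n ∸ 1) C east ∎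
        where open ≡-Reasoning

    bridgeCount : ℕ → ℕ
    bridgeCount i = (k ℕ.* i ℕ.+ ℓ ℕ.* i ∸ 1) C (ℓ ℕ.* i ∸ 1)

    f₁-recurrence : ∀ n → n ℕ.* f₁ k ℓ n ≡ Σ< n (λ i → bridgeCount (suc i) ℕ.* f₁ k ℓ (n ∸ suc i))
    f₁-recurrence n = begin
      n ℕ.* f₁ k ℓ n
        ≡⟨ cong (n ℕ.*_) (excursions≡f₁ n ℕP.≤-refl) ⟨
      n ℕ.* excursions n
        ≡⟨ excursions-recurrence n ⟩
      Σ< n (λ i → bridges (suc i) ℕ.* excursions (n ∸ suc i))
        ≡⟨ Σ<-cong n (λ i i<n → cong₂ ℕ._*_ (Count.bridges≡C M i (ℕP.*-monoʳ-≤ k i<n))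
                                            (excursions≡f₁ (n ∸ suc i) (ℕP.*-monoʳ-≤ k (ℕP.m∸n≤m n (suc i))))) ⟩
      Σ< n (λ i → bridgeCount (suc i) ℕ.* f₁ k ℓ (n ∸ suc i)) ∎
      where
      open ≡-Reasoning
      M : ℕ
      M = k ℕ.* n
      open Bounded M
      excursions≡f₁ : ∀ j → k ℕ.* j ℕ.≤ M → excursions j ≡ f₁ k ℓ j
      excursions≡f₁ zero    _   = refl
      excursions≡f₁ (suc m) k[1+m]≤M = sym (Count.f₁≡excursions M m k[1+m]≤M)

module Exponential where
  open import Algebra.Structures using (IsCommutativeRing)
  open import Data.Integer as ℤ using (ℤ; +_)
  import Data.Integer.Properties as ℤP
  open import Data.Integer.Tactic.RingSolver using (solve-∀)
  open import Data.Nat as ℕ using (ℕ; zero; suc; _∸_; z≤n; s≤s; NonZero; _!)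
  import Data.Nat.Properties as ℕP
  open import Data.Nat.Induction using (<-rec)
  open import Data.Rational as ℚ using (ℚ; _/_; toℚᵘ)
  import Data.Rational.Properties as ℚP
  import Data.Rational.Unnormalised as ℚᵘ
  import Data.Rational.Unnormalised.Properties as ℚᵘP
  open import Function using (id; _∘_)
  open import Relation.Binary.PropositionalEquality
  open import Relation.Nullary using (contradiction)
  open import Defs using (inv!; _⊛_; onePS; _^PS_; expPS)

  open Series (IsCommutativeRing.isCommutativeSemiring ℚP.+-*-isCommutativeRing)

  ι : ℕ → ℚ
  ι n = + n / 1

  private
    toℚᵘ-/ : ∀ i n .{{_ : NonZero n}} → toℚᵘ (i / n) ℚᵘ.≃ ℚᵘ.mkℚᵘ i (ℕ.pred n)
    toℚᵘ-/ i (suc n) = ℚP.toℚᵘ-fromℚᵘ (ℚᵘ.mkℚᵘ i n)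

  ι-+ : ∀ a b → ι (a ℕ.+ b) ≡ ι a ℚ.+ ι b
  ι-+ a b = ℚP.toℚᵘ-injective (begin
    toℚᵘ (ι (a ℕ.+ b))                          ≈⟨ toℚᵘ-/ (+ (a ℕ.+ b)) 1 ⟩
    ℚᵘ.mkℚᵘ (+ (a ℕ.+ b)) 0                     ≈⟨ ℚᵘ.*≡* (trans (cong (ℤ._* (+ 1 ℤ.* + 1)) (ℤP.pos-+ a b)) (lemma (+ a) (+ b))) ⟩
    ℚᵘ.mkℚᵘ (+ a) 0 ℚᵘ.+ ℚᵘ.mkℚᵘ (+ b) 0        ≈⟨ ℚᵘP.≃-sym (ℚᵘP.+-cong (toℚᵘ-/ (+ a) 1) (toℚᵘ-/ (+ b) 1)) ⟩
    toℚᵘ (ι a) ℚᵘ.+ toℚᵘ (ι b)                  ≈⟨ ℚᵘP.≃-sym (ℚP.toℚᵘ-homo-+ (ι a) (ι b)) ⟩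
    toℚᵘ (ι a ℚ.+ ι b)                          ∎)
    where
    open ℚᵘP.≃-Reasoning
    lemma : ∀ (x y : ℤ) → (x ℤ.+ y) ℤ.* (+ 1 ℤ.* + 1) ≡ (x ℤ.* + 1 ℤ.+ y ℤ.* + 1) ℤ.* + 1
    lemma = solve-∀

  ι-* : ∀ a b → ι (a ℕ.* b) ≡ ι a ℚ.* ι b
  ι-* a b = ℚP.toℚᵘ-injective (begin
    toℚᵘ (ι (a ℕ.* b))                          ≈⟨ toℚᵘ-/ (+ (a ℕ.* b)) 1 ⟩
    ℚᵘ.mkℚᵘ (+ (a ℕ.* b)) 0                     ≈⟨ ℚᵘ.*≡* (trans (cong (ℤ._* (+ 1 ℤ.* + 1)) (ℤP.pos-* a b)) (lemma (+ a) (+ b))) ⟩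
    ℚᵘ.mkℚᵘ (+ a) 0 ℚᵘ.* ℚᵘ.mkℚᵘ (+ b) 0        ≈⟨ ℚᵘP.≃-sym (ℚᵘP.*-cong (toℚᵘ-/ (+ a) 1) (toℚᵘ-/ (+ b) 1)) ⟩
    toℚᵘ (ι a) ℚᵘ.* toℚᵘ (ι b)                  ≈⟨ ℚᵘP.≃-sym (ℚP.toℚᵘ-homo-* (ι a) (ι b)) ⟩
    toℚᵘ (ι a ℚ.* ι b)                          ∎)
    where
    open ℚᵘP.≃-Reasoning
    lemma : ∀ (x y : ℤ) → (x ℤ.* y) ℤ.* (+ 1 ℤ.* + 1) ≡ (x ℤ.* y) ℤ.* + 1
    lemma = solve-∀

  ι-*-/ : ∀ c d → ι (suc d) ℚ.* (+ c / suc d) ≡ ι c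
  ι-*-/ c d = ℚP.toℚᵘ-injective (begin
    toℚᵘ (ι (suc d) ℚ.* (+ c / suc d))             ≈⟨ ℚP.toℚᵘ-homo-* (ι (suc d)) (+ c / suc d) ⟩
    toℚᵘ (ι (suc d)) ℚᵘ.* toℚᵘ (+ c / suc d)       ≈⟨ ℚᵘP.*-cong (toℚᵘ-/ (+ suc d) 1) (toℚᵘ-/ (+ c) (suc d)) ⟩
    ℚᵘ.mkℚᵘ (+ suc d) 0 ℚᵘ.* ℚᵘ.mkℚᵘ (+ c) d       ≈⟨ ℚᵘ.*≡* (trans (lemma (+ suc d) (+ c)) (cong (λ z → + c ℤ.* + z) (sym (ℕP.*-identityˡ (suc d))))) ⟩
    ℚᵘ.mkℚᵘ (+ c) 0                                ≈⟨ ℚᵘP.≃-sym (toℚᵘ-/ (+ c) 1) ⟩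
    toℚᵘ (ι c)                                     ∎)
    where
    open ℚᵘP.≃-Reasoning
    lemma : ∀ (x y : ℤ) → (x ℤ.* y) ℤ.* + 1 ≡ y ℤ.* x
    lemma = solve-∀

  ι-*-inv! : ∀ m → ι (suc m) ℚ.* inv! (suc m) ≡ inv! m
  ι-*-inv! m = ℚP.toℚᵘ-injective (begin
    toℚᵘ (ι (suc m) ℚ.* inv! (suc m))                           ≈⟨ ℚP.toℚᵘ-homo-* (ι (suc m)) (inv! (suc m)) ⟩
    toℚᵘ (ι (suc m)) ℚᵘ.* toℚᵘ (inv! (suc m))                   ≈⟨ ℚᵘP.*-cong (toℚᵘ-/ (+ suc m) 1) (toℚᵘ-/ (+ 1) (suc m !)) ⟩
    ℚᵘ.mkℚᵘ (+ suc m) 0 ℚᵘ.* ℚᵘ.mkℚᵘ (+ 1) (ℕ.pred (suc m !))   ≈⟨ ℚᵘ.*≡* cross ⟩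
    ℚᵘ.mkℚᵘ (+ 1) (ℕ.pred (m !))                                ≈⟨ ℚᵘP.≃-sym (toℚᵘ-/ (+ 1) (m !)) ⟩
    toℚᵘ (inv! m)                                               ∎)
    where
    open ℚᵘP.≃-Reasoning
    instance
      m!≢0 : NonZero (m !)
      m!≢0 = ℕP._!≢0 m
      [1+m]!≢0 : NonZero (suc m !)
      [1+m]!≢0 = ℕP._!≢0 (suc m)
    cross : (+ suc m ℤ.* + 1) ℤ.* + suc (ℕ.pred (m !)) ≡ + 1 ℤ.* + (1 ℕ.* suc (ℕ.pred (suc m !)))
    cross = trans (cong₂ (λ x y → x ℤ.* + y) (ℤP.*-identityʳ (+ suc m)) (ℕP.suc-pred (m !)))
           (trans (sym (ℤP.pos-* (suc m) (m !)))
           (trans (cong +_ (sym (trans (ℕP.*-identityˡ _) (ℕP.suc-pred (suc m !))))) (sym (ℤP.*-identityˡ _))))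

  ι-Σ< : ∀ n f → ι (ℕSeries.Σ< n f) ≡ Σ< n (ι ∘ f)
  ι-Σ< zero    f = refl
  ι-Σ< (suc n) f = trans (ι-+ (f 0) _) (cong (ι (f 0) ℚ.+_) (ι-Σ< n (f ∘ suc)))

  ×≡ι* : ∀ n q → n × q ≡ ι n ℚ.* q
  ×≡ι* zero    q = sym (ℚP.*-zeroˡ q)
  ×≡ι* (suc n) q = begin
    q ℚ.+ n × q                ≡⟨ cong₂ ℚ._+_ (sym (ℚP.*-identityˡ q)) (×≡ι* n q) ⟩
    ℚ.1ℚ ℚ.* q ℚ.+ ι n ℚ.* q   ≡⟨ sym (ℚP.*-distribʳ-+ q ℚ.1ℚ (ι n)) ⟩
    (ℚ.1ℚ ℚ.+ ι n) ℚ.* q       ≡⟨ cong (ℚ._* q) (sym (ι-+ 1 n)) ⟩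
    ι (suc n) ℚ.* q            ∎
    where open ≡-Reasoning

  ι-nonZero : ∀ m → ι (suc m) ≢ ℚ.0ℚ
  ι-nonZero m ι≡0 with ℚᵘP.≃-trans (ℚᵘP.≃-sym (toℚᵘ-/ (+ suc m) 1)) (ℚᵘP.≃-reflexive (cong toℚᵘ ι≡0))
  ... | ℚᵘ.*≡* ()

  ι-cancelˡ : ∀ m {x y} → ι (suc m) ℚ.* x ≡ ι (suc m) ℚ.* y → x ≡ y
  ι-cancelˡ m {x} {y} eq = begin
    x                    ≡⟨ sym (ℚP.*-identityˡ x) ⟩
    ℚ.1ℚ ℚ.* x           ≡⟨ cong (ℚ._* x) (sym (ℚP.*-inverseˡ p)) ⟩
    ℚ.1/ p ℚ.* p ℚ.* x   ≡⟨ ℚP.*-assoc (ℚ.1/ p) p x ⟩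
    ℚ.1/ p ℚ.* (p ℚ.* x) ≡⟨ cong (ℚ.1/ p ℚ.*_) eq ⟩
    ℚ.1/ p ℚ.* (p ℚ.* y) ≡⟨ sym (ℚP.*-assoc (ℚ.1/ p) p y) ⟩
    ℚ.1/ p ℚ.* p ℚ.* y   ≡⟨ cong (ℚ._* y) (ℚP.*-inverseˡ p) ⟩
    ℚ.1ℚ ℚ.* y           ≡⟨ ℚP.*-identityˡ y ⟩
    y                    ∎
    where
    open ≡-Reasoning
    p : ℚ
    p = ι (suc m)
    instance
      p≢0 : ℚ.NonZero p
      p≢0 = ℚ.≢-nonZero (ι-nonZero m)

  recurrence-unique : ∀ (a u v : ℕ → ℚ) → u 0 ≡ v 0 →
                      (∀ n → ι n ℚ.* u n ≡ Σ< n (λ i → a (suc i) ℚ.* u (n ∸ suc i))) →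
                      (∀ n → ι n ℚ.* v n ≡ Σ< n (λ i → a (suc i) ℚ.* v (n ∸ suc i))) →
                      ∀ n → u n ≡ v n
  recurrence-unique a u v u₀≡v₀ rec-u rec-v = <-rec (λ n → u n ≡ v n) step
    where
    open ≡-Reasoning
    step : ∀ n → (∀ {j} → j ℕ.< n → u j ≡ v j) → u n ≡ v n
    step zero    _       = u₀≡v₀
    step (suc m) earlier = ι-cancelˡ m (begin
      ι (suc m) ℚ.* u (suc m)                              ≡⟨ rec-u (suc m) ⟩
      Σ< (suc m) (λ i → a (suc i) ℚ.* u (suc m ∸ suc i))   ≡⟨ Σ<-ext (suc m) (λ i → cong (a (suc i) ℚ.*_) (earlier (s≤s (ℕP.m∸n≤m m i)))) ⟩
      Σ< (suc m) (λ i → a (suc i) ℚ.* v (suc m ∸ suc i))   ≡⟨ sym (rec-v (suc m)) ⟩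
      ι (suc m) ℚ.* v (suc m)                              ∎)

  ⊛≡∗ : ∀ f g n → (f ⊛ g) n ≡ (f ∗ g) n
  ⊛≡∗ f g n = Σ∈-applyUpTo id (suc n) (λ i → f i ℚ.* g (n ∸ i))

  θ-onePS : ∀ n → θ onePS n ≡ ℚ.0ℚ
  θ-onePS zero    = refl
  θ-onePS (suc n) = ×-zeroʳ (suc n)

  ∸-<-swap : ∀ {n m i} → n ∸ m ℕ.< i → i ℕ.≤ n → n ∸ i ℕ.< m
  ∸-<-swap {n} {zero}  {i} n<i i≤n = contradiction (ℕP.<-≤-trans n<i i≤n) (ℕP.<-irrefl refl)
  ∸-<-swap {n} {suc m} {i} n∸m<i _ = ℕP.m<n+o⇒m∸n<o n i (begin-strict
    n                      ≤⟨ ℕP.m≤n+m∸n n (suc m) ⟩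
    suc m ℕ.+ (n ∸ suc m)  <⟨ ℕP.+-monoʳ-< (suc m) n∸m<i ⟩
    suc m ℕ.+ i            ≡⟨ ℕP.+-comm (suc m) i ⟩
    i ℕ.+ suc m            ∎)
    where open ℕP.≤-Reasoning

  module Powers (G : ℕ → ℚ) (G₀ : G 0 ≡ ℚ.0ℚ) where
    open ≡-Reasoning

    θ-power : ∀ m n → θ (G ^PS suc m) n ≡ suc m × (θ G ∗ (G ^PS m)) n
    θ-power zero n = begin
      n × (G ⊛ onePS) n                     ≡⟨ cong (n ×_) (⊛≡∗ G onePS n) ⟩
      θ (G ∗ onePS) n                       ≡⟨ θ-∗ G onePS n ⟩
      (θ G ∗ onePS) n ℚ.+ (G ∗ θ onePS) n   ≡⟨ cong ((θ G ∗ onePS) n ℚ.+_) (trans (∗-congʳ G n θ-onePS) (Σ<-≡0 (suc n) (λ i _ → ℚP.*-zeroʳ (G i)))) ⟩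
      (θ G ∗ onePS) n ℚ.+ ℚ.0ℚ              ∎
    θ-power (suc m) n = begin
      n × (G ⊛ (G ^PS suc m)) n                                               ≡⟨ cong (n ×_) (⊛≡∗ G (G ^PS suc m) n) ⟩
      θ (G ∗ (G ^PS suc m)) n                                                 ≡⟨ θ-∗ G (G ^PS suc m) n ⟩
      (θ G ∗ (G ^PS suc m)) n ℚ.+ (G ∗ θ (G ^PS suc m)) n                     ≡⟨ cong ((θ G ∗ (G ^PS suc m)) n ℚ.+_) (∗-congʳ G n (θ-power m)) ⟩
      (θ G ∗ (G ^PS suc m)) n ℚ.+ (G ∗ (λ j → suc m × (θ G ∗ (G ^PS m)) j)) n ≡⟨ cong ((θ G ∗ (G ^PS suc m)) n ℚ.+_) (∗-×ʳ G (θ G ∗ (G ^PS m)) (suc m) n) ⟩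
      (θ G ∗ (G ^PS suc m)) n ℚ.+ suc m × (G ∗ (θ G ∗ (G ^PS m))) n           ≡⟨ cong (λ z → (θ G ∗ (G ^PS suc m)) n ℚ.+ suc m × z) shuffle ⟩
      (θ G ∗ (G ^PS suc m)) n ℚ.+ suc m × (θ G ∗ (G ^PS suc m)) n             ∎
      where
      shuffle : (G ∗ (θ G ∗ (G ^PS m))) n ≡ (θ G ∗ (G ^PS suc m)) n
      shuffle = begin
        (G ∗ (θ G ∗ (G ^PS m))) n    ≡⟨ sym (∗-assoc G (θ G) (G ^PS m) n) ⟩
        ((G ∗ θ G) ∗ (G ^PS m)) n    ≡⟨ ∗-congˡ (G ^PS m) n (∗-comm G (θ G)) ⟩
        ((θ G ∗ G) ∗ (G ^PS m)) n    ≡⟨ ∗-assoc (θ G) G (G ^PS m) n ⟩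
        (θ G ∗ (G ∗ (G ^PS m))) n    ≡⟨ ∗-congʳ (θ G) n (λ j → sym (⊛≡∗ G (G ^PS m) j)) ⟩
        (θ G ∗ (G ^PS suc m)) n      ∎

    power-vanishes : ∀ m j → j ℕ.< m → (G ^PS m) j ≡ ℚ.0ℚ
    power-vanishes (suc m) j j<m = trans (⊛≡∗ G (G ^PS m) j) (Σ<-≡0 (suc j) term≡0)
      where
      term≡0 : ∀ i → i ℕ.< suc j → G i ℚ.* (G ^PS m) (j ∸ i) ≡ ℚ.0ℚ
      term≡0 zero    _   = trans (cong (ℚ._* (G ^PS m) j) G₀) (ℚP.*-zeroˡ ((G ^PS m) j))
      term≡0 (suc i) i≤j = trans (cong (G (suc i) ℚ.*_) (power-vanishes m (j ∸ suc i)
                             (ℕP.<-≤-trans (ℕP.∸-monoʳ-< {j} {suc i} {0} (s≤s z≤n) (ℕP.≤-pred i≤j)) (ℕP.≤-pred j<m))))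
                           (ℚP.*-zeroʳ (G (suc i)))

    θG∗power-truncate : ∀ n m → m ℕ.≤ n →
                        Σ< (suc (n ∸ m)) (λ i → θ G i ℚ.* (G ^PS m) (n ∸ i)) ≡ (θ G ∗ (G ^PS m)) n
    θG∗power-truncate n m m≤n = Σ<-extend (λ i → θ G i ℚ.* (G ^PS m) (n ∸ i)) (s≤s (ℕP.m∸n≤m n m)) beyond
      where
      beyond : ∀ i → suc (n ∸ m) ℕ.≤ i → i ℕ.< suc n → θ G i ℚ.* (G ^PS m) (n ∸ i) ≡ ℚ.0ℚ
      beyond i n∸m<i i<1+n = trans (cong (θ G i ℚ.*_) (power-vanishes m (n ∸ i) (∸-<-swap n∸m<i (ℕP.≤-pred i<1+n))))
                                   (ℚP.*-zeroʳ (θ G i))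

    θ-expPS-powers : ∀ n → θ (expPS G) n ≡ Σ< (suc n) (λ m → (θ G ∗ (G ^PS m)) n ℚ.* inv! m)
    θ-expPS-powers n = begin
      n × expPS G n
        ≡⟨ cong (n ×_) (Σ∈-applyUpTo id (suc n) (λ m → (G ^PS m) n ℚ.* inv! m)) ⟩
      n × Σ< (suc n) (λ m → (G ^PS m) n ℚ.* inv! m)
        ≡⟨ ×-Σ< n (suc n) (λ m → (G ^PS m) n ℚ.* inv! m) ⟩
      Σ< (suc n) (λ m → n × ((G ^PS m) n ℚ.* inv! m))
        ≡⟨ Σ<-ext (suc n) (λ m → sym (×-assoc-* n ((G ^PS m) n) (inv! m))) ⟩
      θ onePS n ℚ.* inv! 0 ℚ.+ Σ< n (λ m → θ (G ^PS suc m) n ℚ.* inv! (suc m))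
        ≡⟨ cong₂ ℚ._+_ (trans (cong (ℚ._* inv! 0) (θ-onePS n)) (ℚP.*-zeroˡ (inv! 0)))
                       (Σ<-ext n (λ m → trans (cong (ℚ._* inv! (suc m)) (θ-power m n)) (×-inv! m ((θ G ∗ (G ^PS m)) n)))) ⟩
      ℚ.0ℚ ℚ.+ Σ< n (λ m → (θ G ∗ (G ^PS m)) n ℚ.* inv! m)
        ≡⟨ trans (ℚP.+-identityˡ tail) (sym (ℚP.+-identityʳ tail)) ⟩
      Σ< n (λ m → (θ G ∗ (G ^PS m)) n ℚ.* inv! m) ℚ.+ ℚ.0ℚ
        ≡⟨ cong (Σ< n (λ m → (θ G ∗ (G ^PS m)) n ℚ.* inv! m) ℚ.+_) (sym (trans (cong (ℚ._* inv! n) top≡0) (ℚP.*-zeroˡ (inv! n)))) ⟩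
      Σ< n (λ m → (θ G ∗ (G ^PS m)) n ℚ.* inv! m) ℚ.+ (θ G ∗ (G ^PS n)) n ℚ.* inv! n
        ≡⟨ sym (Σ<-last n (λ m → (θ G ∗ (G ^PS m)) n ℚ.* inv! m)) ⟩
      Σ< (suc n) (λ m → (θ G ∗ (G ^PS m)) n ℚ.* inv! m) ∎
      where
      tail : ℚ
      tail = Σ< n (λ m → (θ G ∗ (G ^PS m)) n ℚ.* inv! m)
      ×-inv! : ∀ m c → (suc m × c) ℚ.* inv! (suc m) ≡ c ℚ.* inv! m
      ×-inv! m c = begin
        (suc m × c) ℚ.* inv! (suc m)        ≡⟨ cong (ℚ._* inv! (suc m)) (trans (×≡ι* (suc m) c) (ℚP.*-comm (ι (suc m)) c)) ⟩
        c ℚ.* ι (suc m) ℚ.* inv! (suc m)    ≡⟨ ℚP.*-assoc c (ι (suc m)) (inv! (suc m)) ⟩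
        c ℚ.* (ι (suc m) ℚ.* inv! (suc m))  ≡⟨ cong (c ℚ.*_) (ι-*-inv! m) ⟩
        c ℚ.* inv! m                        ∎
      top≡0 : (θ G ∗ (G ^PS n)) n ≡ ℚ.0ℚ
      top≡0 = Σ<-≡0 (suc n) term≡0
        where
        term≡0 : ∀ i → i ℕ.< suc n → θ G i ℚ.* (G ^PS n) (n ∸ i) ≡ ℚ.0ℚ
        term≡0 zero    _   = ℚP.*-zeroˡ ((G ^PS n) n)
        term≡0 (suc i) i<n = trans (cong (θ G (suc i) ℚ.*_) (power-vanishes n (n ∸ suc i)
                               (ℕP.∸-monoʳ-< {n} {suc i} {0} (s≤s z≤n) (ℕP.≤-pred i<n)))) (ℚP.*-zeroʳ (θ G (suc i)))

    θ-expPS : ∀ n → θ (expPS G) n ≡ (θ G ∗ expPS G) n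
    θ-expPS n = begin
      θ (expPS G) n
        ≡⟨ θ-expPS-powers n ⟩
      Σ< (suc n) (λ m → (θ G ∗ (G ^PS m)) n ℚ.* inv! m)
        ≡⟨ Σ<-cong (suc n) (λ m m≤n → cong (ℚ._* inv! m) (sym (θG∗power-truncate n m (ℕP.≤-pred m≤n)))) ⟩
      Σ< (suc n) (λ m → Σ< (suc (n ∸ m)) (λ i → θ G i ℚ.* (G ^PS m) (n ∸ i)) ℚ.* inv! m)
        ≡⟨ Σ<-ext (suc n) (λ m → trans (sym (Σ<-*ʳ (suc (n ∸ m)) (inv! m) (λ i → θ G i ℚ.* (G ^PS m) (n ∸ i))))
                                       (Σ<-ext (suc (n ∸ m)) (λ i → ℚP.*-assoc (θ G i) ((G ^PS m) (n ∸ i)) (inv! m)))) ⟩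
      Σ< (suc n) (λ m → Σ< (suc (n ∸ m)) (λ i → θ G i ℚ.* ((G ^PS m) (n ∸ i) ℚ.* inv! m)))
        ≡⟨ sym (Σ<-triangle-swap n (λ i m → θ G i ℚ.* ((G ^PS m) (n ∸ i) ℚ.* inv! m))) ⟩
      Σ< (suc n) (λ i → Σ< (suc (n ∸ i)) (λ m → θ G i ℚ.* ((G ^PS m) (n ∸ i) ℚ.* inv! m)))
        ≡⟨ Σ<-ext (suc n) (λ i → trans (Σ<-*ˡ (suc (n ∸ i)) (θ G i) (λ m → (G ^PS m) (n ∸ i) ℚ.* inv! m))
                                       (cong (θ G i ℚ.*_) (sym (Σ∈-applyUpTo id (suc (n ∸ i)) (λ m → (G ^PS m) (n ∸ i) ℚ.* inv! m))))) ⟩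
      (θ G ∗ expPS G) n ∎

  expPS-recurrence : ∀ G (a : ℕ → ℚ) → G 0 ≡ ℚ.0ℚ → (∀ i → ι (suc i) ℚ.* G (suc i) ≡ a (suc i)) →
                     ∀ n → ι n ℚ.* expPS G n ≡ Σ< n (λ i → a (suc i) ℚ.* expPS G (n ∸ suc i))
  expPS-recurrence G a G₀ weights n = begin
    ι n ℚ.* expPS G n                                  ≡⟨ ×≡ι* n (expPS G n) ⟨
    θ (expPS G) n                                      ≡⟨ Powers.θ-expPS G G₀ n ⟩
    θ G 0 ℚ.* expPS G n ℚ.+ Σ< n (λ i → θ G (suc i) ℚ.* expPS G (n ∸ suc i))
                                                       ≡⟨ cong (ℚ._+ Σ< n (λ i → θ G (suc i) ℚ.* expPS G (n ∸ suc i))) (ℚP.*-zeroˡ (expPS G n)) ⟩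
    ℚ.0ℚ ℚ.+ Σ< n (λ i → θ G (suc i) ℚ.* expPS G (n ∸ suc i))
                                                       ≡⟨ ℚP.+-identityˡ _ ⟩
    Σ< n (λ i → θ G (suc i) ℚ.* expPS G (n ∸ suc i))   ≡⟨ Σ<-ext n (λ i → cong (ℚ._* expPS G (n ∸ suc i)) (trans (×≡ι* (suc i) (G (suc i))) (weights i))) ⟩
    Σ< n (λ i → a (suc i) ℚ.* expPS G (n ∸ suc i))     ∎
    where open ≡-Reasoning

  ι-recurrence : ∀ (a u : ℕ → ℕ) → (∀ n → n ℕ.* u n ≡ ℕSeries.Σ< n (λ i → a (suc i) ℕ.* u (n ∸ suc i))) →
                 ∀ n → ι n ℚ.* ι (u n) ≡ Σ< n (λ i → ι (a (suc i)) ℚ.* ι (u (n ∸ suc i)))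
  ι-recurrence a u rec n = begin
    ι n ℚ.* ι (u n)                                         ≡⟨ ι-* n (u n) ⟨
    ι (n ℕ.* u n)                                           ≡⟨ cong ι (rec n) ⟩
    ι (ℕSeries.Σ< n (λ i → a (suc i) ℕ.* u (n ∸ suc i)))    ≡⟨ ι-Σ< n (λ i → a (suc i) ℕ.* u (n ∸ suc i)) ⟩
    Σ< n (λ i → ι (a (suc i) ℕ.* u (n ∸ suc i)))            ≡⟨ Σ<-ext n (λ i → ι-* (a (suc i)) (u (n ∸ suc i))) ⟩
    Σ< n (λ i → ι (a (suc i)) ℚ.* ι (u (n ∸ suc i)))        ∎
    where open ≡-Reasoning

open import Defs
open import Data.Nat using (ℕ; _≤_; suc)
open import Data.Integer using (+_)
open import Data.Rational using (_/_)
open import Function using (_∘_)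
open import Relation.Binary.PropositionalEquality using (refl)

theorem1p4 : (k ℓ : ℕ) → 1 ≤ k → 1 ≤ ℓ →
    (n : ℕ) → ((+ f₁ k ℓ n) / 1) ≡ expPS (G₁ k ℓ) n
theorem1p4 k ℓ@(suc ℓ′) _ _ =
  recurrence-unique (ι ∘ bridgeCount) (ι ∘ f₁ k ℓ) (expPS (G₁ k ℓ)) refl
    (ι-recurrence bridgeCount (f₁ k ℓ) f₁-recurrence)
    (expPS-recurrence (G₁ k ℓ) (ι ∘ bridgeCount) refl (λ i → ι-*-/ (bridgeCount (suc i)) i))
  where
  open LatticePaths.Segments k ℓ′ using (bridgeCount; f₁-recurrence)
  open Exponential using (ι; ι-*-/; ι-recurrence; expPS-recurrence; recurrence-unique)
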